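{- Let $\alpha\in(0,1)$ be irrational with continued fraction expansion $\alpha=[0;a_1,a_2,a_3,\dots]$ and convergent denominators $q_n$ (with $q_{ -1}=0$, $q_0=1$, $q_n=a_nq_{n-1}+q_{n-2}$), and set $a_0=0$. Let $\mathfrak{Q}$ be the increasing sequence consisting of $1$ and of all points of discontinuity of the function $\psi^{[2]}_\alpha$ defined in the context. Replace the partial quotients $a_1,a_2,\dots$, in their order, by blocks of integers according to the following rules: 1. each $a_n\ge 3$ is replaced by the successive numbers $q_{n-2}+q_{n-1},\ 2q_{n-1},\ q_n-q_{n-1}$; 2. each $a_n=2$ is replaced by the single number $q_n-q_{n-1}$; 3. if $a_{n-1}\neq 1$, $a_n=1$, $a_{n+1}\ge 2$, then $a_n=1$ is replaced by the single number $q_{n-2}+q_n=2q_{n-2}+q_{n-1}$; 4. if $r\ge 2$ and $a_{n-1}\ne 1$, $a_n=\dots=a_{n+r-1}=1$, $a_{n+r}\ge 2$, then the elements $a_n,\dots,a_{n+r-1}$ are replaced by the successive numbers $2q_{n-2}+q_{n-1},\ 2q_{n-1},\ 2q_n,\ \dots,\ 2q_{n+r-2},\ 2q_{n+r-3}+q_{n+r-2}$; 5. if $a_{n-1}\ne 1$ and $a_j=1$ for all $j\ge n$, then the elements $a_n,a_{n+1},\dots$ are replaced by the numbers $2q_{n-2}+q_{n-1},\ 2q_{n-1},\ 2q_n,\ 2q_{n+1},\dots$. Then the sequence obtained by concatenating these blocks (a value occurring several times in succession being recorded only once) is exactly the sequence $\mathfrak{Q}$.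
   Context: For real $x$, $\|x\|$ denotes the distance from $x$ to the nearest integer. For $n\ge 0$, $p_n/q_n=[0;a_1,\dots,a_n]$ in lowest terms with $q_n>0$ are the convergents of $\alpha$; also $p_{ -1}=1,q_{ -1}=0$, $p_0=0,q_0=1$. For $t\ge 1$ define $\psi^{[2]}_\alpha(t)=\min\{|q\alpha-p| : p,q\in\mathbb{Z},\ 1\le q\le t,\ (p,q)\ne(p_n,q_n)\ \text{for all } n\ge 0\}$. This function is piecewise constant in $t$; its points of discontinuity are integers. The sequence $\mathfrak{Q}:\ \mathfrak{q}_1=1<\mathfrak{q}_2<\mathfrak{q}_3<\dots$ consists of $1$ and the points of discontinuity of $\psi^{[2]}_\alpha$, in increasing order. -}

module Defs where

open import Data.Nat using (ℕ; zero; suc; _+_; _*_; _∸_; _≤_; _<_)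
import Data.Nat as ℕ
open import Data.Integer as ℤ using (ℤ; +_; -[1+_]; -_)
open import Data.Bool using (Bool; true; false)
open import Data.List using (List; []; _∷_; concat; map; upTo; length; derun)
open import Data.Product using (Σ; ∃; _×_; _,_)
open import Data.Sum using (_⊎_)
open import Relation.Nullary using (¬_)
open import Relation.Binary.PropositionalEquality using (_≡_)

-- Partial quotients: a : ℕ → ℕ, a n = a_n (a 0 = a_0 = 0, a n ≥ 1 for n ≥ 1).

-- Shifted convergent denominators / numerators: qq k = q_{k-1}, pp k = p_{k-1}.
-- qq 0 = q_{-1} = 0, qq 1 = q_0 = 1, q_n = a_n q_{n-1} + q_{n-2}.
qq : (ℕ → ℕ) → ℕ → ℕ
qq a zero = 0
qq a (suc zero) = 1
qq a (suc (suc k)) = a (suc k) * qq a (suc k) + qq a k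

pp : (ℕ → ℕ) → ℕ → ℕ
pp a zero = 1
pp a (suc zero) = 0
pp a (suc (suc k)) = a (suc k) * pp a (suc k) + pp a k

-- The real α = [0; a_1, a_2, ...] is represented through its Dedekind cut,
-- determined by the convergents: even convergents increase to α, odd
-- convergents decrease to α.

-- α > d / c  (c > 0):  d/c ≤ p_{2k}/q_{2k} for some k.
AlphaAbove : (ℕ → ℕ) → ℤ → ℕ → Set
AlphaAbove a d c = ∃ λ k → d ℤ.* (+ qq a (suc (2 * k))) ℤ.≤ (+ pp a (suc (2 * k))) ℤ.* (+ c)

-- α < d / c  (c > 0):  p_{2k+1}/q_{2k+1} ≤ d/c for some k.
AlphaBelow : (ℕ → ℕ) → ℤ → ℕ → Set
AlphaBelow a d c = ∃ λ k → (+ pp a (suc (suc (2 * k)))) ℤ.* (+ c) ℤ.≤ d ℤ.* (+ qq a (suc (suc (2 * k))))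

-- Pos a c d  means  c α - d > 0.
Pos : (ℕ → ℕ) → ℤ → ℤ → Set
Pos a (+ zero) d = d ℤ.< + 0
Pos a (+ (suc m)) d = AlphaAbove a d (suc m)
Pos a (-[1+ m ]) d = AlphaBelow a (- d) (suc m)

-- Closer a q p q' p'  means  |q α - p| < |q' α - p'|.
-- (|x| < |y|  iff  (y - x > 0 or -y - x > 0) and (y + x > 0 or x - y > 0).)
Closer : (ℕ → ℕ) → ℤ → ℤ → ℤ → ℤ → Set
Closer a q p q' p' =
  (Pos a (q' ℤ.- q) (p' ℤ.- p) ⊎ Pos a (- q' ℤ.- q) (- p' ℤ.- p)) ×
  (Pos a (q' ℤ.+ q) (p' ℤ.+ p) ⊎ Pos a (q ℤ.- q') (p ℤ.- p'))

IsConvergent : (ℕ → ℕ) → ℤ → ℕ → Set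
IsConvergent a p q = ∃ λ n → (p ≡ + pp a (suc n)) × (q ≡ qq a (suc n))

-- t ≥ 2 is a point of discontinuity of ψ^[2]_α :  ψ(t) < ψ(t-1), i.e. some
-- non-convergent (p , t) is strictly closer than every non-convergent (p', q')
-- with 1 ≤ q' < t (the minimum defining ψ(t-1) is attained).
IsDiscontinuity : (ℕ → ℕ) → ℕ → Set
IsDiscontinuity a t =
  2 ≤ t × (Σ ℤ λ p → ¬ IsConvergent a p t ×
    ((q' : ℕ) (p' : ℤ) → 1 ≤ q' → q' < t → ¬ IsConvergent a p' q' →
       Closer a (+ t) p (+ q') p'))

InQ : (ℕ → ℕ) → ℕ → Set
InQ a t = (t ≡ 1) ⊎ IsDiscontinuity a t

IsIncreasingEnumeration : (ℕ → Set) → (ℕ → ℕ) → Set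
IsIncreasingEnumeration S Q =
  ((i : ℕ) → Q i < Q (suc i)) ×
  ((x : ℕ) → (S x → ∃ λ i → Q i ≡ x) × ((∃ λ i → Q i ≡ x) → S x))

isOne : ℕ → Bool
isOne (suc zero) = true
isOne _ = false

-- Contribution of a_n = 1 to the block of a maximal run of 1's
-- (rules 3, 4, 5). First argument: isOne a_{n-1} (false = n starts the run);
-- second argument: isOne a_{n+1} (false = n ends the run);
-- qm2 = q_{n-2}, qm1 = q_{n-1}.
onesBlock : Bool → Bool → ℕ → ℕ → List ℕ
onesBlock false false qm2 qm1 = 2 * qm2 + qm1 ∷ []                 -- rule 3
onesBlock false true  qm2 qm1 = 2 * qm2 + qm1 ∷ 2 * qm1 ∷ []       -- start of rule 4/5 run
onesBlock true  true  qm2 qm1 = 2 * qm1 ∷ []                       -- interior of run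
onesBlock true  false qm2 qm1 = 2 * qm1 ∷ 2 * qm2 + qm1 ∷ []       -- end of rule 4 run

-- Block replacing a_n (n = suc m), given A = a_n.
blockAux : (ℕ → ℕ) → ℕ → ℕ → List ℕ
blockAux a m zero = []   -- impossible since a_n ≥ 1
blockAux a m (suc zero) =
  onesBlock (isOne (a m)) (isOne (a (suc (suc m)))) (qq a m) (qq a (suc m))
blockAux a m (suc (suc zero)) = qq a (suc (suc m)) ∸ qq a (suc m) ∷ []   -- rule 2
blockAux a m (suc (suc (suc _))) =                                       -- rule 1
  qq a m + qq a (suc m) ∷ 2 * qq a (suc m) ∷ qq a (suc (suc m)) ∸ qq a (suc m) ∷ []

block : (ℕ → ℕ) → ℕ → List ℕ
block a m = blockAux a m (a (suc m))

word : (ℕ → ℕ) → ℕ → List ℕ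
word a N = derun ℕ._≟_ (concat (map (block a) (upTo N)))

module Submission where

-- α enters only through its convergents: c α - d has, for all large K, the sign of
-- c p_K - d q_K, so every comparison |q α - p| < |q′ α - p′| is decided by integers.
-- In the basis formed by two consecutive convergents a point (q , p) has integer
-- coordinates (x , y), and |q α - p| becomes proportional to |x δ₀ - y δ₁|, where
-- δ₀ = a δ₁ + δ₂ and δ₀ > δ₁ > δ₂ > 0 play the roles of ‖q_{L-1} α‖, ‖q_L α‖ and
-- ‖q_{L+1} α‖. For every two successive entries u , w of the block sequence, a case
-- analysis on the signs of the coordinates of the points of denominator below w shows
-- that w beats all the non-convergents among them while u is the best of them; so u
-- and w are successive points of 𝔔. Removing repetitions commutes with appending
-- blocks and the words grow without bound, hence they are the prefixes of one
-- increasing sequence, which therefore enumerates 𝔔.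

open import Defs
open import Data.Nat as ℕ using (ℕ; zero; suc; _+_; _*_; _∸_; _≤_; _<_; z≤n; s≤s)
import Data.Nat.Properties as ℕₚ
open import Data.Nat.Tactic.RingSolver using (solve) renaming (solve-∀ to ℕ-solve-∀)
open import Data.Integer as ℤ using (ℤ; +_; -[1+_]; -_; ∣_∣; +[1+_]; 0ℤ; 1ℤ; -1ℤ)
  renaming (_+_ to _+ᶻ_; _*_ to _*ᶻ_; _-_ to _-ᶻ_; _≤_ to _≤ᶻ_; _<_ to _<ᶻ_)
import Data.Integer.Properties as ℤₚ
open import Data.Integer.Tactic.RingSolver using (solve-∀)
open import Data.Bool using (Bool; true; false)
open import Data.Product using (Σ; ∃; _×_; _,_; proj₁; proj₂)
open import Data.Sum using (_⊎_; inj₁; inj₂)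
import Data.Sum
open import Data.Empty using (⊥; ⊥-elim)
open import Data.List using (List; []; _∷_; _++_; derun; length; map; upTo; applyUpTo; concat; _∷ʳ_)
import Data.List
import Data.List.Properties as Listₚ
open import Data.Maybe using (just)
open import Data.Maybe.Properties using (just-injective)
open import Relation.Nullary using (¬_; yes; no)
open import Relation.Binary.Definitions using (DecidableEquality)
open import Relation.Binary.PropositionalEquality hiding (J)

+-linear : ∀ A x y → + (A * x + y) ≡ + A *ᶻ + x +ᶻ + y
+-linear A x y = trans (ℤₚ.pos-+ (A * x) y) (cong (_+ᶻ + y) (ℤₚ.pos-* A x))

0<j-i⇒i<j : ∀ {i j} → 0ℤ <ᶻ j -ᶻ i → i <ᶻ j
0<j-i⇒i<j {i} {j} h = subst₂ _<ᶻ_ (ℤₚ.+-identityˡ i) (cancel j i) (ℤₚ.+-monoˡ-< i h)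
  where
  cancel : ∀ (j i : ℤ) → (j -ᶻ i) +ᶻ i ≡ j
  cancel = solve-∀

i<j⇒0<j-i : ∀ {i j} → i <ᶻ j → 0ℤ <ᶻ j -ᶻ i
i<j⇒0<j-i {i} {j} h = subst (_<ᶻ j -ᶻ i) (ℤₚ.+-inverseʳ i) (ℤₚ.+-monoˡ-< (- i) h)

<∧-<⇒∣∣< : ∀ i j → i <ᶻ j → - i <ᶻ j → ∣ i ∣ < ∣ j ∣
<∧-<⇒∣∣< (+ n) (+ m) i<j _ = ℤₚ.drop‿+<+ i<j
<∧-<⇒∣∣< -[1+ n ] (+ m) _ -i<j = ℤₚ.drop‿+<+ -i<j

∣∣<⇒<∧-< : ∀ i j → ∣ i ∣ < ∣ j ∣ → 0ℤ <ᶻ j → i <ᶻ j × - i <ᶻ j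
∣∣<⇒<∧-< (+ zero) (+ m) _ 0<j = 0<j , 0<j
∣∣<⇒<∧-< +[1+ n ] (+ m) h _ = ℤ.+<+ h , ℤ.-<+
∣∣<⇒<∧-< -[1+ n ] (+ m) h _ = ℤ.-<+ , ℤ.+<+ h

0<j+i⇒-i<j : ∀ {i j} → 0ℤ <ᶻ j +ᶻ i → - i <ᶻ j
0<j+i⇒-i<j {i} {j} h = 0<j-i⇒i<j (subst (0ℤ <ᶻ_) (identity j i) h)
  where
  identity : ∀ (j i : ℤ) → j +ᶻ i ≡ j -ᶻ (- i)
  identity = solve-∀

-- |i| < |j| written as the conjunction of two disjunctions of positivity
-- conditions, the shape in which Closer unfolds.
∣∣<-from-signs : ∀ i j → (0ℤ <ᶻ j -ᶻ i ⊎ 0ℤ <ᶻ - j -ᶻ i) → (0ℤ <ᶻ j +ᶻ i ⊎ 0ℤ <ᶻ i -ᶻ j) → ∣ i ∣ < ∣ j ∣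
∣∣<-from-signs i j (inj₁ i<j) (inj₁ -i<j) = <∧-<⇒∣∣< i j (0<j-i⇒i<j i<j) (0<j+i⇒-i<j -i<j)
∣∣<-from-signs i j (inj₁ i<j) (inj₂ j<i) = ⊥-elim (ℤₚ.<-asym (0<j-i⇒i<j {i} {j} i<j) (0<j-i⇒i<j j<i))
∣∣<-from-signs i j (inj₂ i<-j) (inj₁ -i<j) = ⊥-elim (ℤₚ.<-asym (0<j-i⇒i<j i<-j)
  (subst (- j <ᶻ_) (ℤₚ.neg-involutive i) (ℤₚ.neg-mono-< (0<j+i⇒-i<j -i<j))))
∣∣<-from-signs i j (inj₂ i<-j) (inj₂ j<i) =
  subst (∣ i ∣ <_) (ℤₚ.∣-i∣≡∣i∣ j) (<∧-<⇒∣∣< i (- j) (0<j-i⇒i<j i<-j) (ℤₚ.neg-mono-< (0<j-i⇒i<j j<i)))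

-- Convergents and the signs of linear forms in α

-- ε J = (-1) ^ (J + 1), the sign of q_{J-1} α - p_{J-1}.
ε : ℕ → ℤ
ε zero = -1ℤ
ε (suc zero) = 1ℤ
ε (suc (suc J)) = ε J

ε-suc : ∀ J → ε (suc J) ≡ - ε J
ε-suc zero = refl
ε-suc (suc zero) = refl
ε-suc (suc (suc J)) = ε-suc J

ε*ε≡1 : ∀ J → ε J *ᶻ ε J ≡ 1ℤ
ε*ε≡1 zero = refl
ε*ε≡1 (suc zero) = refl
ε*ε≡1 (suc (suc J)) = ε*ε≡1 J

∣ε∣≡1 : ∀ J → ∣ ε J ∣ ≡ 1
∣ε∣≡1 zero = refl
∣ε∣≡1 (suc zero) = refl
∣ε∣≡1 (suc (suc J)) = ∣ε∣≡1 J

∣ε*i∣≡∣i∣ : ∀ J i → ∣ ε J *ᶻ i ∣ ≡ ∣ i ∣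
∣ε*i∣≡∣i∣ J i = trans (ℤₚ.abs-* (ε J) i) (trans (cong (ℕ._* ∣ i ∣) (∣ε∣≡1 J)) (ℕₚ.*-identityˡ ∣ i ∣))

ε-odd : ∀ k → ε (suc (2 * k)) ≡ 1ℤ
ε-odd zero = refl
ε-odd (suc k) rewrite ℕₚ.+-suc k (k + 0) = ε-odd k

ε-even : ∀ k → ε (suc (suc (2 * k))) ≡ -1ℤ
ε-even zero = refl
ε-even (suc k) rewrite ℕₚ.+-suc k (k + 0) = ε-even k

Eventually : (ℕ → Set) → Set
Eventually R = Σ ℕ λ K₀ → ∀ K → K₀ ≤ K → R K

eventually-zip : ∀ {R S T : ℕ → Set} → Eventually R → Eventually S → (∀ K → R K → S K → T K) → Eventually T
eventually-zip (K₁ , r) (K₂ , s) g =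
  K₁ + K₂ , λ K h → g K (r K (ℕₚ.≤-trans (ℕₚ.m≤m+n K₁ K₂) h)) (s K (ℕₚ.≤-trans (ℕₚ.m≤n+m K₂ K₁) h))

eventually-map : ∀ {R S : ℕ → Set} → Eventually R → (∀ K → R K → S K) → Eventually S
eventually-map (K₀ , r) g = K₀ , λ K h → g K (r K h)

eventually-witness : ∀ {R : ℕ → Set} → Eventually R → Σ ℕ R
eventually-witness (K₀ , r) = K₀ , r K₀ ℕₚ.≤-refl

-- Indices are shifted by one throughout: Q J = q_{J-1} and P J = p_{J-1}.
module Convergents (a : ℕ → ℕ) where

  Q P : ℕ → ℕ
  Q = qq a
  P = pp a

  Qᶻ Pᶻ : ℕ → ℤ
  Qᶻ J = + Q J
  Pᶻ J = + P J

  Qᶻ-rec : ∀ k → Qᶻ (suc (suc k)) ≡ + a (suc k) *ᶻ Qᶻ (suc k) +ᶻ Qᶻ k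
  Qᶻ-rec k = +-linear (a (suc k)) (Q (suc k)) (Q k)

  Pᶻ-rec : ∀ k → Pᶻ (suc (suc k)) ≡ + a (suc k) *ᶻ Pᶻ (suc k) +ᶻ Pᶻ k
  Pᶻ-rec k = +-linear (a (suc k)) (P (suc k)) (P k)

  -- form K c d = Q K (c (P K / Q K) - d): for large K its sign is that of c α - d.
  form : ℕ → ℤ → ℤ → ℤ
  form K c d = c *ᶻ Pᶻ K -ᶻ d *ᶻ Qᶻ K

  form-neg : ∀ K c d → form K (- c) (- d) ≡ - form K c d
  form-neg K c d = identity c d (Pᶻ K) (Qᶻ K)
    where
    identity : ∀ (c d p q : ℤ) → (- c) *ᶻ p -ᶻ (- d) *ᶻ q ≡ - (c *ᶻ p -ᶻ d *ᶻ q)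
    identity = solve-∀

  Δ : ℕ → ℕ → ℤ
  Δ J K = form K (Qᶻ J) (Pᶻ J)

  Δ-diag : ∀ J → Δ J J ≡ 0ℤ
  Δ-diag J = identity (Qᶻ J) (Pᶻ J)
    where
    identity : ∀ (q p : ℤ) → q *ᶻ p -ᶻ p *ᶻ q ≡ 0ℤ
    identity = solve-∀

  Δ-adjacent : ∀ J → Δ J (suc J) ≡ ε J
  Δ-adjacent zero = refl
  Δ-adjacent (suc J) = begin
      Qᶻ (suc J) *ᶻ Pᶻ (suc (suc J)) -ᶻ Pᶻ (suc J) *ᶻ Qᶻ (suc (suc J))
    ≡⟨ cong₂ (λ p q → Qᶻ (suc J) *ᶻ p -ᶻ Pᶻ (suc J) *ᶻ q) (Pᶻ-rec J) (Qᶻ-rec J) ⟩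
      Qᶻ (suc J) *ᶻ (A *ᶻ Pᶻ (suc J) +ᶻ Pᶻ J) -ᶻ Pᶻ (suc J) *ᶻ (A *ᶻ Qᶻ (suc J) +ᶻ Qᶻ J)
    ≡⟨ identity (Qᶻ (suc J)) (Pᶻ (suc J)) A (Pᶻ J) (Qᶻ J) ⟩
      - Δ J (suc J)
    ≡⟨ cong -_ (Δ-adjacent J) ⟩
      - ε J
    ≡⟨ ε-suc J ⟨
      ε (suc J) ∎
    where
    open ≡-Reasoning
    A = + a (suc J)
    identity : ∀ (q₁ p₁ A p₀ q₀ : ℤ) → q₁ *ᶻ (A *ᶻ p₁ +ᶻ p₀) -ᶻ p₁ *ᶻ (A *ᶻ q₁ +ᶻ q₀) ≡ - (q₀ *ᶻ p₁ -ᶻ p₀ *ᶻ q₁)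
    identity = solve-∀

  form-rec : ∀ K c d → form (suc (suc K)) c d ≡ + a (suc K) *ᶻ form (suc K) c d +ᶻ form K c d
  form-rec K c d = begin
      c *ᶻ Pᶻ (suc (suc K)) -ᶻ d *ᶻ Qᶻ (suc (suc K))
    ≡⟨ cong₂ (λ p q → c *ᶻ p -ᶻ d *ᶻ q) (Pᶻ-rec K) (Qᶻ-rec K) ⟩
      c *ᶻ (A *ᶻ Pᶻ (suc K) +ᶻ Pᶻ K) -ᶻ d *ᶻ (A *ᶻ Qᶻ (suc K) +ᶻ Qᶻ K)
    ≡⟨ identity c d A (Pᶻ (suc K)) (Pᶻ K) (Qᶻ (suc K)) (Qᶻ K) ⟩
      A *ᶻ form (suc K) c d +ᶻ form K c d ∎
    where
    open ≡-Reasoning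
    A = + a (suc K)
    identity : ∀ (c d A p₁ p₀ q₁ q₀ : ℤ) →
      c *ᶻ (A *ᶻ p₁ +ᶻ p₀) -ᶻ d *ᶻ (A *ᶻ q₁ +ᶻ q₀) ≡ A *ᶻ (c *ᶻ p₁ -ᶻ d *ᶻ q₁) +ᶻ (c *ᶻ p₀ -ᶻ d *ᶻ q₀)
    identity = solve-∀

  Δ-recˡ : ∀ J K → Δ (suc (suc J)) K ≡ + a (suc J) *ᶻ Δ (suc J) K +ᶻ Δ J K
  Δ-recˡ J K = begin
      Qᶻ (suc (suc J)) *ᶻ Pᶻ K -ᶻ Pᶻ (suc (suc J)) *ᶻ Qᶻ K
    ≡⟨ cong₂ (λ q p → q *ᶻ Pᶻ K -ᶻ p *ᶻ Qᶻ K) (Qᶻ-rec J) (Pᶻ-rec J) ⟩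
      (A *ᶻ Qᶻ (suc J) +ᶻ Qᶻ J) *ᶻ Pᶻ K -ᶻ (A *ᶻ Pᶻ (suc J) +ᶻ Pᶻ J) *ᶻ Qᶻ K
    ≡⟨ identity A (Qᶻ (suc J)) (Qᶻ J) (Pᶻ (suc J)) (Pᶻ J) (Pᶻ K) (Qᶻ K) ⟩
      A *ᶻ Δ (suc J) K +ᶻ Δ J K ∎
    where
    open ≡-Reasoning
    A = + a (suc J)
    identity : ∀ (A q₁ q₀ p₁ p₀ p q : ℤ) →
      (A *ᶻ q₁ +ᶻ q₀) *ᶻ p -ᶻ (A *ᶻ p₁ +ᶻ p₀) *ᶻ q ≡ A *ᶻ (q₁ *ᶻ p -ᶻ p₁ *ᶻ q) +ᶻ (q₀ *ᶻ p -ᶻ p₀ *ᶻ q)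
    identity = solve-∀

  -- The denominator of [0; a_{J+1}, ..., a_{J+d-1}].
  continuant : ℕ → ℕ → ℕ
  continuant J zero = 0
  continuant J (suc zero) = 1
  continuant J (suc (suc d)) = a (suc (d + J)) * continuant J (suc d) + continuant J d

  Δ≡ε*continuant : ∀ J d → Δ J (d + J) ≡ ε J *ᶻ + continuant J d
  Δ≡ε*continuant J zero = trans (Δ-diag J) (sym (ℤₚ.*-zeroʳ (ε J)))
  Δ≡ε*continuant J (suc zero) = trans (Δ-adjacent J) (sym (ℤₚ.*-identityʳ (ε J)))
  Δ≡ε*continuant J (suc (suc d)) = begin
      Δ J (suc (suc (d + J)))
    ≡⟨ form-rec (d + J) (Qᶻ J) (Pᶻ J) ⟩
      A *ᶻ Δ J (suc d + J) +ᶻ Δ J (d + J)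
    ≡⟨ cong₂ (λ u v → A *ᶻ u +ᶻ v) (Δ≡ε*continuant J (suc d)) (Δ≡ε*continuant J d) ⟩
      A *ᶻ (ε J *ᶻ + continuant J (suc d)) +ᶻ ε J *ᶻ + continuant J d
    ≡⟨ identity A (ε J) (+ continuant J (suc d)) (+ continuant J d) ⟩
      ε J *ᶻ (A *ᶻ + continuant J (suc d) +ᶻ + continuant J d)
    ≡⟨ cong (ε J *ᶻ_) (+-linear (a (suc (d + J))) (continuant J (suc d)) (continuant J d)) ⟨
      ε J *ᶻ + continuant J (suc (suc d)) ∎
    where
    open ≡-Reasoning
    A = + a (suc (d + J))
    identity : ∀ (A s c₁ c₀ : ℤ) → A *ᶻ (s *ᶻ c₁) +ᶻ s *ᶻ c₀ ≡ s *ᶻ (A *ᶻ c₁ +ᶻ c₀)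
    identity = solve-∀

  -- δ J K / Q K is |q_{J-1} α - p_{J-1}| with α replaced by P K / Q K.
  δ : ℕ → ℕ → ℕ
  δ J K = ∣ Δ J K ∣

  δ≡continuant : ∀ J d → δ J (d + J) ≡ continuant J d
  δ≡continuant J d = trans (cong ∣_∣ (Δ≡ε*continuant J d)) (∣ε*i∣≡∣i∣ J (+ continuant J d))

  Δ≡ε*δ : ∀ J K → J ≤ K → Δ J K ≡ ε J *ᶻ + δ J K
  Δ≡ε*δ J K J≤K with d ← K ∸ J | refl ← sym (ℕₚ.m∸n+n≡m J≤K) =
    trans (Δ≡ε*continuant J d) (cong (λ c → ε J *ᶻ + c) (sym (δ≡continuant J d)))

  δ-rec : ∀ J K → suc (suc J) ≤ K → δ J K ≡ a (suc J) * δ (suc J) K + δ (suc (suc J)) K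
  δ-rec J K h = ℤₚ.+-injective (begin
      + δ J K
    ≡⟨ ε-signed J (ℕₚ.≤-trans (ℕₚ.n≤1+n J) J+1≤K) ⟨
      ε J *ᶻ Δ J K
    ≡⟨ cong (ε J *ᶻ_) (identity (Δ (suc (suc J)) K) A (Δ (suc J) K) (Δ J K) (Δ-recˡ J K)) ⟩
      ε J *ᶻ (Δ (suc (suc J)) K -ᶻ A *ᶻ Δ (suc J) K)
    ≡⟨ distribute (ε J) (Δ (suc (suc J)) K) A (Δ (suc J) K) ⟩
      ε (suc (suc J)) *ᶻ Δ (suc (suc J)) K +ᶻ A *ᶻ (- ε J *ᶻ Δ (suc J) K)
    ≡⟨ cong₂ (λ u s → u +ᶻ A *ᶻ (s *ᶻ Δ (suc J) K)) (ε-signed (suc (suc J)) h) (sym (ε-suc J)) ⟩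
      + δ (suc (suc J)) K +ᶻ A *ᶻ (ε (suc J) *ᶻ Δ (suc J) K)
    ≡⟨ cong (λ u → + δ (suc (suc J)) K +ᶻ A *ᶻ u) (ε-signed (suc J) J+1≤K) ⟩
      + δ (suc (suc J)) K +ᶻ A *ᶻ + δ (suc J) K
    ≡⟨ ℤₚ.+-comm (+ δ (suc (suc J)) K) (A *ᶻ + δ (suc J) K) ⟩
      A *ᶻ + δ (suc J) K +ᶻ + δ (suc (suc J)) K
    ≡⟨ +-linear (a (suc J)) (δ (suc J) K) (δ (suc (suc J)) K) ⟨
      + (a (suc J) * δ (suc J) K + δ (suc (suc J)) K) ∎)
    where
    open ≡-Reasoning
    A = + a (suc J)
    J+1≤K = ℕₚ.≤-trans (ℕₚ.n≤1+n (suc J)) h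
    ε-signed : ∀ I → I ≤ K → ε I *ᶻ Δ I K ≡ + δ I K
    ε-signed I I≤K = begin
        ε I *ᶻ Δ I K             ≡⟨ cong (ε I *ᶻ_) (Δ≡ε*δ I K I≤K) ⟩
        ε I *ᶻ (ε I *ᶻ + δ I K)  ≡⟨ ℤₚ.*-assoc (ε I) (ε I) (+ δ I K) ⟨
        (ε I *ᶻ ε I) *ᶻ + δ I K  ≡⟨ cong (_*ᶻ + δ I K) (ε*ε≡1 I) ⟩
        1ℤ *ᶻ + δ I K            ≡⟨ ℤₚ.*-identityˡ (+ δ I K) ⟩
        + δ I K                  ∎
    identity : ∀ (x A y z : ℤ) → x ≡ A *ᶻ y +ᶻ z → z ≡ x -ᶻ A *ᶻ y
    identity x A y z refl = sym (cancel A y z)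
      where
      cancel : ∀ (A y z : ℤ) → (A *ᶻ y +ᶻ z) -ᶻ A *ᶻ y ≡ z
      cancel = solve-∀
    distribute : ∀ (s x A y : ℤ) → s *ᶻ (x -ᶻ A *ᶻ y) ≡ s *ᶻ x +ᶻ A *ᶻ (- s *ᶻ y)
    distribute = solve-∀

  -- For K > J the sign of form K c d is governed by form J c d and by c * Δ J K.
  form-transfer : ∀ J K c d → Qᶻ J *ᶻ form K c d ≡ Qᶻ K *ᶻ form J c d +ᶻ c *ᶻ Δ J K
  form-transfer J K c d = identity (Qᶻ J) (Qᶻ K) (Pᶻ J) (Pᶻ K) c d
    where
    identity : ∀ (qJ qK pJ pK c d : ℤ) →
      qJ *ᶻ (c *ᶻ pK -ᶻ d *ᶻ qK) ≡ qK *ᶻ (c *ᶻ pJ -ᶻ d *ᶻ qJ) +ᶻ c *ᶻ (qJ *ᶻ pK -ᶻ pJ *ᶻ qK)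
    identity = solve-∀

  qOf pOf : ℕ → ℤ → ℤ → ℤ
  qOf L x y = x *ᶻ Qᶻ L +ᶻ y *ᶻ Qᶻ (suc L)
  pOf L x y = x *ᶻ Pᶻ L +ᶻ y *ᶻ Pᶻ (suc L)

  -- Two consecutive convergents form a basis of ℤ² since Δ L (suc L) = ± 1.
  coordinates : ∀ L q p → Σ ℤ λ x → Σ ℤ λ y → q ≡ qOf L x y × p ≡ pOf L x y
  coordinates L q p = x , y , solve-for q (expand-q (ε L) q p (Qᶻ L) (Pᶻ L) (Qᶻ (suc L)) (Pᶻ (suc L)))
                            , solve-for p (expand-p (ε L) q p (Qᶻ L) (Pᶻ L) (Qᶻ (suc L)) (Pᶻ (suc L)))
    where
    x = ε L *ᶻ (q *ᶻ Pᶻ (suc L) -ᶻ p *ᶻ Qᶻ (suc L))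
    y = ε L *ᶻ (p *ᶻ Qᶻ L -ᶻ q *ᶻ Pᶻ L)
    solve-for : ∀ {r} z → r ≡ ε L *ᶻ (z *ᶻ Δ L (suc L)) → z ≡ r
    solve-for {r} z r≡ = sym (begin
      r                               ≡⟨ r≡ ⟩
      ε L *ᶻ (z *ᶻ Δ L (suc L))        ≡⟨ cong (λ s → ε L *ᶻ (z *ᶻ s)) (Δ-adjacent L) ⟩
      ε L *ᶻ (z *ᶻ ε L)               ≡⟨ regroup (ε L) z ⟩
      z *ᶻ (ε L *ᶻ ε L)               ≡⟨ cong (z *ᶻ_) (ε*ε≡1 L) ⟩
      z *ᶻ 1ℤ                         ≡⟨ ℤₚ.*-identityʳ z ⟩
      z                               ∎)
      where
      open ≡-Reasoning
      regroup : ∀ (s z : ℤ) → s *ᶻ (z *ᶻ s) ≡ z *ᶻ (s *ᶻ s)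
      regroup = solve-∀
    expand-q : ∀ (s q p Q₀ P₀ Q₁ P₁ : ℤ) →
      (s *ᶻ (q *ᶻ P₁ -ᶻ p *ᶻ Q₁)) *ᶻ Q₀ +ᶻ (s *ᶻ (p *ᶻ Q₀ -ᶻ q *ᶻ P₀)) *ᶻ Q₁ ≡ s *ᶻ (q *ᶻ (Q₀ *ᶻ P₁ -ᶻ P₀ *ᶻ Q₁))
    expand-q = solve-∀
    expand-p : ∀ (s q p Q₀ P₀ Q₁ P₁ : ℤ) →
      (s *ᶻ (q *ᶻ P₁ -ᶻ p *ᶻ Q₁)) *ᶻ P₀ +ᶻ (s *ᶻ (p *ᶻ Q₀ -ᶻ q *ᶻ P₀)) *ᶻ P₁ ≡ s *ᶻ (p *ᶻ (Q₀ *ᶻ P₁ -ᶻ P₀ *ᶻ Q₁))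
    expand-p = solve-∀

  -- gap L K x y / Q K is |q α - p|, for the point with coordinates (x , y), with α
  -- replaced by P K / Q K.
  gap : ℕ → ℕ → ℤ → ℤ → ℕ
  gap L K x y = ∣ x *ᶻ + δ L K -ᶻ y *ᶻ + δ (suc L) K ∣

  ∣form∣-in-coordinates : ∀ L K x y → suc L ≤ K → ∣ form K (qOf L x y) (pOf L x y) ∣ ≡ gap L K x y
  ∣form∣-in-coordinates L K x y L<K = begin
      ∣ form K (qOf L x y) (pOf L x y) ∣
    ≡⟨ cong ∣_∣ (linear x y (Qᶻ L) (Pᶻ L) (Qᶻ (suc L)) (Pᶻ (suc L)) (Pᶻ K) (Qᶻ K)) ⟩
      ∣ x *ᶻ Δ L K +ᶻ y *ᶻ Δ (suc L) K ∣
    ≡⟨ cong₂ (λ u v → ∣ x *ᶻ u +ᶻ y *ᶻ v ∣) (Δ≡ε*δ L K (ℕₚ.≤-trans (ℕₚ.n≤1+n L) L<K))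
        (trans (Δ≡ε*δ (suc L) K L<K) (cong (_*ᶻ + δ (suc L) K) (ε-suc L))) ⟩
      ∣ x *ᶻ (ε L *ᶻ + δ L K) +ᶻ y *ᶻ (- ε L *ᶻ + δ (suc L) K) ∣
    ≡⟨ cong ∣_∣ (factor x y (ε L) (+ δ L K) (+ δ (suc L) K)) ⟩
      ∣ ε L *ᶻ (x *ᶻ + δ L K -ᶻ y *ᶻ + δ (suc L) K) ∣
    ≡⟨ ∣ε*i∣≡∣i∣ L _ ⟩
      ∣ x *ᶻ + δ L K -ᶻ y *ᶻ + δ (suc L) K ∣ ∎
    where
    open ≡-Reasoning
    linear : ∀ (x y Q₀ P₀ Q₁ P₁ p q : ℤ) →
      (x *ᶻ Q₀ +ᶻ y *ᶻ Q₁) *ᶻ p -ᶻ (x *ᶻ P₀ +ᶻ y *ᶻ P₁) *ᶻ q ≡ x *ᶻ (Q₀ *ᶻ p -ᶻ P₀ *ᶻ q) +ᶻ y *ᶻ (Q₁ *ᶻ p -ᶻ P₁ *ᶻ q)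
    linear = solve-∀
    factor : ∀ (x y s e₀ e₁ : ℤ) → x *ᶻ (s *ᶻ e₀) +ᶻ y *ᶻ (- s *ᶻ e₁) ≡ s *ᶻ (x *ᶻ e₀ -ᶻ y *ᶻ e₁)
    factor = solve-∀

  -- Convergents are primitive vectors, again because Δ = ± 1.
  ¬convergent-even : ∀ q p (c : ℕ) (z : ℤ) → q ≡ 2 * c → p ≡ + 2 *ᶻ z → ¬ IsConvergent a p q
  ¬convergent-even q p c z refl refl (n , p≡ , q≡) = 2*≢1 ∣ t ∣ (begin
      2 * ∣ t ∣        ≡⟨ ℤₚ.abs-* (+ 2) t ⟨
      ∣ + 2 *ᶻ t ∣     ≡⟨ cong ∣_∣ Δ≡2t ⟨
      ∣ ε (suc n) ∣    ≡⟨ ∣ε∣≡1 (suc n) ⟩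
      1                ∎)
    where
    open ≡-Reasoning
    t = + c *ᶻ Pᶻ (suc (suc n)) -ᶻ z *ᶻ Qᶻ (suc (suc n))
    double : ∀ (c z p q : ℤ) → (+ 2 *ᶻ c) *ᶻ p -ᶻ (+ 2 *ᶻ z) *ᶻ q ≡ + 2 *ᶻ (c *ᶻ p -ᶻ z *ᶻ q)
    double = solve-∀
    Δ≡2t : ε (suc n) ≡ + 2 *ᶻ t
    Δ≡2t = trans (sym (Δ-adjacent (suc n))) (trans (cong₂ (λ u v → u *ᶻ Pᶻ (suc (suc n)) -ᶻ v *ᶻ Qᶻ (suc (suc n)))
      (trans (cong +_ (sym q≡)) (ℤₚ.pos-* 2 c)) (sym p≡)) (double (+ c) z (Pᶻ (suc (suc n))) (Qᶻ (suc (suc n)))))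
    2*≢1 : ∀ k → 2 * k ≢ 1
    2*≢1 zero ()
    2*≢1 (suc k) h with () ← trans (sym (ℕₚ.+-suc (suc k) (k + 0))) h

  ConvergentCoordinates : ℕ → ℤ → ℤ → Set
  ConvergentCoordinates L x y = Σ ℕ λ l → qOf L x y ≡ Qᶻ l × pOf L x y ≡ Pᶻ l

  avoids-convergent : ∀ {L x₀ y₀} → ConvergentCoordinates L x₀ y₀ → ∀ {x y q p} →
    + q ≡ qOf L x y → p ≡ pOf L x y → 1 ≤ q → ¬ IsConvergent a p q → (x , y) ≢ (x₀ , y₀)
  avoids-convergent (zero , q≡ , _) q≡′ _ 1≤q _ refl with () ← subst (1 ≤_) (ℤₚ.+-injective (trans q≡′ q≡)) 1≤q
  avoids-convergent (suc n , q≡ , p≡) q≡′ p≡′ _ ¬conv refl = ¬conv (n , trans p≡′ p≡ , ℤₚ.+-injective (trans q≡′ q≡))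

  private
    module Recurrent (s : ℕ → ℤ) (s-rec : ∀ k → s (suc (suc k)) ≡ + a (suc k) *ᶻ s (suc k) +ᶻ s k) where

      s-rec₁ : ∀ k → a (suc k) ≡ 1 → s (suc (suc k)) ≡ s (suc k) +ᶻ s k
      s-rec₁ k a≡1 =
        trans (s-rec k) (trans (cong (λ A → + A *ᶻ s (suc k) +ᶻ s k) a≡1) (cong (_+ᶻ s k) (ℤₚ.*-identityˡ (s (suc k)))))

      unit₀ : ∀ L → + 1 *ᶻ s L +ᶻ + 0 *ᶻ s (suc L) ≡ s L
      unit₀ L = identity (s L) (s (suc L))
        where
        identity : ∀ (u v : ℤ) → + 1 *ᶻ u +ᶻ + 0 *ᶻ v ≡ u
        identity = solve-∀

      unit₁ : ∀ L → + 0 *ᶻ s L +ᶻ + 1 *ᶻ s (suc L) ≡ s (suc L)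
      unit₁ L = identity (s L) (s (suc L))
        where
        identity : ∀ (u v : ℤ) → + 0 *ᶻ u +ᶻ + 1 *ᶻ v ≡ v
        identity = solve-∀

      back₁ : ∀ l → a (suc l) ≡ 1 → -1ℤ *ᶻ s (suc l) +ᶻ + 1 *ᶻ s (suc (suc l)) ≡ s l
      back₁ l a≡1 = trans (cong (λ v → -1ℤ *ᶻ s (suc l) +ᶻ + 1 *ᶻ v) (s-rec₁ l a≡1)) (identity (s l) (s (suc l)))
        where
        identity : ∀ (u v : ℤ) → -1ℤ *ᶻ v +ᶻ + 1 *ᶻ (v +ᶻ u) ≡ u
        identity = solve-∀

      back₂ : ∀ l → a (suc l) ≡ 1 → a (suc (suc l)) ≡ 1 → + 2 *ᶻ s (suc (suc l)) +ᶻ -1ℤ *ᶻ s (suc (suc (suc l))) ≡ s l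
      back₂ l a≡1 a′≡1 = trans (cong (λ v → + 2 *ᶻ s (suc (suc l)) +ᶻ -1ℤ *ᶻ v) (s-rec₁ (suc l) a′≡1))
        (trans (cong (λ u → + 2 *ᶻ u +ᶻ -1ℤ *ᶻ (u +ᶻ s (suc l))) (s-rec₁ l a≡1)) (identity (s l) (s (suc l))))
        where
        identity : ∀ (u v : ℤ) → + 2 *ᶻ (v +ᶻ u) +ᶻ -1ℤ *ᶻ ((v +ᶻ u) +ᶻ v) ≡ u
        identity = solve-∀

    module Qs = Recurrent Qᶻ Qᶻ-rec
    module Ps = Recurrent Pᶻ Pᶻ-rec

  convergent-coordinates₀ : ∀ L → ConvergentCoordinates L (+ 1) (+ 0)
  convergent-coordinates₀ L = L , Qs.unit₀ L , Ps.unit₀ L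

  convergent-coordinates₁ : ∀ L → ConvergentCoordinates L (+ 0) (+ 1)
  convergent-coordinates₁ L = suc L , Qs.unit₁ L , Ps.unit₁ L

  -- When a_{l+1} = 1 (resp. also a_{l+2} = 1), an older convergent reappears with
  -- small coordinates at the next (resp. next but one) level.
  convergent-coordinates₋₁ : ∀ l → a (suc l) ≡ 1 → ConvergentCoordinates (suc l) -1ℤ (+ 1)
  convergent-coordinates₋₁ l a≡1 = l , Qs.back₁ l a≡1 , Ps.back₁ l a≡1

  convergent-coordinates₋₂ : ∀ l → a (suc l) ≡ 1 → a (suc (suc l)) ≡ 1 → ConvergentCoordinates (suc (suc l)) (+ 2) -1ℤ
  convergent-coordinates₋₂ l a≡1 a′≡1 = l , Qs.back₂ l a≡1 a′≡1 , Ps.back₂ l a≡1 a′≡1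

module ContinuedFraction (a : ℕ → ℕ) (ha : ∀ n → 1 ≤ a (suc n)) where

  open Convergents a public

  x≤a*x : ∀ k x → x ≤ a (suc k) * x
  x≤a*x k x = ℕₚ.m≤n*m x (a (suc k)) {{ℕ.>-nonZero (ha k)}}

  Q-sum≤ : ∀ k → Q (suc k) + Q k ≤ Q (suc (suc k))
  Q-sum≤ k = ℕₚ.+-monoˡ-≤ (Q k) (x≤a*x k (Q (suc k)))

  Q-step : ∀ K → Q K ≤ Q (suc K)
  Q-step zero = z≤n
  Q-step (suc k) = ℕₚ.≤-trans (ℕₚ.m≤m+n (Q (suc k)) (Q k)) (Q-sum≤ k)

  Q≥1 : ∀ K → 1 ≤ K → 1 ≤ Q K
  Q≥1 (suc zero) _ = s≤s z≤n
  Q≥1 (suc (suc k)) _ = ℕₚ.≤-trans (Q≥1 (suc k) (s≤s z≤n)) (ℕₚ.≤-trans (ℕₚ.m≤m+n _ (Q k)) (Q-sum≤ k))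

  Q-mono : ∀ {J K} → J ≤ K → Q J ≤ Q K
  Q-mono {J} {K} J≤K with d ← K ∸ J | refl ← sym (ℕₚ.m∸n+n≡m J≤K) = go d
    where
    go : ∀ d → Q J ≤ Q (d + J)
    go zero = ℕₚ.≤-refl
    go (suc d) = ℕₚ.≤-trans (go d) (Q-step (d + J))

  Q-strict : ∀ m → Q (suc (suc m)) < Q (suc (suc (suc m)))
  Q-strict m = ℕₚ.<-≤-trans (ℕₚ.m<m+n (Q (suc (suc m))) (Q≥1 (suc m) (s≤s z≤n))) (Q-sum≤ (suc m))

  Q-grow : ∀ c → suc c ≤ Q (suc (suc (2 * c)))
  Q-grow zero = Q≥1 2 (s≤s z≤n)
  Q-grow (suc c) rewrite ℕₚ.+-suc c (c + 0) =
    ℕₚ.≤-trans (ℕₚ.+-mono-≤ (Q≥1 (suc (suc (suc (2 * c)))) (s≤s z≤n)) (Q-grow c)) (Q-sum≤ (suc (suc (2 * c))))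

  δ-pos : ∀ J K → J < K → 1 ≤ δ J K
  δ-pos J K J<K with d ← K ∸ suc J | refl ← sym (ℕₚ.m∸n+n≡m J<K) =
    subst (1 ≤_) (sym (trans (cong (δ J) (ℕₚ.+-suc d J)) (δ≡continuant J (suc d)))) (continuant-pos d)
    where
    continuant-pos : ∀ d → 1 ≤ continuant J (suc d)
    continuant-pos zero = s≤s z≤n
    continuant-pos (suc d) = ℕₚ.≤-trans (ℕₚ.≤-trans (ha (d + J))
      (ℕₚ.m≤m*n (a (suc (d + J))) (continuant J (suc d)) {{ℕ.>-nonZero (continuant-pos d)}})) (ℕₚ.m≤m+n _ _)

  δ-decreasing : ∀ L K → suc (suc (suc L)) < K → δ (suc (suc L)) K < δ (suc L) K
  δ-decreasing L K L+3<K = begin-strict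
    δ (suc (suc L)) K                                           <⟨ ℕₚ.m<m+n _ (δ-pos (suc (suc (suc L))) K L+3<K) ⟩
    δ (suc (suc L)) K + δ (suc (suc (suc L))) K                 ≤⟨ ℕₚ.+-monoˡ-≤ _ (x≤a*x (suc L) _) ⟩
    a (suc (suc L)) * δ (suc (suc L)) K + δ (suc (suc (suc L))) K ≡⟨ δ-rec (suc L) K (ℕₚ.<⇒≤ L+3<K) ⟨
    δ (suc L) K                                                 ∎
    where open ℕₚ.≤-Reasoning

  scaled-εΔ-pos : ∀ J K m → J < K → 0ℤ <ᶻ (+ suc m *ᶻ ε J) *ᶻ Δ J K
  scaled-εΔ-pos J K m J<K = subst (0ℤ <ᶻ_) (begin
      + (suc m * δ J K)                   ≡⟨ ℤₚ.pos-* (suc m) (δ J K) ⟩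
      + suc m *ᶻ + δ J K                  ≡⟨ cong (+ suc m *ᶻ_) (ℤₚ.*-identityˡ (+ δ J K)) ⟨
      + suc m *ᶻ (1ℤ *ᶻ + δ J K)           ≡⟨ cong (λ s → + suc m *ᶻ (s *ᶻ + δ J K)) (ε*ε≡1 J) ⟨
      + suc m *ᶻ ((ε J *ᶻ ε J) *ᶻ + δ J K) ≡⟨ identity (+ suc m) (ε J) (+ δ J K) ⟩
      (+ suc m *ᶻ ε J) *ᶻ (ε J *ᶻ + δ J K) ≡⟨ cong ((+ suc m *ᶻ ε J) *ᶻ_) (Δ≡ε*δ J K (ℕₚ.<⇒≤ J<K)) ⟨
      (+ suc m *ᶻ ε J) *ᶻ Δ J K ∎)
    (ℤ.+<+ (ℕₚ.*-mono-≤ (s≤s (z≤n {m})) (δ-pos J K J<K)))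
    where
    open ≡-Reasoning
    identity : ∀ (c s x : ℤ) → c *ᶻ ((s *ᶻ s) *ᶻ x) ≡ (c *ᶻ s) *ᶻ (s *ᶻ x)
    identity = solve-∀

  eventually-positive-from : ∀ J c d → 0ℤ ≤ᶻ form J c d → (∀ K → J < K → 0ℤ <ᶻ c *ᶻ Δ J K) →
    Eventually (λ K → 0ℤ <ᶻ form K c d)
  eventually-positive-from J c d 0≤form cΔ>0 = suc J , λ K J<K →
    ℤₚ.*-cancelˡ-<-nonNeg (Qᶻ J) (subst₂ _<ᶻ_ (sym (ℤₚ.*-zeroʳ (Qᶻ J))) (sym (form-transfer J K c d))
      (ℤₚ.≤-<-trans (ℤₚ.≤-reflexive (sym (ℤₚ.+-identityˡ 0ℤ)))
        (ℤₚ.+-mono-≤-< (nonneg* (Qᶻ K) (ℤ.+≤+ z≤n) 0≤form) (cΔ>0 K J<K))))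
    where
    nonneg* : ∀ x {y} → 0ℤ ≤ᶻ x → 0ℤ ≤ᶻ y → 0ℤ ≤ᶻ x *ᶻ y
    nonneg* (+ n) {+ m} _ _ = subst (0ℤ ≤ᶻ_) (ℤₚ.pos-* n m) (ℤ.+≤+ z≤n)

  EventuallyPositive : ℤ → ℤ → Set
  EventuallyPositive c d = Eventually (λ K → 0ℤ <ᶻ form K c d)

  private
    odd-scale : ∀ k m → + suc m ≡ + suc m *ᶻ ε (suc (2 * k))
    odd-scale k m = sym (trans (cong (+ suc m *ᶻ_) (ε-odd k)) (ℤₚ.*-identityʳ (+ suc m)))

    even-scale : ∀ k m → - + suc m ≡ + suc m *ᶻ ε (suc (suc (2 * k)))
    even-scale k m =
      sym (trans (cong (+ suc m *ᶻ_) (ε-even k)) (trans (sym (ℤₚ.neg-distribʳ-* (+ suc m) 1ℤ)) (cong -_ (ℤₚ.*-identityʳ (+ suc m)))))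

  Pos⇒eventually : ∀ c d → Pos a c d → EventuallyPositive c d
  Pos⇒eventually (+ zero) -[1+ n ] _ = 1 , λ K 1≤K →
    subst (0ℤ <ᶻ_) (trans (ℤₚ.pos-* (suc n) (Q K)) (identity (+ suc n) (Qᶻ K) (Pᶻ K))) (ℤ.+<+ (ℕₚ.*-mono-≤ (s≤s (z≤n {n})) (Q≥1 K 1≤K)))
    where
    identity : ∀ (x q p : ℤ) → x *ᶻ q ≡ 0ℤ *ᶻ p -ᶻ (- x) *ᶻ q
    identity = solve-∀
  Pos⇒eventually (+ zero) (+ n) (ℤ.+<+ ())
  Pos⇒eventually +[1+ m ] d (k , h) = eventually-positive-from J (+ suc m) d
    (subst (0ℤ ≤ᶻ_) (cong (_-ᶻ d *ᶻ Qᶻ J) (ℤₚ.*-comm (Pᶻ J) (+ suc m))) (ℤₚ.i≤j⇒0≤j-i h))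
    λ K J<K → subst (λ c → 0ℤ <ᶻ c *ᶻ Δ J K) (sym (odd-scale k m)) (scaled-εΔ-pos J K m J<K)
    where
    J = suc (2 * k)
  Pos⇒eventually -[1+ m ] d (k , h) = eventually-positive-from J (- + suc m) d
    (subst (0ℤ ≤ᶻ_) (identity (+ suc m) d (Pᶻ J) (Qᶻ J)) (ℤₚ.i≤j⇒0≤j-i h))
    λ K J<K → subst (λ c → 0ℤ <ᶻ c *ᶻ Δ J K) (sym (even-scale k m)) (scaled-εΔ-pos J K m J<K)
    where
    J = suc (suc (2 * k))
    identity : ∀ (c d p q : ℤ) → (- d) *ᶻ q -ᶻ p *ᶻ c ≡ (- c) *ᶻ p -ᶻ d *ᶻ q
    identity = solve-∀

  eventually⇒Pos : ∀ c d → EventuallyPositive c d → Pos a c d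
  eventually⇒Pos (+ zero) (+ n) (K₀ , h) = ⊥-elim (ℤₚ.<-irrefl refl (ℤₚ.<-≤-trans (h (suc K₀) (ℕₚ.n≤1+n K₀))
    (subst (_≤ᶻ 0ℤ) (trans (cong -_ (ℤₚ.pos-* n (Q (suc K₀)))) (sym (identity (+ n) (Qᶻ (suc K₀)) (Pᶻ (suc K₀))))) ℤₚ.neg-≤-pos)))
    where
    identity : ∀ (x q p : ℤ) → 0ℤ *ᶻ p -ᶻ x *ᶻ q ≡ - (x *ᶻ q)
    identity = solve-∀
  eventually⇒Pos (+ zero) -[1+ n ] _ = ℤ.-<+
  eventually⇒Pos +[1+ m ] d (K₀ , h) = K₀ , subst (d *ᶻ Qᶻ J ≤ᶻ_) (ℤₚ.*-comm (+ suc m) (Pᶻ J))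
    (ℤₚ.<⇒≤ (0<j-i⇒i<j (h J (ℕₚ.≤-trans (ℕₚ.m≤m+n K₀ (K₀ + 0)) (ℕₚ.n≤1+n _)))))
    where
    J = suc (2 * K₀)
  eventually⇒Pos -[1+ m ] d (K₀ , h) = K₀ , ℤₚ.<⇒≤ (0<j-i⇒i<j (subst (0ℤ <ᶻ_) (identity (+ suc m) d (Pᶻ J) (Qᶻ J))
    (h J (ℕₚ.≤-trans (ℕₚ.m≤m+n K₀ (K₀ + 0)) (ℕₚ.≤-trans (ℕₚ.n≤1+n _) (ℕₚ.n≤1+n _))))))
    where
    J = suc (suc (2 * K₀))
    identity : ∀ (c d p q : ℤ) → (- c) *ᶻ p -ᶻ d *ᶻ q ≡ (- d) *ᶻ q -ᶻ p *ᶻ c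
    identity = solve-∀

  -- α is irrational: if c α - d changed sign between two consecutive convergents of
  -- denominators larger than c, then c would be at least the larger denominator.
  eventually-sign : ∀ c d → 1 ≤ c → EventuallyPositive (+ c) d ⊎ EventuallyPositive (- + c) (- d)
  eventually-sign (suc m) d _ with form J (+ suc m) d in form-J | form (suc J) (- + suc m) (- d) in form-J+1
    where J = suc (2 * suc m)
  ... | + _ | _ = inj₁ (eventually-positive-from J (+ suc m) d (subst (0ℤ ≤ᶻ_) (sym form-J) (ℤ.+≤+ z≤n))
        λ K J<K → subst (λ c → 0ℤ <ᶻ c *ᶻ Δ J K) (sym (odd-scale (suc m) m)) (scaled-εΔ-pos J K m J<K))
    where J = suc (2 * suc m)
  ... | -[1+ _ ] | + _ = inj₂ (eventually-positive-from (suc J) (- + suc m) (- d) (subst (0ℤ ≤ᶻ_) (sym form-J+1) (ℤ.+≤+ z≤n))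
        λ K J<K → subst (λ c → 0ℤ <ᶻ c *ᶻ Δ (suc J) K) (sym (even-scale (suc m) m)) (scaled-εΔ-pos (suc J) K m J<K))
    where J = suc (2 * suc m)
  ... | -[1+ n ] | -[1+ n′ ] = ⊥-elim (ℕₚ.<-irrefl refl (ℕₚ.<-≤-trans (Q-grow c)
        (ℕₚ.≤-trans (ℕₚ.m≤m*n (Q (suc J)) (suc n)) (ℕₚ.≤-trans (ℕₚ.m≤n+m _ _) (ℕₚ.≤-reflexive (sym c≡))))))
    where
    c = suc m
    J = suc (2 * c)
    form-J+1≡ : form (suc J) (+ c) d ≡ +[1+ n′ ]
    form-J+1≡ = ℤₚ.neg-injective (trans (sym (form-neg (suc J) (+ c) d)) form-J+1)
    transfer : Qᶻ J *ᶻ +[1+ n′ ] ≡ Qᶻ (suc J) *ᶻ -[1+ n ] +ᶻ + c *ᶻ 1ℤ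
    transfer = trans (cong (Qᶻ J *ᶻ_) (sym form-J+1≡)) (trans (form-transfer J (suc J) (+ c) d)
      (cong₂ (λ u v → Qᶻ (suc J) *ᶻ u +ᶻ + c *ᶻ v) form-J (trans (Δ-adjacent J) (ε-odd c))))
    identity : ∀ (y z c : ℤ) → c ≡ (y *ᶻ (- z) +ᶻ c *ᶻ 1ℤ) +ᶻ y *ᶻ z
    identity = solve-∀
    c≡ : c ≡ Q J * suc n′ + Q (suc J) * suc n
    c≡ = ℤₚ.+-injective (trans (identity (Qᶻ (suc J)) (+ suc n) (+ c)) (trans (cong (_+ᶻ Qᶻ (suc J) *ᶻ + suc n) (sym transfer))
      (sym (trans (ℤₚ.pos-+ (Q J * suc n′) (Q (suc J) * suc n)) (cong₂ _+ᶻ_ (ℤₚ.pos-* (Q J) (suc n′)) (ℤₚ.pos-* (Q (suc J)) (suc n)))))))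

  form-+ : ∀ K c d c′ d′ → form K (c +ᶻ c′) (d +ᶻ d′) ≡ form K c d +ᶻ form K c′ d′
  form-+ K c d c′ d′ = identity c d c′ d′ (Pᶻ K) (Qᶻ K)
    where
    identity : ∀ (c d c′ d′ p q : ℤ) → (c +ᶻ c′) *ᶻ p -ᶻ (d +ᶻ d′) *ᶻ q ≡ (c *ᶻ p -ᶻ d *ᶻ q) +ᶻ (c′ *ᶻ p -ᶻ d′ *ᶻ q)
    identity = solve-∀

  form-- : ∀ K c d c′ d′ → form K (c -ᶻ c′) (d -ᶻ d′) ≡ form K c d -ᶻ form K c′ d′
  form-- K c d c′ d′ = trans (form-+ K c d (- c′) (- d′)) (cong (form K c d +ᶻ_) (form-neg K c′ d′))

  form-neg-- : ∀ K c d c′ d′ → form K (- c -ᶻ c′) (- d -ᶻ d′) ≡ - form K c d -ᶻ form K c′ d′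
  form-neg-- K c d c′ d′ = trans (form-- K (- c) (- d) c′ d′) (cong (_-ᶻ form K c′ d′) (form-neg K c d))

  -- Closer compares |q α - p| with |q′ α - p′| through four signs of linear forms
  -- in α; each is read off from P K / Q K for K large.
  Closer⇒eventually : ∀ q p q′ p′ → Closer a q p q′ p′ → Eventually (λ K → ∣ form K q p ∣ < ∣ form K q′ p′ ∣)
  Closer⇒eventually q p q′ p′ (minus , plus) = eventually-zip (either minus) (either plus) λ K s₁ s₂ →
    ∣∣<-from-signs (form K q p) (form K q′ p′)
      (Data.Sum.map (subst (0ℤ <ᶻ_) (form-- K q′ p′ q p)) (subst (0ℤ <ᶻ_) (form-neg-- K q′ p′ q p)) s₁)
      (Data.Sum.map (subst (0ℤ <ᶻ_) (form-+ K q′ p′ q p)) (subst (0ℤ <ᶻ_) (form-- K q p q′ p′)) s₂)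
    where
    either : ∀ {c₁ d₁ c₂ d₂} → Pos a c₁ d₁ ⊎ Pos a c₂ d₂ → Eventually (λ K → 0ℤ <ᶻ form K c₁ d₁ ⊎ 0ℤ <ᶻ form K c₂ d₂)
    either {c₁} {d₁} (inj₁ pos) = eventually-map (Pos⇒eventually c₁ d₁ pos) (λ _ → inj₁)
    either {c₂ = c₂} {d₂} (inj₂ pos) = eventually-map (Pos⇒eventually c₂ d₂ pos) (λ _ → inj₂)

  eventually⇒Closer : ∀ w pw q p → 1 ≤ q → Eventually (λ K → ∣ form K (+ w) pw ∣ < ∣ form K (+ q) p ∣) →
    Closer a (+ w) pw (+ q) p
  eventually⇒Closer w pw q p 1≤q closer with eventually-sign q p 1≤q
  ... | inj₁ positive =
      inj₁ (eventually⇒Pos _ _ (eventually-zip closer positive λ K lt pos →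
        subst (0ℤ <ᶻ_) (sym (form-- K (+ q) p (+ w) pw)) (i<j⇒0<j-i (proj₁ (∣∣<⇒<∧-< (i K) (j K) lt pos)))))
    , inj₁ (eventually⇒Pos _ _ (eventually-zip closer positive λ K lt pos →
        subst (0ℤ <ᶻ_) (sym (form-+ K (+ q) p (+ w) pw)) (-i<j⇒0<j+i (proj₂ (∣∣<⇒<∧-< (i K) (j K) lt pos)))))
    where
    i j : ℕ → ℤ
    i K = form K (+ w) pw
    j K = form K (+ q) p
    -i<j⇒0<j+i : ∀ {x y} → - x <ᶻ y → 0ℤ <ᶻ y +ᶻ x
    -i<j⇒0<j+i {x} {y} h = subst (0ℤ <ᶻ_) (cong (y +ᶻ_) (ℤₚ.neg-involutive x)) (i<j⇒0<j-i h)
  ... | inj₂ negative =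
      inj₂ (eventually⇒Pos _ _ (eventually-zip closer negative λ K lt neg →
        subst (0ℤ <ᶻ_) (sym (form-neg-- K (+ q) p (+ w) pw)) (i<j⇒0<j-i (proj₁ (split K lt neg)))))
    , inj₂ (eventually⇒Pos _ _ (eventually-zip closer negative λ K lt neg →
        subst (0ℤ <ᶻ_) (sym (form-- K (+ w) pw (+ q) p)) (i<j⇒0<j-i (ℤₚ.neg-cancel-< (proj₂ (split K lt neg))))))
    where
    i j : ℕ → ℤ
    i K = form K (+ w) pw
    j K = form K (+ q) p
    split : ∀ K → ∣ i K ∣ < ∣ j K ∣ → 0ℤ <ᶻ form K (- + q) (- p) → i K <ᶻ - j K × - i K <ᶻ - j K
    split K lt neg = ∣∣<⇒<∧-< (i K) (- j K) (subst (∣ i K ∣ <_) (sym (ℤₚ.∣-i∣≡∣i∣ (j K))) lt)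
      (subst (0ℤ <ᶻ_) (form-neg K (+ q) p) neg)

  ¬convergent-between : ∀ J q p → Q J < q → q < Q (suc J) → ¬ IsConvergent a p q
  ¬convergent-between J q p QJ<q q<QJ+1 (n , _ , q≡) with ℕₚ.≤-<-connex (suc n) J
  ... | inj₁ n+1≤J = ℕₚ.<-irrefl refl (ℕₚ.<-≤-trans QJ<q (ℕₚ.≤-trans (ℕₚ.≤-reflexive q≡) (Q-mono n+1≤J)))
  ... | inj₂ J<n+1 = ℕₚ.<-irrefl refl (ℕₚ.<-≤-trans q<QJ+1 (ℕₚ.≤-trans (Q-mono J<n+1) (ℕₚ.≤-reflexive (sym q≡))))

-- Gaps of lattice points

-- A lattice point q = x Q₀ + y Q₁ with 0 < q < A Q₁ + Q₀, sorted by the signs of its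
-- coordinates, together with its gap g = |x e₀ - y e₁|.
data Shape (Q₀ Q₁ A e₀ e₁ q g : ℕ) : ℤ → ℤ → Set where
  y-axis : ∀ Y → q ≡ suc Y * Q₁ → g ≡ suc Y * e₁ → Shape Q₀ Q₁ A e₀ e₁ q g (+ 0) (+ suc Y)
  first-quadrant : ∀ X Y → Y < A → q ≡ suc X * Q₀ + Y * Q₁ → g + Y * e₁ ≡ suc X * e₀ →
    Shape Q₀ Q₁ A e₀ e₁ q g (+ suc X) (+ Y)
  fourth-quadrant : ∀ X Y → q + suc Y * Q₁ ≡ suc X * Q₀ → g ≡ suc X * e₀ + suc Y * e₁ →
    Shape Q₀ Q₁ A e₀ e₁ q g (+ suc X) -[1+ Y ]
  second-quadrant : ∀ X Y → q + suc X * Q₀ ≡ suc Y * Q₁ → g ≡ suc X * e₀ + suc Y * e₁ →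
    Shape Q₀ Q₁ A e₀ e₁ q g -[1+ X ] (+ suc Y)

private
  +-sum : ∀ m n Q₀ Q₁ → + m *ᶻ + Q₀ +ᶻ + n *ᶻ + Q₁ ≡ + (m * Q₀ + n * Q₁)
  +-sum m n Q₀ Q₁ = sym (trans (ℤₚ.pos-+ (m * Q₀) (n * Q₁)) (cong₂ _+ᶻ_ (ℤₚ.pos-* m Q₀) (ℤₚ.pos-* n Q₁)))

  not-positive : ∀ {q} n → + q ≡ - + n → ¬ 1 ≤ q
  not-positive zero refl ()
  not-positive (suc n) ()

  negate-both : ∀ (u v Q₀ Q₁ : ℤ) → (- u) *ᶻ Q₀ +ᶻ (- v) *ᶻ Q₁ ≡ - (u *ᶻ Q₀ +ᶻ v *ᶻ Q₁)
  negate-both = solve-∀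

  only-second : ∀ (v Q₀ Q₁ : ℤ) → 0ℤ *ᶻ Q₀ +ᶻ v *ᶻ Q₁ ≡ v *ᶻ Q₁
  only-second = solve-∀

classify : ∀ {Q₀ Q₁ A e₀ e₁ e₂} x y {q} → e₀ ≡ A * e₁ + e₂ → + q ≡ x *ᶻ + Q₀ +ᶻ y *ᶻ + Q₁ → 1 ≤ q → q < A * Q₁ + Q₀ →
  Shape Q₀ Q₁ A e₀ e₁ q ∣ x *ᶻ + e₀ -ᶻ y *ᶻ + e₁ ∣ x y
classify {Q₀} {Q₁} (+ zero) (+ zero) _ q≡ 1≤q _ = ⊥-elim (not-positive 0 (trans q≡ (+-sum 0 0 Q₀ Q₁)) 1≤q)
classify {Q₀} {Q₁} {e₀ = e₀} {e₁} (+ zero) (+ suc Y) _ q≡ _ _ =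
  y-axis Y (ℤₚ.+-injective (trans q≡ (+-sum 0 (suc Y) Q₀ Q₁))) (begin
    ∣ 0ℤ *ᶻ + e₀ -ᶻ + suc Y *ᶻ + e₁ ∣  ≡⟨ cong ∣_∣ (identity (+ e₀) (+ suc Y *ᶻ + e₁)) ⟩
    ∣ - (+ suc Y *ᶻ + e₁) ∣            ≡⟨ ℤₚ.∣-i∣≡∣i∣ (+ suc Y *ᶻ + e₁) ⟩
    ∣ + suc Y *ᶻ + e₁ ∣                ≡⟨ cong ∣_∣ (ℤₚ.pos-* (suc Y) e₁) ⟨
    suc Y * e₁                         ∎)
  where
  open ≡-Reasoning
  identity : ∀ (u v : ℤ) → 0ℤ *ᶻ u -ᶻ v ≡ - v
  identity = solve-∀
classify {Q₀} {Q₁} (+ zero) -[1+ Y ] _ q≡ 1≤q _ = ⊥-elim (not-positive (suc Y * Q₁)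
  (trans q≡ (trans (only-second (- + suc Y) (+ Q₀) (+ Q₁))
    (trans (sym (ℤₚ.neg-distribˡ-* (+ suc Y) (+ Q₁))) (cong -_ (sym (ℤₚ.pos-* (suc Y) Q₁)))))) 1≤q)
classify {Q₀} {Q₁} {A} {e₀} {e₁} {e₂} (+ suc X) (+ Y) {q} e₀≡ q≡ _ q<bound = first-quadrant X Y Y<A q≡′ g≡
  where
  q≡′ : q ≡ suc X * Q₀ + Y * Q₁
  q≡′ = ℤₚ.+-injective (trans q≡ (+-sum (suc X) Y Q₀ Q₁))
  Y<A : Y < A
  Y<A = ℕₚ.≰⇒> λ A≤Y → ℕₚ.<⇒≱ q<bound (begin
    A * Q₁ + Q₀           ≡⟨ ℕₚ.+-comm (A * Q₁) Q₀ ⟩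
    Q₀ + A * Q₁           ≤⟨ ℕₚ.+-mono-≤ (ℕₚ.m≤m+n Q₀ (X * Q₀)) (ℕₚ.*-monoˡ-≤ Q₁ A≤Y) ⟩
    suc X * Q₀ + Y * Q₁   ≡⟨ q≡′ ⟨
    q                     ∎)
    where open ℕₚ.≤-Reasoning
  Ye₁≤ : Y * e₁ ≤ suc X * e₀
  Ye₁≤ = ℕₚ.≤-trans (ℕₚ.*-monoˡ-≤ e₁ (ℕₚ.<⇒≤ Y<A))
    (ℕₚ.≤-trans (ℕₚ.m≤m+n (A * e₁) e₂) (ℕₚ.≤-trans (ℕₚ.≤-reflexive (sym e₀≡)) (ℕₚ.m≤m+n e₀ (X * e₀))))
  g≡ : ∣ + suc X *ᶻ + e₀ -ᶻ + Y *ᶻ + e₁ ∣ + Y * e₁ ≡ suc X * e₀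
  g≡ = trans (cong (λ u → ∣ u ∣ + Y * e₁) (trans (cong₂ _-ᶻ_ (sym (ℤₚ.pos-* (suc X) e₀)) (sym (ℤₚ.pos-* Y e₁)))
    (trans (ℤₚ.m-n≡m⊖n (suc X * e₀) (Y * e₁)) (ℤₚ.⊖-≥ Ye₁≤)))) (ℕₚ.m∸n+n≡m Ye₁≤)
classify {Q₀} {Q₁} {e₀ = e₀} {e₁} (+ suc X) -[1+ Y ] {q} _ q≡ _ _ = fourth-quadrant X Y q≡′
  (cong ∣_∣ (trans (identity (+ suc X) (+ suc Y) (+ e₀) (+ e₁)) (+-sum (suc X) (suc Y) e₀ e₁)))
  where
  q≡′ : q + suc Y * Q₁ ≡ suc X * Q₀
  q≡′ = ℤₚ.+-injective (trans (ℤₚ.pos-+ q (suc Y * Q₁)) (trans (cong₂ _+ᶻ_ q≡ (ℤₚ.pos-* (suc Y) Q₁))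
    (trans (cancel (+ suc X) (+ suc Y) (+ Q₀) (+ Q₁)) (sym (ℤₚ.pos-* (suc X) Q₀)))))
    where
    cancel : ∀ (u v Q₀ Q₁ : ℤ) → (u *ᶻ Q₀ +ᶻ (- v) *ᶻ Q₁) +ᶻ v *ᶻ Q₁ ≡ u *ᶻ Q₀
    cancel = solve-∀
  identity : ∀ (u v e₀ e₁ : ℤ) → u *ᶻ e₀ -ᶻ (- v) *ᶻ e₁ ≡ u *ᶻ e₀ +ᶻ v *ᶻ e₁
  identity = solve-∀
classify {Q₀} {Q₁} -[1+ X ] (+ zero) _ q≡ 1≤q _ = ⊥-elim (not-positive (suc X * Q₀ + 0 * Q₁)
  (trans q≡ (trans (negate-both (+ suc X) (+ 0) (+ Q₀) (+ Q₁)) (cong -_ (+-sum (suc X) 0 Q₀ Q₁)))) 1≤q)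
classify {Q₀} {Q₁} {e₀ = e₀} {e₁} -[1+ X ] (+ suc Y) {q} _ q≡ _ _ = second-quadrant X Y q≡′ (begin
    ∣ -[1+ X ] *ᶻ + e₀ -ᶻ + suc Y *ᶻ + e₁ ∣      ≡⟨ cong ∣_∣ (identity (+ suc X) (+ suc Y) (+ e₀) (+ e₁)) ⟩
    ∣ - (+ suc X *ᶻ + e₀ +ᶻ + suc Y *ᶻ + e₁) ∣   ≡⟨ ℤₚ.∣-i∣≡∣i∣ (+ suc X *ᶻ + e₀ +ᶻ + suc Y *ᶻ + e₁) ⟩
    ∣ + suc X *ᶻ + e₀ +ᶻ + suc Y *ᶻ + e₁ ∣       ≡⟨ cong ∣_∣ (+-sum (suc X) (suc Y) e₀ e₁) ⟩
    suc X * e₀ + suc Y * e₁                      ∎)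
  where
  open ≡-Reasoning
  q≡′ : q + suc X * Q₀ ≡ suc Y * Q₁
  q≡′ = ℤₚ.+-injective (trans (ℤₚ.pos-+ q (suc X * Q₀)) (trans (cong₂ _+ᶻ_ q≡ (ℤₚ.pos-* (suc X) Q₀))
    (trans (cancel (+ suc X) (+ suc Y) (+ Q₀) (+ Q₁)) (sym (ℤₚ.pos-* (suc Y) Q₁)))))
    where
    cancel : ∀ (u v Q₀ Q₁ : ℤ) → ((- u) *ᶻ Q₀ +ᶻ v *ᶻ Q₁) +ᶻ u *ᶻ Q₀ ≡ v *ᶻ Q₁
    cancel = solve-∀
  identity : ∀ (u v e₀ e₁ : ℤ) → (- u) *ᶻ e₀ -ᶻ v *ᶻ e₁ ≡ - (u *ᶻ e₀ +ᶻ v *ᶻ e₁)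
  identity = solve-∀
classify {Q₀} {Q₁} -[1+ X ] -[1+ Y ] _ q≡ 1≤q _ = ⊥-elim (not-positive (suc X * Q₀ + suc Y * Q₁)
  (trans q≡ (trans (negate-both (+ suc X) (+ suc Y) (+ Q₀) (+ Q₁)) (cong -_ (+-sum (suc X) (suc Y) Q₀ Q₁)))) 1≤q)

gap-unit : ∀ k e₁ d → ∣ + 1 *ᶻ + (k * e₁ + d) -ᶻ + k *ᶻ + e₁ ∣ ≡ d
gap-unit k e₁ d = cong ∣_∣ (trans (cong (λ t → + 1 *ᶻ t -ᶻ + k *ᶻ + e₁) (+-linear k e₁ d)) (identity (+ k) (+ e₁) (+ d)))
  where
  identity : ∀ (k e₁ d : ℤ) → + 1 *ᶻ (k *ᶻ e₁ +ᶻ d) -ᶻ k *ᶻ e₁ ≡ d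
  identity = solve-∀

gap-opposite⁻ : ∀ m n e₀ e₁ → ∣ - (+ m) *ᶻ + e₀ -ᶻ + n *ᶻ + e₁ ∣ ≡ m * e₀ + n * e₁
gap-opposite⁻ m n e₀ e₁ = begin
    ∣ - (+ m) *ᶻ + e₀ -ᶻ + n *ᶻ + e₁ ∣   ≡⟨ cong ∣_∣ (identity (+ m) (+ n) (+ e₀) (+ e₁)) ⟩
    ∣ - (+ m *ᶻ + e₀ +ᶻ + n *ᶻ + e₁) ∣   ≡⟨ ℤₚ.∣-i∣≡∣i∣ (+ m *ᶻ + e₀ +ᶻ + n *ᶻ + e₁) ⟩
    ∣ + m *ᶻ + e₀ +ᶻ + n *ᶻ + e₁ ∣       ≡⟨ cong ∣_∣ (+-sum m n e₀ e₁) ⟩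
    m * e₀ + n * e₁                      ∎
  where
  open ≡-Reasoning
  identity : ∀ (m n e₀ e₁ : ℤ) → (- m) *ᶻ e₀ -ᶻ n *ᶻ e₁ ≡ - (m *ᶻ e₀ +ᶻ n *ᶻ e₁)
  identity = solve-∀

gap-opposite⁺ : ∀ m n e₀ e₁ → ∣ + m *ᶻ + e₀ -ᶻ - (+ n) *ᶻ + e₁ ∣ ≡ m * e₀ + n * e₁
gap-opposite⁺ m n e₀ e₁ = cong ∣_∣ (trans (identity (+ m) (+ n) (+ e₀) (+ e₁)) (+-sum m n e₀ e₁))
  where
  identity : ∀ (m n e₀ e₁ : ℤ) → m *ᶻ e₀ -ᶻ (- n) *ᶻ e₁ ≡ m *ᶻ e₀ +ᶻ n *ᶻ e₁
  identity = solve-∀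

module LowerBounds where

  open ℕₚ.≤-Reasoning

  private
    ≤-by : ∀ {m} n k → m + k ≡ n → m ≤ n
    ≤-by {m} n k m+k≡n = subst (m ≤_) m+k≡n (ℕₚ.m≤m+n m k)

    ≡-via : ∀ {x z : ℕ} y → x ≡ y → z ≡ y → x ≡ z
    ≡-via y x≡y z≡y = trans x≡y (sym z≡y)

    absurd-< : ∀ {q w} {B : Set} → q < w → w ≤ q → B
    absurd-< q<w w≤q = ⊥-elim (ℕₚ.<⇒≱ q<w w≤q)

    first-quadrant-gap : ∀ A e₁ e₂ X Y g → g + Y * e₁ ≡ suc (suc X) * (A * e₁ + e₂) → Y < A → (A * e₁ + e₂) + e₁ + e₂ ≤ g
    first-quadrant-gap A e₁ e₂ X Y g h Y<A = ℕₚ.+-cancelʳ-≤ (Y * e₁) _ _ (begin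
        (A * e₁ + e₂) + e₁ + e₂ + Y * e₁
      ≡⟨ solve (A ∷ e₁ ∷ e₂ ∷ Y ∷ []) ⟩
        (A * e₁ + e₂) + e₂ + suc Y * e₁
      ≤⟨ ℕₚ.+-monoʳ-≤ ((A * e₁ + e₂) + e₂) (ℕₚ.*-monoˡ-≤ e₁ Y<A) ⟩
        (A * e₁ + e₂) + e₂ + A * e₁
      ≡⟨ solve (A ∷ e₁ ∷ e₂ ∷ []) ⟩
        (A * e₁ + e₂) + (A * e₁ + e₂)
      ≤⟨ ℕₚ.+-monoʳ-≤ (A * e₁ + e₂) (ℕₚ.m≤m+n _ _) ⟩
        suc (suc X) * (A * e₁ + e₂)
      ≡⟨ sym h ⟩
        g + Y * e₁ ∎)

    mixed-gap : ∀ e₀ e₁ X Y g → g ≡ suc X * e₀ + suc Y * e₁ → e₀ + e₁ ≤ g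
    mixed-gap e₀ e₁ X Y g refl = ℕₚ.+-mono-≤ (ℕₚ.m≤m+n e₀ (X * e₀)) (ℕₚ.m≤m+n e₁ (Y * e₁))

    ¬fourth-quadrant-unit : ∀ Q₀ Q₁ Y q → 1 ≤ q → Q₀ ≤ Q₁ → q + suc Y * Q₁ ≡ 1 * Q₀ → ⊥
    ¬fourth-quadrant-unit Q₀ Q₁ Y q 1≤q Q₀≤Q₁ q+Q≡Q₀ = ℕₚ.<⇒≱ (begin-strict
      Q₁               <⟨ ℕₚ.m<n+m Q₁ 1≤q ⟩
      q + Q₁           ≤⟨ ℕₚ.+-monoʳ-≤ q (ℕₚ.m≤m+n Q₁ (Y * Q₁)) ⟩
      q + suc Y * Q₁   ≡⟨ q+Q≡Q₀ ⟩
      1 * Q₀           ≡⟨ ℕₚ.*-identityˡ Q₀ ⟩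
      Q₀               ∎) Q₀≤Q₁

  w≤Q₀+Q₁ : ∀ w Q₀ Q₁ → w + Q₀ ≡ 2 * Q₁ → Q₁ ≤ 2 * Q₀ → w ≤ Q₀ + Q₁
  w≤Q₀+Q₁ w Q₀ Q₁ w≡ Q₁≤2Q₀ = ℕₚ.+-cancelʳ-≤ Q₀ w (Q₀ + Q₁) (begin
      w + Q₀ ≡⟨ w≡ ⟩
      2 * Q₁ ≡⟨ solve (Q₁ ∷ []) ⟩
      Q₁ + Q₁ ≤⟨ ℕₚ.+-monoˡ-≤ Q₁ Q₁≤2Q₀ ⟩
      2 * Q₀ + Q₁ ≡⟨ solve (Q₀ ∷ Q₁ ∷ []) ⟩
      Q₀ + Q₁ + Q₀ ∎)

  -- Gaps of the lattice points below a bound w, when the two basis points, which are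
  -- convergents, are excluded (and, in the inner block, also the convergent (-1 , 1)).
  module _ {Q₀ Q₁ q g : ℕ} {x y : ℤ} (¬10 : (x , y) ≢ (+ 1 , + 0)) (¬01 : (x , y) ≢ (+ 0 , + 1)) where

    gap≥e₀-e₁ : ∀ A′ e₁ e₂ → Shape Q₀ Q₁ (3 + A′) ((3 + A′) * e₁ + e₂) e₁ q g x y → q < 2 * Q₁ →
      suc (suc A′) * e₁ + e₂ ≤ g
    gap≥e₀-e₁ A′ e₁ e₂ (y-axis zero _ _) _ = ⊥-elim (¬01 refl)
    gap≥e₀-e₁ A′ e₁ e₂ (y-axis (suc Y) q≡ _) q<w =
      absurd-< q<w (≤-by _ (Y * Q₁) (≡-via (suc (suc Y) * Q₁) (solve (Q₁ ∷ Y ∷ [])) q≡))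
    gap≥e₀-e₁ A′ e₁ e₂ (first-quadrant zero zero _ _ _) _ = ⊥-elim (¬10 refl)
    gap≥e₀-e₁ A′ e₁ e₂ (first-quadrant zero (suc zero) _ _ g≡) _ =
      ℕₚ.≤-reflexive (ℕₚ.+-cancelʳ-≡ (1 * e₁) _ _ (≡-via (1 * ((3 + A′) * e₁ + e₂)) (solve (A′ ∷ e₁ ∷ e₂ ∷ [])) g≡))
    gap≥e₀-e₁ A′ e₁ e₂ (first-quadrant zero (suc (suc Y)) _ q≡ _) q<w =
      absurd-< q<w (≤-by _ (Q₀ + Y * Q₁) (≡-via (1 * Q₀ + suc (suc Y) * Q₁) (solve (Q₀ ∷ Q₁ ∷ Y ∷ [])) q≡))
    gap≥e₀-e₁ A′ e₁ e₂ (first-quadrant (suc X) Y Y<A _ g≡) _ =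
      ℕₚ.≤-trans (≤-by (((3 + A′) * e₁ + e₂) + e₁ + e₂) (e₁ + e₁ + e₂) (solve (A′ ∷ e₁ ∷ e₂ ∷ []))) (first-quadrant-gap (3 + A′) e₁ e₂ X Y g g≡ Y<A)
    gap≥e₀-e₁ A′ e₁ e₂ (fourth-quadrant X Y _ g≡) _ =
      ℕₚ.≤-trans (≤-by (((3 + A′) * e₁ + e₂) + e₁) (e₁ + e₁) (solve (A′ ∷ e₁ ∷ e₂ ∷ []))) (mixed-gap _ e₁ X Y g g≡)
    gap≥e₀-e₁ A′ e₁ e₂ (second-quadrant X Y _ g≡) _ =
      ℕₚ.≤-trans (≤-by (((3 + A′) * e₁ + e₂) + e₁) (e₁ + e₁) (solve (A′ ∷ e₁ ∷ e₂ ∷ []))) (mixed-gap _ e₁ X Y g g≡)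

    gap≥2e₁ : ∀ A′ e₁ e₂ → Shape Q₀ Q₁ (3 + A′) ((3 + A′) * e₁ + e₂) e₁ q g x y → q < 1 * Q₀ + (2 + A′) * Q₁ →
      2 * e₁ ≤ g
    gap≥2e₁ A′ e₁ e₂ (y-axis zero _ _) _ = ⊥-elim (¬01 refl)
    gap≥2e₁ A′ e₁ e₂ (y-axis (suc Y) _ refl) _ = ≤-by (suc (suc Y) * e₁) (Y * e₁) (solve (e₁ ∷ Y ∷ []))
    gap≥2e₁ A′ e₁ e₂ (first-quadrant zero zero _ _ _) _ = ⊥-elim (¬10 refl)
    gap≥2e₁ A′ e₁ e₂ (first-quadrant zero (suc Y) Y<A q≡ g≡) q<w with Y ℕ.≤? A′
    ... | no Y≰A′ = absurd-< q<w (ℕₚ.≤-reflexive (trans (cong (λ u → 1 * Q₀ + suc u * Q₁) (sym Y≡)) (sym q≡)))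
      where
      Y≡ : Y ≡ suc A′
      Y≡ = ℕₚ.≤-antisym (ℕₚ.≤-pred (ℕₚ.≤-pred Y<A)) (ℕₚ.≰⇒> Y≰A′)
    ... | yes Y<A′ with ℕₚ.m≤n⇒∃[o]m+o≡n Y<A′
    ... | d , refl = subst (2 * e₁ ≤_) (sym g≡′) (ℕₚ.m≤m+n (2 * e₁) (d * e₁ + e₂))
      where
      g≡′ : g ≡ 2 * e₁ + (d * e₁ + e₂)
      g≡′ = ℕₚ.+-cancelʳ-≡ (suc Y * e₁) _ _ (≡-via (1 * ((3 + (Y + d)) * e₁ + e₂)) g≡ (solve (Y ∷ d ∷ e₁ ∷ e₂ ∷ [])))
    gap≥2e₁ A′ e₁ e₂ (first-quadrant (suc X) Y Y<A _ g≡) _ =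
      ℕₚ.≤-trans (≤-by (((3 + A′) * e₁ + e₂) + e₁ + e₂) ((2 + A′) * e₁ + 2 * e₂) (solve (A′ ∷ e₁ ∷ e₂ ∷ []))) (first-quadrant-gap (3 + A′) e₁ e₂ X Y g g≡ Y<A)
    gap≥2e₁ A′ e₁ e₂ (fourth-quadrant X Y _ g≡) _ =
      ℕₚ.≤-trans (≤-by (((3 + A′) * e₁ + e₂) + e₁) ((2 + A′) * e₁ + e₂) (solve (A′ ∷ e₁ ∷ e₂ ∷ []))) (mixed-gap _ e₁ X Y g g≡)
    gap≥2e₁ A′ e₁ e₂ (second-quadrant X Y _ g≡) _ =
      ℕₚ.≤-trans (≤-by (((3 + A′) * e₁ + e₂) + e₁) ((2 + A′) * e₁ + e₂) (solve (A′ ∷ e₁ ∷ e₂ ∷ []))) (mixed-gap _ e₁ X Y g g≡)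

    gap≥e₀+e₁ : ∀ A′ e₁ e₂ → Shape Q₀ Q₁ (2 + A′) ((2 + A′) * e₁ + e₂) e₁ q g x y → Q₀ ≤ Q₁ → q < Q₀ + Q₁ →
      ((2 + A′) * e₁ + e₂) + e₁ ≤ g
    gap≥e₀+e₁ A′ e₁ e₂ (y-axis zero _ _) _ _ = ⊥-elim (¬01 refl)
    gap≥e₀+e₁ A′ e₁ e₂ (y-axis (suc Y) q≡ _) Q₀≤Q₁ q<w = absurd-< q<w (begin
        Q₀ + Q₁ ≤⟨ ℕₚ.+-monoˡ-≤ Q₁ Q₀≤Q₁ ⟩
        Q₁ + Q₁ ≤⟨ ≤-by {Q₁ + Q₁} (suc (suc Y) * Q₁) (Y * Q₁) (solve (Q₁ ∷ Y ∷ [])) ⟩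
        suc (suc Y) * Q₁ ≡⟨ sym q≡ ⟩
        q ∎)
    gap≥e₀+e₁ A′ e₁ e₂ (first-quadrant zero zero _ _ _) _ _ = ⊥-elim (¬10 refl)
    gap≥e₀+e₁ A′ e₁ e₂ (first-quadrant zero (suc Y) _ q≡ _) _ q<w = absurd-< q<w (begin
        Q₀ + Q₁ ≤⟨ ≤-by {Q₀ + Q₁} (1 * Q₀ + suc Y * Q₁) (Y * Q₁) (solve (Q₀ ∷ Q₁ ∷ Y ∷ [])) ⟩
        1 * Q₀ + suc Y * Q₁ ≡⟨ sym q≡ ⟩
        q ∎)
    gap≥e₀+e₁ A′ e₁ e₂ (first-quadrant (suc X) Y Y<A _ g≡) _ _ =
      ℕₚ.≤-trans (ℕₚ.m≤m+n _ e₂) (first-quadrant-gap (2 + A′) e₁ e₂ X Y g g≡ Y<A)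
    gap≥e₀+e₁ A′ e₁ e₂ (fourth-quadrant X Y _ g≡) _ _ = mixed-gap _ e₁ X Y g g≡
    gap≥e₀+e₁ A′ e₁ e₂ (second-quadrant X Y _ g≡) _ _ = mixed-gap _ e₁ X Y g g≡

    module _ (1≤q : 1 ≤ q) (Q₀≤Q₁ : Q₀ ≤ Q₁) (¬m11 : (x , y) ≢ (-[1+ 0 ] , + 1)) where

      gap≥e₀+2e₁-below-2Q₀ : ∀ e₁ e₂ → Shape Q₀ Q₁ 1 (1 * e₁ + e₂) e₁ q g x y → q < 2 * Q₀ →
        (1 * e₁ + e₂) + 2 * e₁ ≤ g
      gap≥e₀+2e₁-below-2Q₀ e₁ e₂ (y-axis zero _ _) _ = ⊥-elim (¬01 refl)
      gap≥e₀+2e₁-below-2Q₀ e₁ e₂ (y-axis (suc Y) q≡ _) q<w =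
        absurd-< q<w (ℕₚ.≤-trans (ℕₚ.*-monoʳ-≤ 2 Q₀≤Q₁) (≤-by {2 * Q₁} q (Y * Q₁) (≡-via (suc (suc Y) * Q₁) (solve (Q₁ ∷ Y ∷ [])) q≡)))
      gap≥e₀+2e₁-below-2Q₀ e₁ e₂ (first-quadrant zero zero _ _ _) _ = ⊥-elim (¬10 refl)
      gap≥e₀+2e₁-below-2Q₀ e₁ e₂ (first-quadrant (suc X) zero _ q≡ _) q<w =
        absurd-< q<w (≤-by q (X * Q₀) (≡-via (suc (suc X) * Q₀ + 0 * Q₁) (solve (Q₀ ∷ Q₁ ∷ X ∷ [])) q≡))
      gap≥e₀+2e₁-below-2Q₀ e₁ e₂ (first-quadrant X (suc Y) (s≤s ()) _ _) _
      gap≥e₀+2e₁-below-2Q₀ e₁ e₂ (fourth-quadrant zero Y q≡ _) _ = ⊥-elim (¬fourth-quadrant-unit Q₀ Q₁ Y q 1≤q Q₀≤Q₁ q≡)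
      gap≥e₀+2e₁-below-2Q₀ e₁ e₂ (fourth-quadrant (suc X) Y _ refl) _ =
        ≤-by _ (X * (1 * e₁ + e₂) + e₂ + Y * e₁) (solve (e₁ ∷ e₂ ∷ X ∷ Y ∷ []))
      gap≥e₀+2e₁-below-2Q₀ e₁ e₂ (second-quadrant zero zero _ _) _ = ⊥-elim (¬m11 refl)
      gap≥e₀+2e₁-below-2Q₀ e₁ e₂ (second-quadrant zero (suc Y) _ refl) _ = ≤-by _ (Y * e₁) (solve (e₁ ∷ e₂ ∷ Y ∷ []))
      gap≥e₀+2e₁-below-2Q₀ e₁ e₂ (second-quadrant (suc X) Y _ refl) _ =
        ≤-by _ (X * (1 * e₁ + e₂) + e₂ + Y * e₁) (solve (e₁ ∷ e₂ ∷ X ∷ Y ∷ []))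

      gap≥e₀+2e₁-below-Q₀+Q₁ : ∀ A′ e₁ e₂ → Shape Q₀ Q₁ (2 + A′) ((2 + A′) * e₁ + e₂) e₁ q g x y → q < Q₀ + Q₁ →
        ((2 + A′) * e₁ + e₂) + 2 * e₁ ≤ g
      gap≥e₀+2e₁-below-Q₀+Q₁ A′ e₁ e₂ (y-axis zero _ _) _ = ⊥-elim (¬01 refl)
      gap≥e₀+2e₁-below-Q₀+Q₁ A′ e₁ e₂ (y-axis (suc Y) q≡ _) q<w = absurd-< q<w (begin
          Q₀ + Q₁ ≤⟨ ℕₚ.+-monoˡ-≤ Q₁ Q₀≤Q₁ ⟩
          Q₁ + Q₁ ≤⟨ ≤-by {Q₁ + Q₁} (suc (suc Y) * Q₁) (Y * Q₁) (solve (Q₁ ∷ Y ∷ [])) ⟩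
          suc (suc Y) * Q₁ ≡⟨ sym q≡ ⟩
          q ∎)
      gap≥e₀+2e₁-below-Q₀+Q₁ A′ e₁ e₂ (first-quadrant zero zero _ _ _) _ = ⊥-elim (¬10 refl)
      gap≥e₀+2e₁-below-Q₀+Q₁ A′ e₁ e₂ (first-quadrant zero (suc Y) _ q≡ _) q<w = absurd-< q<w (begin
          Q₀ + Q₁ ≤⟨ ≤-by {Q₀ + Q₁} (1 * Q₀ + suc Y * Q₁) (Y * Q₁) (solve (Q₀ ∷ Q₁ ∷ Y ∷ [])) ⟩
          1 * Q₀ + suc Y * Q₁ ≡⟨ sym q≡ ⟩
          q ∎)
      gap≥e₀+2e₁-below-Q₀+Q₁ A′ e₁ e₂ (first-quadrant (suc X) zero _ _ g≡) _ = begin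
          ((2 + A′) * e₁ + e₂) + 2 * e₁ ≤⟨ ≤-by {((2 + A′) * e₁ + e₂) + 2 * e₁} (suc (suc X) * ((2 + A′) * e₁ + e₂)) (A′ * e₁ + e₂ + X * ((2 + A′) * e₁ + e₂)) (solve (X ∷ A′ ∷ e₁ ∷ e₂ ∷ [])) ⟩
          suc (suc X) * ((2 + A′) * e₁ + e₂) ≡⟨ sym g≡ ⟩
          g + 0 * e₁ ≡⟨ ℕₚ.+-identityʳ g ⟩
          g ∎
      gap≥e₀+2e₁-below-Q₀+Q₁ A′ e₁ e₂ (first-quadrant (suc X) (suc Y) _ q≡ _) q<w = absurd-< q<w (begin
          Q₀ + Q₁ ≤⟨ ≤-by {Q₀ + Q₁} (suc (suc X) * Q₀ + suc Y * Q₁) (Q₀ + X * Q₀ + Y * Q₁) (solve (Q₀ ∷ Q₁ ∷ X ∷ Y ∷ [])) ⟩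
          suc (suc X) * Q₀ + suc Y * Q₁ ≡⟨ sym q≡ ⟩
          q ∎)
      gap≥e₀+2e₁-below-Q₀+Q₁ A′ e₁ e₂ (fourth-quadrant zero Y q≡ _) _ = ⊥-elim (¬fourth-quadrant-unit Q₀ Q₁ Y q 1≤q Q₀≤Q₁ q≡)
      gap≥e₀+2e₁-below-Q₀+Q₁ A′ e₁ e₂ (fourth-quadrant (suc X) Y _ refl) _ =
        ≤-by {((2 + A′) * e₁ + e₂) + 2 * e₁} (suc (suc X) * ((2 + A′) * e₁ + e₂) + suc Y * e₁) (suc A′ * e₁ + e₂ + X * ((2 + A′) * e₁ + e₂) + Y * e₁) (solve (X ∷ A′ ∷ e₁ ∷ e₂ ∷ Y ∷ []))
      gap≥e₀+2e₁-below-Q₀+Q₁ A′ e₁ e₂ (second-quadrant zero zero _ _) _ = ⊥-elim (¬m11 refl)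
      gap≥e₀+2e₁-below-Q₀+Q₁ A′ e₁ e₂ (second-quadrant zero (suc Y) _ refl) _ =
        ≤-by {((2 + A′) * e₁ + e₂) + 2 * e₁} _ (Y * e₁) (solve (A′ ∷ e₁ ∷ e₂ ∷ Y ∷ []))
      gap≥e₀+2e₁-below-Q₀+Q₁ A′ e₁ e₂ (second-quadrant (suc X) Y _ refl) _ =
        ≤-by {((2 + A′) * e₁ + e₂) + 2 * e₁} (suc (suc X) * ((2 + A′) * e₁ + e₂) + suc Y * e₁) (suc A′ * e₁ + e₂ + X * ((2 + A′) * e₁ + e₂) + Y * e₁) (solve (X ∷ A′ ∷ e₁ ∷ e₂ ∷ Y ∷ []))

      gap≥2e₀ : ∀ A′ e₁ e₂ {w} → Shape Q₀ Q₁ (2 + A′) ((2 + A′) * e₁ + e₂) e₁ q g x y →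
        q < w → w + Q₀ ≡ 2 * Q₁ → Q₁ ≤ 2 * Q₀ → 2 * ((2 + A′) * e₁ + e₂) ≤ g
      gap≥2e₀ A′ e₁ e₂ {w} (y-axis zero _ _) _ _ _ = ⊥-elim (¬01 refl)
      gap≥2e₀ A′ e₁ e₂ {w} (y-axis (suc Y) q≡ _) q<w w≡ _ = absurd-< q<w (begin
          w ≤⟨ ℕₚ.m≤m+n w Q₀ ⟩
          w + Q₀ ≡⟨ w≡ ⟩
          2 * Q₁ ≤⟨ ≤-by {2 * Q₁} (suc (suc Y) * Q₁) (Y * Q₁) (solve (Q₁ ∷ Y ∷ [])) ⟩
          suc (suc Y) * Q₁ ≡⟨ sym q≡ ⟩
          q ∎)
      gap≥2e₀ A′ e₁ e₂ {w} (first-quadrant zero zero _ _ _) _ _ _ = ⊥-elim (¬10 refl)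
      gap≥2e₀ A′ e₁ e₂ {w} (first-quadrant zero (suc Y) _ q≡ _) q<w w≡ Q₁≤2Q₀ = absurd-< q<w (begin
          w ≤⟨ w≤Q₀+Q₁ w Q₀ Q₁ w≡ Q₁≤2Q₀ ⟩
          Q₀ + Q₁ ≤⟨ ≤-by {Q₀ + Q₁} (1 * Q₀ + suc Y * Q₁) (Y * Q₁) (solve (Q₀ ∷ Q₁ ∷ Y ∷ [])) ⟩
          1 * Q₀ + suc Y * Q₁ ≡⟨ sym q≡ ⟩
          q ∎)
      gap≥2e₀ A′ e₁ e₂ {w} (first-quadrant (suc X) zero _ _ g≡) _ _ _ = begin
          2 * ((2 + A′) * e₁ + e₂) ≤⟨ ≤-by {2 * ((2 + A′) * e₁ + e₂)} (suc (suc X) * ((2 + A′) * e₁ + e₂)) (X * ((2 + A′) * e₁ + e₂)) (solve (X ∷ A′ ∷ e₁ ∷ e₂ ∷ [])) ⟩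
          suc (suc X) * ((2 + A′) * e₁ + e₂) ≡⟨ sym g≡ ⟩
          g + 0 * e₁ ≡⟨ ℕₚ.+-identityʳ g ⟩
          g ∎
      gap≥2e₀ A′ e₁ e₂ {w} (first-quadrant (suc X) (suc Y) _ q≡ _) q<w w≡ Q₁≤2Q₀ = absurd-< q<w (begin
          w ≤⟨ w≤Q₀+Q₁ w Q₀ Q₁ w≡ Q₁≤2Q₀ ⟩
          Q₀ + Q₁ ≤⟨ ≤-by {Q₀ + Q₁} (suc (suc X) * Q₀ + suc Y * Q₁) (Q₀ + X * Q₀ + Y * Q₁) (solve (Q₀ ∷ Q₁ ∷ X ∷ Y ∷ [])) ⟩
          suc (suc X) * Q₀ + suc Y * Q₁ ≡⟨ sym q≡ ⟩
          q ∎)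
      gap≥2e₀ A′ e₁ e₂ {w} (fourth-quadrant zero Y q≡ _) _ _ _ = ⊥-elim (¬fourth-quadrant-unit Q₀ Q₁ Y q 1≤q Q₀≤Q₁ q≡)
      gap≥2e₀ A′ e₁ e₂ {w} (fourth-quadrant (suc X) Y _ refl) _ _ _ =
        ≤-by {2 * ((2 + A′) * e₁ + e₂)} _ (X * ((2 + A′) * e₁ + e₂) + suc Y * e₁) (solve (X ∷ A′ ∷ e₁ ∷ e₂ ∷ Y ∷ []))
      gap≥2e₀ A′ e₁ e₂ {w} (second-quadrant zero zero _ _) _ _ _ = ⊥-elim (¬m11 refl)
      gap≥2e₀ A′ e₁ e₂ {w} (second-quadrant zero (suc Y) q≡ _) q<w w≡ _ = absurd-< q<w (ℕₚ.+-cancelʳ-≤ Q₀ w q (begin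
          w + Q₀ ≡⟨ w≡ ⟩
          2 * Q₁ ≤⟨ ≤-by {2 * Q₁} (suc (suc Y) * Q₁) (Y * Q₁) (solve (Q₁ ∷ Y ∷ [])) ⟩
          suc (suc Y) * Q₁ ≡⟨ sym q≡ ⟩
          q + 1 * Q₀ ≡⟨ cong (λ u → q + u) (ℕₚ.*-identityˡ Q₀) ⟩
          q + Q₀ ∎))
      gap≥2e₀ A′ e₁ e₂ {w} (second-quadrant (suc X) Y _ refl) _ _ _ =
        ≤-by {2 * ((2 + A′) * e₁ + e₂)} _ (X * ((2 + A′) * e₁ + e₂) + suc Y * e₁) (solve (X ∷ A′ ∷ e₁ ∷ e₂ ∷ Y ∷ []))

      gap≥2e₀+e₁ : ∀ A′ e₁ e₂ {w} → Shape Q₀ Q₁ (1 + A′) ((1 + A′) * e₁ + e₂) e₁ q g x y →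
        q < w → w + Q₀ ≡ 2 * Q₁ → Q₁ ≤ 2 * Q₀ → 2 * Q₁ ≤ 3 * Q₀ → 2 * ((1 + A′) * e₁ + e₂) + e₁ ≤ g
      gap≥2e₀+e₁ A′ e₁ e₂ {w} (y-axis zero _ _) _ _ _ _ = ⊥-elim (¬01 refl)
      gap≥2e₀+e₁ A′ e₁ e₂ {w} (y-axis (suc Y) q≡ _) q<w w≡ _ _ = absurd-< q<w (begin
          w ≤⟨ ℕₚ.m≤m+n w Q₀ ⟩
          w + Q₀ ≡⟨ w≡ ⟩
          2 * Q₁ ≤⟨ ≤-by {2 * Q₁} (suc (suc Y) * Q₁) (Y * Q₁) (solve (Q₁ ∷ Y ∷ [])) ⟩
          suc (suc Y) * Q₁ ≡⟨ sym q≡ ⟩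
          q ∎)
      gap≥2e₀+e₁ A′ e₁ e₂ {w} (first-quadrant zero zero _ _ _) _ _ _ _ = ⊥-elim (¬10 refl)
      gap≥2e₀+e₁ A′ e₁ e₂ {w} (first-quadrant zero (suc Y) _ q≡ _) q<w w≡ Q₁≤2Q₀ _ = absurd-< q<w (begin
          w ≤⟨ w≤Q₀+Q₁ w Q₀ Q₁ w≡ Q₁≤2Q₀ ⟩
          Q₀ + Q₁ ≤⟨ ≤-by {Q₀ + Q₁} (1 * Q₀ + suc Y * Q₁) (Y * Q₁) (solve (Q₀ ∷ Q₁ ∷ Y ∷ [])) ⟩
          1 * Q₀ + suc Y * Q₁ ≡⟨ sym q≡ ⟩
          q ∎)
      gap≥2e₀+e₁ A′ e₁ e₂ {w} (first-quadrant (suc zero) zero _ q≡ _) q<w w≡ _ 2Q₁≤3Q₀ =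
        absurd-< q<w (ℕₚ.+-cancelʳ-≤ Q₀ w q (begin
          w + Q₀ ≡⟨ w≡ ⟩
          2 * Q₁ ≤⟨ 2Q₁≤3Q₀ ⟩
          3 * Q₀ ≡⟨ solve (Q₀ ∷ Q₁ ∷ []) ⟩
          (2 * Q₀ + 0 * Q₁) + Q₀ ≡⟨ cong (_+ Q₀) (sym q≡) ⟩
          q + Q₀ ∎))
      gap≥2e₀+e₁ A′ e₁ e₂ {w} (first-quadrant (suc (suc X)) zero _ _ g≡) _ _ _ _ = begin
          2 * ((1 + A′) * e₁ + e₂) + e₁ ≤⟨ ≤-by {2 * ((1 + A′) * e₁ + e₂) + e₁} (suc (suc (suc X)) * ((1 + A′) * e₁ + e₂)) (A′ * e₁ + e₂ + X * ((1 + A′) * e₁ + e₂)) (solve (X ∷ A′ ∷ e₁ ∷ e₂ ∷ [])) ⟩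
          suc (suc (suc X)) * ((1 + A′) * e₁ + e₂) ≡⟨ sym g≡ ⟩
          g + 0 * e₁ ≡⟨ ℕₚ.+-identityʳ g ⟩
          g ∎
      gap≥2e₀+e₁ A′ e₁ e₂ {w} (first-quadrant (suc X) (suc Y) _ q≡ _) q<w w≡ Q₁≤2Q₀ _ = absurd-< q<w (begin
          w ≤⟨ w≤Q₀+Q₁ w Q₀ Q₁ w≡ Q₁≤2Q₀ ⟩
          Q₀ + Q₁ ≤⟨ ≤-by {Q₀ + Q₁} (suc (suc X) * Q₀ + suc Y * Q₁) (Q₀ + X * Q₀ + Y * Q₁) (solve (Q₀ ∷ Q₁ ∷ X ∷ Y ∷ [])) ⟩
          suc (suc X) * Q₀ + suc Y * Q₁ ≡⟨ sym q≡ ⟩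
          q ∎)
      gap≥2e₀+e₁ A′ e₁ e₂ {w} (fourth-quadrant zero Y q≡ _) _ _ _ _ = ⊥-elim (¬fourth-quadrant-unit Q₀ Q₁ Y q 1≤q Q₀≤Q₁ q≡)
      gap≥2e₀+e₁ A′ e₁ e₂ {w} (fourth-quadrant (suc X) Y _ refl) _ _ _ _ =
        ≤-by {2 * ((1 + A′) * e₁ + e₂) + e₁} (suc (suc X) * ((1 + A′) * e₁ + e₂) + suc Y * e₁) (X * ((1 + A′) * e₁ + e₂) + Y * e₁) (solve (X ∷ A′ ∷ e₁ ∷ e₂ ∷ Y ∷ []))
      gap≥2e₀+e₁ A′ e₁ e₂ {w} (second-quadrant zero zero _ _) _ _ _ _ = ⊥-elim (¬m11 refl)
      gap≥2e₀+e₁ A′ e₁ e₂ {w} (second-quadrant zero (suc Y) q≡ _) q<w w≡ _ _ = absurd-< q<w (ℕₚ.+-cancelʳ-≤ Q₀ w q (begin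
          w + Q₀ ≡⟨ w≡ ⟩
          2 * Q₁ ≤⟨ ≤-by {2 * Q₁} (suc (suc Y) * Q₁) (Y * Q₁) (solve (Q₁ ∷ Y ∷ [])) ⟩
          suc (suc Y) * Q₁ ≡⟨ sym q≡ ⟩
          q + 1 * Q₀ ≡⟨ cong (λ u → q + u) (ℕₚ.*-identityˡ Q₀) ⟩
          q + Q₀ ∎))
      gap≥2e₀+e₁ A′ e₁ e₂ {w} (second-quadrant (suc X) Y _ refl) _ _ _ _ =
        ≤-by {2 * ((1 + A′) * e₁ + e₂) + e₁} (suc (suc X) * ((1 + A′) * e₁ + e₂) + suc Y * e₁) (X * ((1 + A′) * e₁ + e₂) + Y * e₁) (solve (X ∷ A′ ∷ e₁ ∷ e₂ ∷ Y ∷ []))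

      gap≥2e₀+2e₁ : ∀ A′ e₁ e₂ → (x , y) ≢ (+ 2 , -[1+ 0 ]) → Shape Q₀ Q₁ (1 + A′) ((1 + A′) * e₁ + e₂) e₁ q g x y →
        q < 2 * Q₀ → Q₁ ≤ 2 * Q₀ → 3 * Q₀ ≤ 2 * Q₁ → 2 * ((1 + A′) * e₁ + e₂) + 2 * e₁ ≤ g
      gap≥2e₀+2e₁ A′ e₁ e₂ _ (y-axis zero _ _) _ _ _ = ⊥-elim (¬01 refl)
      gap≥2e₀+2e₁ A′ e₁ e₂ _ (y-axis (suc Y) q≡ _) q<w _ _ = absurd-< q<w (begin
          2 * Q₀ ≤⟨ ℕₚ.*-monoʳ-≤ 2 Q₀≤Q₁ ⟩
          2 * Q₁ ≤⟨ ≤-by {2 * Q₁} (suc (suc Y) * Q₁) (Y * Q₁) (solve (Q₁ ∷ Y ∷ [])) ⟩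
          suc (suc Y) * Q₁ ≡⟨ sym q≡ ⟩
          q ∎)
      gap≥2e₀+2e₁ A′ e₁ e₂ _ (first-quadrant zero zero _ _ _) _ _ _ = ⊥-elim (¬10 refl)
      gap≥2e₀+2e₁ A′ e₁ e₂ _ (first-quadrant zero (suc Y) _ q≡ _) q<w _ _ = absurd-< q<w (begin
          2 * Q₀ ≡⟨ solve (Q₀ ∷ []) ⟩
          Q₀ + Q₀ ≤⟨ ℕₚ.+-monoʳ-≤ Q₀ Q₀≤Q₁ ⟩
          Q₀ + Q₁ ≤⟨ ≤-by {Q₀ + Q₁} (1 * Q₀ + suc Y * Q₁) (Y * Q₁) (solve (Q₀ ∷ Q₁ ∷ Y ∷ [])) ⟩
          1 * Q₀ + suc Y * Q₁ ≡⟨ sym q≡ ⟩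
          q ∎)
      gap≥2e₀+2e₁ A′ e₁ e₂ _ (first-quadrant (suc X) Y _ q≡ _) q<w _ _ = absurd-< q<w (begin
          2 * Q₀ ≤⟨ ≤-by {2 * Q₀} (suc (suc X) * Q₀ + Y * Q₁) (X * Q₀ + Y * Q₁) (solve (Q₀ ∷ Q₁ ∷ X ∷ Y ∷ [])) ⟩
          suc (suc X) * Q₀ + Y * Q₁ ≡⟨ sym q≡ ⟩
          q ∎)
      gap≥2e₀+2e₁ A′ e₁ e₂ _ (fourth-quadrant zero Y q≡ _) _ _ _ = ⊥-elim (¬fourth-quadrant-unit Q₀ Q₁ Y q 1≤q Q₀≤Q₁ q≡)
      gap≥2e₀+2e₁ A′ e₁ e₂ ¬2m1 (fourth-quadrant (suc zero) zero _ _) _ _ _ = ⊥-elim (¬2m1 refl)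
      gap≥2e₀+2e₁ A′ e₁ e₂ _ (fourth-quadrant (suc zero) (suc Y) _ refl) _ _ _ =
        ≤-by {2 * ((1 + A′) * e₁ + e₂) + 2 * e₁} _ (Y * e₁) (solve (A′ ∷ e₁ ∷ e₂ ∷ Y ∷ []))
      gap≥2e₀+2e₁ A′ e₁ e₂ _ (fourth-quadrant (suc (suc X)) Y _ refl) _ _ _ =
        ≤-by {2 * ((1 + A′) * e₁ + e₂) + 2 * e₁} _ (A′ * e₁ + e₂ + X * ((1 + A′) * e₁ + e₂) + Y * e₁) (solve (X ∷ A′ ∷ e₁ ∷ e₂ ∷ Y ∷ []))
      gap≥2e₀+2e₁ A′ e₁ e₂ _ (second-quadrant zero zero _ _) _ _ _ = ⊥-elim (¬m11 refl)
      gap≥2e₀+2e₁ A′ e₁ e₂ _ (second-quadrant zero (suc Y) q≡ _) q<w _ 3Q₀≤2Q₁ =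
        absurd-< q<w (ℕₚ.+-cancelʳ-≤ Q₀ (2 * Q₀) q (begin
          2 * Q₀ + Q₀ ≡⟨ solve (Q₀ ∷ []) ⟩
          3 * Q₀ ≤⟨ 3Q₀≤2Q₁ ⟩
          2 * Q₁ ≤⟨ ≤-by {2 * Q₁} (suc (suc Y) * Q₁) (Y * Q₁) (solve (Q₁ ∷ Y ∷ [])) ⟩
          suc (suc Y) * Q₁ ≡⟨ sym q≡ ⟩
          q + 1 * Q₀ ≡⟨ cong (λ u → q + u) (ℕₚ.*-identityˡ Q₀) ⟩
          q + Q₀ ∎))
      gap≥2e₀+2e₁ A′ e₁ e₂ _ (second-quadrant (suc X) zero q≡ _) _ Q₁≤2Q₀ _ =
        ⊥-elim (ℕₚ.<-irrefl refl (ℕₚ.<-≤-trans (ℕₚ.m<n+m (2 * Q₀) 1≤q) (begin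
          q + 2 * Q₀ ≤⟨ ≤-by {q + 2 * Q₀} (q + suc (suc X) * Q₀) (X * Q₀) (solve (q ∷ Q₀ ∷ X ∷ [])) ⟩
          q + suc (suc X) * Q₀ ≡⟨ q≡ ⟩
          1 * Q₁ ≡⟨ ℕₚ.*-identityˡ Q₁ ⟩
          Q₁ ≤⟨ Q₁≤2Q₀ ⟩
          2 * Q₀ ∎)))
      gap≥2e₀+2e₁ A′ e₁ e₂ _ (second-quadrant (suc X) (suc Y) _ refl) _ _ _ =
        ≤-by {2 * ((1 + A′) * e₁ + e₂) + 2 * e₁} _ (X * ((1 + A′) * e₁ + e₂) + Y * e₁) (solve (X ∷ A′ ∷ e₁ ∷ e₂ ∷ Y ∷ []))

open LowerBounds

-- Consecutive elements of 𝔔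

-- u and w are consecutive elements of 𝔔: the non-convergent (u , pu) is a best
-- approximation among the non-convergents of denominator below w, and (w , pw)
-- beats all of them.
record Consecutive (a : ℕ → ℕ) (u w : ℕ) : Set where
  field
    pu pw : ℤ
    1≤u : 1 ≤ u
    u-non-convergent : ¬ IsConvergent a pu u
    w-non-convergent : ¬ IsConvergent a pw w
    u-best : ∀ q p → 1 ≤ q → q < w → ¬ IsConvergent a p q → ¬ Closer a (+ q) p (+ u) pu
    w-record : ∀ q p → 1 ≤ q → q < w → ¬ IsConvergent a p q → Closer a (+ w) pw (+ q) p

module ConsecutivePairs (a : ℕ → ℕ) (ha : ∀ n → 1 ≤ a (suc n)) where

  open ContinuedFraction a ha

  consecutive-from-eventually : ∀ {u w} pu pw → 1 ≤ u → ¬ IsConvergent a pu u → ¬ IsConvergent a pw w →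
    Eventually (λ K → ∣ form K (+ w) pw ∣ < ∣ form K (+ u) pu ∣) →
    (∀ q p → 1 ≤ q → q < w → ¬ IsConvergent a p q → Eventually (λ K → ∣ form K (+ u) pu ∣ ≤ ∣ form K (+ q) p ∣)) →
    Consecutive a u w
  consecutive-from-eventually {u} {w} pu pw 1≤u ¬conv-u ¬conv-w w-beats-u u-minimal = record
    { pu = pu ; pw = pw ; 1≤u = 1≤u ; u-non-convergent = ¬conv-u ; w-non-convergent = ¬conv-w
    ; u-best = λ q p 1≤q q<w ¬conv closer →
        let (K , lt , ge) = eventually-witness (eventually-zip (Closer⇒eventually (+ q) p (+ u) pu closer)
                                                               (u-minimal q p 1≤q q<w ¬conv) λ _ lt ge → lt , ge)
        in ℕₚ.<⇒≱ lt ge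
    ; w-record = λ q p 1≤q q<w ¬conv →
        eventually⇒Closer w pw q p 1≤q (eventually-zip w-beats-u (u-minimal q p 1≤q q<w ¬conv) λ _ → ℕₚ.<-≤-trans)
    }

  Avoids : ℕ → ℤ → ℤ → Set
  Avoids L x y = ∀ {x₀ y₀} → ConvergentCoordinates L x₀ y₀ → (x , y) ≢ (x₀ , y₀)

  consecutive-from-coordinates : ∀ L {u w} xu yu xw yw → + u ≡ qOf L xu yu → + w ≡ qOf L xw yw → 1 ≤ u →
    ¬ IsConvergent a (pOf L xu yu) u → ¬ IsConvergent a (pOf L xw yw) w →
    (∀ K → 4 + L ≤ K → gap L K xw yw < gap L K xu yu) →
    (∀ K → 4 + L ≤ K → ∀ x y {q} → + q ≡ qOf L x y → 1 ≤ q → q < w → Avoids L x y → gap L K xu yu ≤ gap L K x y) →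
    Consecutive a u w
  consecutive-from-coordinates L {u} {w} xu yu xw yw u≡ w≡ 1≤u ¬conv-u ¬conv-w w-beats-u u-minimal =
    consecutive-from-eventually (pOf L xu yu) (pOf L xw yw) 1≤u ¬conv-u ¬conv-w
      (4 + L , λ K L+4≤K → subst₂ _<_ (sym (in-coordinates K L+4≤K xw yw w≡)) (sym (in-coordinates K L+4≤K xu yu u≡)) (w-beats-u K L+4≤K))
      λ q p 1≤q q<w ¬conv → 4 + L , λ K L+4≤K → minimal q p 1≤q q<w ¬conv K L+4≤K (coordinates L (+ q) p)
    where
    in-coordinates : ∀ K → 4 + L ≤ K → ∀ {v} x y → + v ≡ qOf L x y → ∣ form K (+ v) (pOf L x y) ∣ ≡ gap L K x y
    in-coordinates K L+4≤K x y v≡ =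
      trans (cong (λ t → ∣ form K t (pOf L x y) ∣) v≡) (∣form∣-in-coordinates L K x y (ℕₚ.≤-trans (ℕₚ.m≤n+m (suc L) 3) L+4≤K))
    minimal : ∀ q p → 1 ≤ q → q < w → ¬ IsConvergent a p q → ∀ K → 4 + L ≤ K →
      (Σ ℤ λ x → Σ ℤ λ y → + q ≡ qOf L x y × p ≡ pOf L x y) → ∣ form K (+ u) (pOf L xu yu) ∣ ≤ ∣ form K (+ q) p ∣
    minimal q p 1≤q q<w ¬conv K L+4≤K (x , y , q≡ , refl) =
      subst₂ _≤_ (sym (in-coordinates K L+4≤K xu yu u≡)) (sym (in-coordinates K L+4≤K x y q≡))
      (u-minimal K L+4≤K x y q≡ 1≤q q<w λ c → avoids-convergent {L} c q≡ refl 1≤q ¬conv)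

  module AtLevel (L K : ℕ) (L+4≤K : 4 + L ≤ K) where

    e₀ e₁ e₂ : ℕ
    e₀ = δ L K
    e₁ = δ (suc L) K
    e₂ = δ (suc (suc L)) K

    e₀≡ : ∀ {A} → a (suc L) ≡ A → e₀ ≡ A * e₁ + e₂
    e₀≡ refl = δ-rec L K (ℕₚ.≤-trans (ℕₚ.m≤n+m (suc (suc L)) 2) L+4≤K)

    e₂≥1 : 1 ≤ e₂
    e₂≥1 = δ-pos (suc (suc L)) K (ℕₚ.≤-trans (ℕₚ.n≤1+n _) L+4≤K)

    e₂<e₁ : e₂ < e₁
    e₂<e₁ = δ-decreasing L K L+4≤K

    e₁≥1 : 1 ≤ e₁
    e₁≥1 = ℕₚ.≤-trans e₂≥1 (ℕₚ.<⇒≤ e₂<e₁)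

    shape : ∀ {A x y q} → a (suc L) ≡ A → + q ≡ qOf L x y → 1 ≤ q → q < Q (suc (suc L)) →
      Shape (Q L) (Q (suc L)) A (A * e₁ + e₂) e₁ q (gap L K x y) x y
    shape {A} {x} {y} {q} a≡A@refl q≡ 1≤q q<bound =
      subst (λ E → Shape (Q L) (Q (suc L)) A E e₁ q (gap L K x y) x y) (e₀≡ a≡A) (classify {e₂ = e₂} x y (e₀≡ a≡A) q≡ 1≤q q<bound)

  2*Q≤Q⁺ : ∀ m → 2 ≤ a (suc m) → 2 * Q (suc m) ≤ Q (suc (suc m))
  2*Q≤Q⁺ m 2≤a = ℕₚ.≤-trans (ℕₚ.*-monoˡ-≤ (Q (suc m)) 2≤a) (ℕₚ.m≤m+n _ (Q m))

  Q⁺≤2*Q : ∀ m → a (suc m) ≡ 1 → Q (suc (suc m)) ≤ 2 * Q (suc m)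
  Q⁺≤2*Q m a≡1 = ℕₚ.≤-trans (ℕₚ.≤-reflexive (cong (λ A → A * Q (suc m) + Q m) a≡1))
    (ℕₚ.≤-trans (ℕₚ.+-monoʳ-≤ (1 * Q (suc m)) (Q-step m)) (ℕₚ.≤-reflexive (double (Q (suc m)))))
    where
    double : ∀ n → 1 * n + n ≡ 2 * n
    double = ℕ-solve-∀

  Q⁺∸Q≡ : ∀ m A′ → a (suc m) ≡ suc A′ → Q (suc (suc m)) ∸ Q (suc m) ≡ Q m + A′ * Q (suc m)
  Q⁺∸Q≡ m A′ a≡ = trans (cong (λ A → A * Q (suc m) + Q m ∸ Q (suc m)) a≡)
    (trans (cong (_∸ Q (suc m)) (regroup A′ (Q (suc m)) (Q m))) (ℕₚ.m+n∸m≡n (Q (suc m)) _))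
    where
    regroup : ∀ A′ x y → suc A′ * x + y ≡ x + (y + A′ * x)
    regroup = ℕ-solve-∀

  mediant-coordinates : ∀ L → + (Q L + Q (suc L)) ≡ qOf L (+ 1) (+ 1)
  mediant-coordinates L = trans (ℤₚ.pos-+ (Q L) (Q (suc L))) (identity (Qᶻ L) (Qᶻ (suc L)))
    where
    identity : ∀ (u v : ℤ) → u +ᶻ v ≡ + 1 *ᶻ u +ᶻ + 1 *ᶻ v
    identity = solve-∀

  doubled-coordinates : ∀ L x y c → + c ≡ qOf L x y → + (2 * c) ≡ qOf L (+ 2 *ᶻ x) (+ 2 *ᶻ y)
  doubled-coordinates L x y c c≡ = trans (ℤₚ.pos-* 2 c) (trans (cong (+ 2 *ᶻ_) c≡) (identity x y (Qᶻ L) (Qᶻ (suc L))))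
    where
    identity : ∀ (x y u v : ℤ) → + 2 *ᶻ (x *ᶻ u +ᶻ y *ᶻ v) ≡ (+ 2 *ᶻ x) *ᶻ u +ᶻ (+ 2 *ᶻ y) *ᶻ v
    identity = solve-∀

  doubled-¬convergent : ∀ L x y c → ¬ IsConvergent a (pOf L (+ 2 *ᶻ x) (+ 2 *ᶻ y)) (2 * c)
  doubled-¬convergent L x y c = ¬convergent-even (2 * c) _ c (pOf L x y) refl (identity x y (Pᶻ L) (Pᶻ (suc L)))
    where
    identity : ∀ (x y u v : ℤ) → (+ 2 *ᶻ x) *ᶻ u +ᶻ (+ 2 *ᶻ y) *ᶻ v ≡ + 2 *ᶻ (x *ᶻ u +ᶻ y *ᶻ v)
    identity = solve-∀

  basis₁-coordinates : ∀ L → + Q (suc L) ≡ qOf L (+ 0) (+ 1)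
  basis₁-coordinates L = sym (proj₁ (proj₂ (convergent-coordinates₁ L)))

  basis₀-coordinates : ∀ L → + Q L ≡ qOf L (+ 1) (+ 0)
  basis₀-coordinates L = sym (proj₁ (proj₂ (convergent-coordinates₀ L)))

  P₂≡1 : Pᶻ 2 ≡ + 1
  P₂≡1 = cong (λ t → + (t + 1)) (ℕₚ.*-zeroʳ (a 1))

  -- The only convergents of denominator 1 are 0/1 and, if a₁ = 1, 1/1.
  ¬convergent-1/1 : 2 ≤ a 1 → ¬ IsConvergent a (+ 1) 1
  ¬convergent-1/1 2≤a₁ (zero , () , _)
  ¬convergent-1/1 2≤a₁ (suc n , _ , 1≡) = ℕₚ.<⇒≱ (ℕₚ.≤-trans 2≤a₁
    (ℕₚ.≤-trans (ℕₚ.≤-reflexive (sym (trans (ℕₚ.+-identityʳ _) (ℕₚ.*-identityʳ (a 1))))) (Q-mono {2} {suc (suc n)} (s≤s (s≤s z≤n)))))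
    (ℕₚ.≤-reflexive (sym 1≡))

  ¬convergent-2/1 : ¬ IsConvergent a (+ 2) 1
  ¬convergent-2/1 (zero , () , _)
  ¬convergent-2/1 (suc zero , 2≡ , _) with () ← trans 2≡ P₂≡1
  ¬convergent-2/1 (suc (suc n) , _ , 1≡) = ℕₚ.<⇒≱ (ℕₚ.≤-trans (ℕₚ.+-mono-≤ (Q≥1 2 (s≤s z≤n)) (Q≥1 1 (s≤s z≤n)))
    (ℕₚ.≤-trans (Q-sum≤ 1) (Q-mono {3} {suc (suc (suc n))} (s≤s (s≤s (s≤s z≤n)))))) (ℕₚ.≤-reflexive (sym 1≡))

  mediant-¬convergent : ∀ m → 2 ≤ a (suc m) → ¬ IsConvergent a (pOf m (+ 1) (+ 1)) (Q m + Q (suc m))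
  mediant-¬convergent zero 2≤a = ¬convergent-1/1 2≤a
  mediant-¬convergent (suc k) 2≤a = ¬convergent-between (suc (suc k)) _ _
    (ℕₚ.m<n+m (Q (suc (suc k))) (Q≥1 (suc k) (s≤s z≤n)))
    (ℕₚ.≤-<-trans (ℕₚ.≤-reflexive (ℕₚ.+-comm (Q (suc k)) (Q (suc (suc k))))) (ℕₚ.+-monoˡ-< (Q (suc k))
      (ℕₚ.<-≤-trans (ℕₚ.m<m+n (Q (suc (suc k))) (Q≥1 (suc (suc k)) (s≤s z≤n)))
        (ℕₚ.≤-trans (ℕₚ.≤-reflexive (double (Q (suc (suc k))))) (ℕₚ.*-monoˡ-≤ (Q (suc (suc k))) 2≤a)))))
    where
    double : ∀ n → n + n ≡ 2 * n
    double = ℕ-solve-∀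

  consecutive-large-first : ∀ m A′ → a (suc m) ≡ 3 + A′ → Consecutive a (Q m + Q (suc m)) (2 * Q (suc m))
  consecutive-large-first m A′ a≡ = consecutive-from-coordinates m (+ 1) (+ 1) (+ 0) (+ 2)
    (mediant-coordinates m) (doubled-coordinates m (+ 0) (+ 1) (Q (suc m)) (basis₁-coordinates m))
    (ℕₚ.≤-trans (Q≥1 (suc m) (s≤s z≤n)) (ℕₚ.m≤n+m _ (Q m)))
    (mediant-¬convergent m (subst (2 ≤_) (sym a≡) (s≤s (s≤s z≤n)))) (doubled-¬convergent m (+ 0) (+ 1) (Q (suc m)))
    beats minimal
    where
    module _ (K : ℕ) (m+4≤K : 4 + m ≤ K) where
      open AtLevel m K m+4≤K
      gap-u : gap m K (+ 1) (+ 1) ≡ suc (suc A′) * e₁ + e₂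
      gap-u = trans (cong (λ t → ∣ + 1 *ᶻ + t -ᶻ + 1 *ᶻ + e₁ ∣) (trans (e₀≡ a≡) (split A′ e₁ e₂))) (gap-unit 1 e₁ _)
        where
        split : ∀ A′ e₁ e₂ → (3 + A′) * e₁ + e₂ ≡ 1 * e₁ + (suc (suc A′) * e₁ + e₂)
        split = ℕ-solve-∀
      beats : gap m K (+ 0) (+ 2) < gap m K (+ 1) (+ 1)
      beats = subst₂ _<_ (sym (gap-opposite⁻ 0 2 e₀ e₁)) (sym gap-u)
        (ℕₚ.<-≤-trans (ℕₚ.m<m+n (2 * e₁) e₂≥1) (ℕₚ.+-monoˡ-≤ e₂ (ℕₚ.*-monoˡ-≤ e₁ {2} {suc (suc A′)} (s≤s (s≤s z≤n)))))
      minimal : ∀ x y {q} → + q ≡ qOf m x y → 1 ≤ q → q < 2 * Q (suc m) → Avoids m x y → gap m K (+ 1) (+ 1) ≤ gap m K x y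
      minimal x y q≡ 1≤q q<w avoids = subst (_≤ gap m K x y) (sym gap-u)
        (gap≥e₀-e₁ (avoids (convergent-coordinates₀ m)) (avoids (convergent-coordinates₁ m)) A′ e₁ e₂
          (shape a≡ q≡ 1≤q (ℕₚ.<-≤-trans q<w (2*Q≤Q⁺ m (subst (2 ≤_) (sym a≡) (s≤s (s≤s z≤n)))))) q<w)

  consecutive-large-second : ∀ m A′ → a (suc m) ≡ 3 + A′ → Consecutive a (2 * Q (suc m)) (Q (suc (suc m)) ∸ Q (suc m))
  consecutive-large-second m A′ a≡ = consecutive-from-coordinates m (+ 0) (+ 2) (+ 1) (+ (2 + A′))
    (doubled-coordinates m (+ 0) (+ 1) (Q (suc m)) (basis₁-coordinates m)) w-coordinates
    (ℕₚ.≤-trans (Q≥1 (suc m) (s≤s z≤n)) (ℕₚ.m≤m+n _ _))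
    (doubled-¬convergent m (+ 0) (+ 1) (Q (suc m)))
    (subst (λ t → ¬ IsConvergent a (pOf m (+ 1) (+ (2 + A′))) t) (sym w≡) (¬convergent-between (suc m) _ _ Q<w w<Q))
    beats minimal
    where
    w≡ : Q (suc (suc m)) ∸ Q (suc m) ≡ Q m + (2 + A′) * Q (suc m)
    w≡ = Q⁺∸Q≡ m (2 + A′) a≡
    w-coordinates : + (Q (suc (suc m)) ∸ Q (suc m)) ≡ qOf m (+ 1) (+ (2 + A′))
    w-coordinates = trans (cong +_ w≡) (trans (ℤₚ.pos-+ (Q m) _) (trans (cong (Qᶻ m +ᶻ_) (ℤₚ.pos-* (2 + A′) (Q (suc m))))
      (identity (Qᶻ m) (+ (2 + A′)) (Qᶻ (suc m)))))
      where
      identity : ∀ (u k v : ℤ) → u +ᶻ k *ᶻ v ≡ + 1 *ᶻ u +ᶻ k *ᶻ v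
      identity = solve-∀
    Q<w : Q (suc m) < Q m + (2 + A′) * Q (suc m)
    Q<w = ℕₚ.<-≤-trans (ℕₚ.m<m+n (Q (suc m)) (Q≥1 (suc m) (s≤s z≤n)))
      (ℕₚ.≤-trans (ℕₚ.≤-reflexive (cong (λ t → Q (suc m) + t) (sym (ℕₚ.+-identityʳ (Q (suc m))))))
        (ℕₚ.≤-trans (ℕₚ.*-monoˡ-≤ (Q (suc m)) {2} {2 + A′} (s≤s (s≤s z≤n))) (ℕₚ.m≤n+m _ (Q m))))
    w<Q : Q m + (2 + A′) * Q (suc m) < Q (suc (suc m))
    w<Q = subst (Q m + (2 + A′) * Q (suc m) <_) (trans (sym (cong (_+ Q (suc m)) w≡)) (ℕₚ.m∸n+n≡m (Q-step (suc m))))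
      (ℕₚ.m<m+n _ (Q≥1 (suc m) (s≤s z≤n)))
    module _ (K : ℕ) (m+4≤K : 4 + m ≤ K) where
      open AtLevel m K m+4≤K
      gap-w : gap m K (+ 1) (+ (2 + A′)) ≡ e₁ + e₂
      gap-w =
        trans (cong (λ t → ∣ + 1 *ᶻ + t -ᶻ + (2 + A′) *ᶻ + e₁ ∣) (trans (e₀≡ a≡) (split A′ e₁ e₂))) (gap-unit (2 + A′) e₁ _)
        where
        split : ∀ A′ e₁ e₂ → (3 + A′) * e₁ + e₂ ≡ (2 + A′) * e₁ + (e₁ + e₂)
        split = ℕ-solve-∀
      beats : gap m K (+ 1) (+ (2 + A′)) < gap m K (+ 0) (+ 2)
      beats = subst₂ _<_ (sym gap-w) (sym (gap-opposite⁻ 0 2 e₀ e₁))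
        (ℕₚ.<-≤-trans (ℕₚ.+-monoʳ-< e₁ e₂<e₁) (ℕₚ.≤-reflexive (cong (λ t → e₁ + t) (sym (ℕₚ.+-identityʳ e₁)))))
      minimal : ∀ x y {q} → + q ≡ qOf m x y → 1 ≤ q → q < Q (suc (suc m)) ∸ Q (suc m) → Avoids m x y →
        gap m K (+ 0) (+ 2) ≤ gap m K x y
      minimal x y {q} q≡ 1≤q q<w avoids = subst (_≤ gap m K x y) (sym (gap-opposite⁻ 0 2 e₀ e₁))
        (gap≥2e₁ (avoids (convergent-coordinates₀ m)) (avoids (convergent-coordinates₁ m)) A′ e₁ e₂
          (shape a≡ q≡ 1≤q (ℕₚ.<-≤-trans q<w (ℕₚ.m∸n≤m (Q (suc (suc m))) (Q (suc m)))))
          (subst (q <_) (trans w≡ (cong (_+ (2 + A′) * Q (suc m)) (sym (ℕₚ.*-identityˡ (Q m))))) q<w))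

  2*Q≤Q⁺⁺ : ∀ m → 2 * Q (suc m) ≤ Q (suc (suc (suc m)))
  2*Q≤Q⁺⁺ m = begin
    2 * Q (suc m)                 ≡⟨ double (Q (suc m)) ⟩
    Q (suc m) + Q (suc m)         ≤⟨ ℕₚ.+-monoˡ-≤ (Q (suc m)) (Q-step (suc m)) ⟩
    Q (suc (suc m)) + Q (suc m)   ≤⟨ Q-sum≤ (suc m) ⟩
    Q (suc (suc (suc m)))         ∎
    where
    open ℕₚ.≤-Reasoning
    double : ∀ n → 2 * n ≡ n + n
    double = ℕ-solve-∀

  Q₀+Q₂<Q₃ : ∀ m → Q m < Q (suc m) → Q m + Q (suc (suc m)) < Q (suc (suc (suc m)))
  Q₀+Q₂<Q₃ m Q₀<Q₁ = begin-strict
    Q m + Q (suc (suc m))          <⟨ ℕₚ.+-monoˡ-< (Q (suc (suc m))) Q₀<Q₁ ⟩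
    Q (suc m) + Q (suc (suc m))    ≡⟨ ℕₚ.+-comm (Q (suc m)) _ ⟩
    Q (suc (suc m)) + Q (suc m)    ≤⟨ Q-sum≤ (suc m) ⟩
    Q (suc (suc (suc m)))          ∎
    where open ℕₚ.≤-Reasoning

  Q₀+Q₂<Q₃-when-2≤a : ∀ m → 2 ≤ a (suc (suc m)) → Q m + Q (suc (suc m)) < Q (suc (suc (suc m)))
  Q₀+Q₂<Q₃-when-2≤a m 2≤a = begin-strict
    Q m + Q (suc (suc m))                       <⟨ ℕₚ.+-monoˡ-< (Q (suc (suc m))) (ℕₚ.m<m+n (Q m) (Q≥1 (suc (suc m)) (s≤s z≤n))) ⟩
    Q m + Q (suc (suc m)) + Q (suc (suc m))     ≤⟨ ℕₚ.+-monoˡ-≤ (Q (suc (suc m))) (ℕₚ.+-monoˡ-≤ (Q (suc (suc m))) (Q-step m)) ⟩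
    Q (suc m) + Q (suc (suc m)) + Q (suc (suc m)) ≡⟨ regroup (Q (suc m)) (Q (suc (suc m))) ⟩
    2 * Q (suc (suc m)) + Q (suc m)             ≤⟨ ℕₚ.+-monoˡ-≤ (Q (suc m)) (ℕₚ.*-monoˡ-≤ (Q (suc (suc m))) 2≤a) ⟩
    Q (suc (suc (suc m)))                       ∎
    where
    open ℕₚ.≤-Reasoning
    regroup : ∀ x y → x + y + y ≡ 2 * y + x
    regroup = ℕ-solve-∀

  ones-value≡ : ∀ m → a (suc m) ≡ 1 → 2 * Q m + Q (suc m) ≡ Q (suc (suc m)) + Q m
  ones-value≡ m a≡1 = sym (trans (cong (λ A → A * Q (suc m) + Q m + Q m) a≡1) (regroup (Q (suc m)) (Q m)))
    where
    regroup : ∀ x y → 1 * x + y + y ≡ 2 * y + x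
    regroup = ℕ-solve-∀

  ones-coordinates : ∀ m → a (suc m) ≡ 1 → + (2 * Q m + Q (suc m)) ≡ qOf (suc m) -1ℤ (+ 2)
  ones-coordinates m a≡1 = trans (+-linear 2 (Q m) (Q (suc m)))
    (trans (identity (Qᶻ m) (Qᶻ (suc m))) (cong (λ t → -1ℤ *ᶻ Qᶻ (suc m) +ᶻ + 2 *ᶻ t) (sym Q₂≡)))
    where
    Q₂≡ : Qᶻ (suc (suc m)) ≡ + 1 *ᶻ Qᶻ (suc m) +ᶻ Qᶻ m
    Q₂≡ = trans (Qᶻ-rec m) (cong (λ A → + A *ᶻ Qᶻ (suc m) +ᶻ Qᶻ m) a≡1)
    identity : ∀ (x y : ℤ) → + 2 *ᶻ x +ᶻ y ≡ -1ℤ *ᶻ y +ᶻ + 2 *ᶻ (+ 1 *ᶻ y +ᶻ x)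
    identity = solve-∀

  ones-¬convergent : ∀ m → a (suc m) ≡ 1 → Q m + Q (suc (suc m)) < Q (suc (suc (suc m))) →
    ¬ IsConvergent a (pOf (suc m) -1ℤ (+ 2)) (2 * Q m + Q (suc m))
  ones-¬convergent zero a≡1 _ = subst (λ p → ¬ IsConvergent a p 1) (sym p≡2) ¬convergent-2/1
    where
    p≡2 : pOf 1 -1ℤ (+ 2) ≡ + 2
    p≡2 = cong (λ t → -1ℤ *ᶻ + 0 +ᶻ + 2 *ᶻ t) P₂≡1
  ones-¬convergent (suc k) a≡1 Q₀+Q₂<Q₃ =
    subst (λ t → ¬ IsConvergent a (pOf (suc (suc k)) -1ℤ (+ 2)) t) (sym (ones-value≡ (suc k) a≡1))
    (¬convergent-between (suc (suc (suc k))) _ _ (ℕₚ.m<m+n _ (Q≥1 (suc k) (s≤s z≤n)))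
      (subst (_< Q (suc (suc (suc (suc k))))) (ℕₚ.+-comm (Q (suc k)) _) Q₀+Q₂<Q₃))

  consecutive-ones-start : ∀ m → a (suc m) ≡ 1 → a (suc (suc m)) ≡ 1 → Q m < Q (suc m) →
    Consecutive a (2 * Q m + Q (suc m)) (2 * Q (suc m))
  consecutive-ones-start m a≡1 a′≡1 Q₀<Q₁ = consecutive-from-coordinates (suc m) -1ℤ (+ 2) (+ 2) (+ 0)
    (ones-coordinates m a≡1) (doubled-coordinates (suc m) (+ 1) (+ 0) (Q (suc m)) (basis₀-coordinates (suc m)))
    (ℕₚ.≤-trans (Q≥1 (suc m) (s≤s z≤n)) (ℕₚ.m≤n+m _ _))
    (ones-¬convergent m a≡1 (Q₀+Q₂<Q₃ m Q₀<Q₁)) (doubled-¬convergent (suc m) (+ 1) (+ 0) (Q (suc m)))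
    beats minimal
    where
    module _ (K : ℕ) (m+5≤K : 4 + suc m ≤ K) where
      open AtLevel (suc m) K m+5≤K
      beats : gap (suc m) K (+ 2) (+ 0) < gap (suc m) K -1ℤ (+ 2)
      beats = subst₂ _<_ (sym (gap-opposite⁺ 2 0 e₀ e₁)) (sym (gap-opposite⁻ 1 2 e₀ e₁)) (begin-strict
        2 * e₀ + 0           ≡⟨ regroup e₀ ⟩
        e₀ + e₀              ≡⟨ cong (λ t → e₀ + t) (trans (e₀≡ a′≡1) (ℕₚ.+-comm (1 * e₁) e₂)) ⟩
        e₀ + (e₂ + 1 * e₁)   <⟨ ℕₚ.+-monoʳ-< e₀ (ℕₚ.+-monoˡ-< (1 * e₁) e₂<e₁) ⟩
        e₀ + (e₁ + 1 * e₁)   ≡⟨ regroup′ e₀ e₁ ⟩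
        1 * e₀ + 2 * e₁      ∎)
        where
        open ℕₚ.≤-Reasoning
        regroup : ∀ x → 2 * x + 0 ≡ x + x
        regroup = ℕ-solve-∀
        regroup′ : ∀ x y → x + (y + 1 * y) ≡ 1 * x + 2 * y
        regroup′ = ℕ-solve-∀
      minimal : ∀ x y {q} → + q ≡ qOf (suc m) x y → 1 ≤ q → q < 2 * Q (suc m) → Avoids (suc m) x y →
        gap (suc m) K -1ℤ (+ 2) ≤ gap (suc m) K x y
      minimal x y q≡ 1≤q q<w avoids =
        subst (_≤ gap (suc m) K x y) (sym (trans (gap-opposite⁻ 1 2 e₀ e₁) (cong (λ t → t + 2 * e₁) e₀≡′)))
        (gap≥e₀+2e₁-below-2Q₀ (avoids (convergent-coordinates₀ (suc m))) (avoids (convergent-coordinates₁ (suc m)))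
          1≤q (Q-step (suc m)) (avoids (convergent-coordinates₋₁ m a≡1)) e₁ e₂
          (shape a′≡1 q≡ 1≤q (ℕₚ.<-≤-trans q<w (2*Q≤Q⁺⁺ m))) q<w)
        where
        e₀≡′ : 1 * e₀ ≡ 1 * e₁ + e₂
        e₀≡′ = trans (ℕₚ.*-identityˡ e₀) (e₀≡ a′≡1)

  consecutive-ones-end : ∀ m A′ → a (suc m) ≡ 1 → a (suc (suc m)) ≡ 2 + A′ →
    Consecutive a (2 * Q (suc m)) (2 * Q m + Q (suc m))
  consecutive-ones-end m A′ a≡1 a′≡ = consecutive-from-coordinates (suc m) (+ 2) (+ 0) -1ℤ (+ 2)
    (doubled-coordinates (suc m) (+ 1) (+ 0) (Q (suc m)) (basis₀-coordinates (suc m))) (ones-coordinates m a≡1)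
    (ℕₚ.≤-trans (Q≥1 (suc m) (s≤s z≤n)) (ℕₚ.m≤m+n _ _))
    (doubled-¬convergent (suc m) (+ 1) (+ 0) (Q (suc m))) (ones-¬convergent m a≡1 (Q₀+Q₂<Q₃-when-2≤a m 2≤a′))
    beats minimal
    where
    2≤a′ : 2 ≤ a (suc (suc m))
    2≤a′ = subst (2 ≤_) (sym a′≡) (s≤s (s≤s z≤n))
    w+Q≡ : (2 * Q m + Q (suc m)) + Q (suc m) ≡ 2 * Q (suc (suc m))
    w+Q≡ = trans (regroup (Q (suc m)) (Q m)) (cong (2 *_) (sym (cong (λ A → A * Q (suc m) + Q m) a≡1)))
      where
      regroup : ∀ x y → 2 * y + x + x ≡ 2 * (1 * x + y)
      regroup = ℕ-solve-∀
    module _ (K : ℕ) (m+5≤K : 4 + suc m ≤ K) where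
      open AtLevel (suc m) K m+5≤K
      gap-u : gap (suc m) K (+ 2) (+ 0) ≡ 2 * ((2 + A′) * e₁ + e₂)
      gap-u = trans (gap-opposite⁺ 2 0 e₀ e₁) (trans (ℕₚ.+-identityʳ (2 * e₀)) (cong (2 *_) (e₀≡ a′≡)))
      beats : gap (suc m) K -1ℤ (+ 2) < gap (suc m) K (+ 2) (+ 0)
      beats = subst₂ _<_ (sym (gap-opposite⁻ 1 2 e₀ e₁)) (sym (trans (gap-opposite⁺ 2 0 e₀ e₁) (regroup e₀)))
        (ℕₚ.+-monoʳ-< (1 * e₀) (subst (2 * e₁ <_) (sym (trans (e₀≡ a′≡) (split A′ e₁ e₂)))
          (ℕₚ.m<m+n (2 * e₁) (ℕₚ.≤-trans e₂≥1 (ℕₚ.m≤n+m e₂ (A′ * e₁))))))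
        where
        regroup : ∀ x → 2 * x + 0 * 0 ≡ 1 * x + x
        regroup = ℕ-solve-∀
        split : ∀ A′ e₁ e₂ → (2 + A′) * e₁ + e₂ ≡ 2 * e₁ + (A′ * e₁ + e₂)
        split = ℕ-solve-∀
      minimal : ∀ x y {q} → + q ≡ qOf (suc m) x y → 1 ≤ q → q < 2 * Q m + Q (suc m) → Avoids (suc m) x y →
        gap (suc m) K (+ 2) (+ 0) ≤ gap (suc m) K x y
      minimal x y q≡ 1≤q q<w avoids = subst (_≤ gap (suc m) K x y) (sym gap-u)
        (gap≥2e₀ (avoids (convergent-coordinates₀ (suc m))) (avoids (convergent-coordinates₁ (suc m)))
          1≤q (Q-step (suc m)) (avoids (convergent-coordinates₋₁ m a≡1)) A′ e₁ e₂
          (shape a′≡ q≡ 1≤q (ℕₚ.<-≤-trans q<w w≤Q₃)) q<w w+Q≡ (Q⁺≤2*Q m a≡1))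
        where
        w≤Q₃ : 2 * Q m + Q (suc m) ≤ Q (suc (suc (suc m)))
        w≤Q₃ = ℕₚ.≤-trans (ℕₚ.m≤m+n _ (Q (suc m))) (ℕₚ.≤-trans (ℕₚ.≤-reflexive w+Q≡)
          (ℕₚ.≤-trans (ℕₚ.*-monoˡ-≤ (Q (suc (suc m))) 2≤a′) (ℕₚ.m≤m+n _ (Q (suc m)))))

  ∸-to-ℤ : ∀ {m n} → m ≤ n → + (n ∸ m) ≡ + n -ᶻ + m
  ∸-to-ℤ {m} {n} m≤n = sym (trans (ℤₚ.m-n≡m⊖n n m) (ℤₚ.⊖-≥ m≤n))

  Q⁺∸Q-coordinates : ∀ L → + (Q (suc (suc L)) ∸ Q (suc L)) ≡ qOf (suc L) -1ℤ (+ 1)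
  Q⁺∸Q-coordinates L = trans (∸-to-ℤ (Q-step (suc L))) (identity (Qᶻ (suc L)) (Qᶻ (suc (suc L))))
    where
    identity : ∀ (x y : ℤ) → y -ᶻ x ≡ -1ℤ *ᶻ x +ᶻ + 1 *ᶻ y
    identity = solve-∀

  1≤Q⁺∸Q : ∀ m → 2 ≤ a (suc m) → 1 ≤ Q (suc (suc m)) ∸ Q (suc m)
  1≤Q⁺∸Q m 2≤a = ℕₚ.m<n⇒0<n∸m (ℕₚ.<-≤-trans (ℕₚ.m<m+n (Q (suc m)) (Q≥1 (suc m) (s≤s z≤n)))
    (ℕₚ.≤-trans (ℕₚ.≤-reflexive (cong (λ t → Q (suc m) + t) (sym (ℕₚ.+-identityʳ (Q (suc m)))))) (2*Q≤Q⁺ m 2≤a)))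

  Q⁺∸Q-¬convergent-if : ∀ m p → 2 * Q (suc m) < Q (suc (suc m)) → ¬ IsConvergent a p (Q (suc (suc m)) ∸ Q (suc m))
  Q⁺∸Q-¬convergent-if m p 2Q<Q⁺ = ¬convergent-between (suc m) _ p
    (ℕₚ.m+n≤o⇒m≤o∸n (suc (Q (suc m))) (subst (_< Q (suc (suc m))) (double (Q (suc m))) 2Q<Q⁺))
    (ℕₚ.∸-monoʳ-< {Q (suc (suc m))} {Q (suc m)} {0} (Q≥1 (suc m) (s≤s z≤n)) (Q-step (suc m)))
    where
    double : ∀ n → 2 * n ≡ n + n
    double = ℕ-solve-∀

  Q⁺∸Q-¬convergent : ∀ m p → 2 ≤ a (suc m) → p ≡ pOf (suc m) -1ℤ (+ 1) → ¬ IsConvergent a p (Q (suc (suc m)) ∸ Q (suc m))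
  Q⁺∸Q-¬convergent zero p 2≤a p≡ with a 1 ℕ.≟ 2
  ... | yes a₁≡2 = subst₂ (λ t v → ¬ IsConvergent a t v) (sym (trans p≡ (cong (λ t → -1ℤ *ᶻ + 0 +ᶻ + 1 *ᶻ t) P₂≡1)))
    (sym (cong (λ A → A * 1 + 0 ∸ 1) a₁≡2)) (¬convergent-1/1 2≤a)
  ... | no a₁≢2 = Q⁺∸Q-¬convergent-if zero p (ℕₚ.<-≤-trans (s≤s (s≤s (s≤s z≤n)))
    (ℕₚ.≤-trans (ℕₚ.≤∧≢⇒< 2≤a (λ 2≡a₁ → a₁≢2 (sym 2≡a₁))) (ℕₚ.≤-reflexive (sym (trans (ℕₚ.+-identityʳ _) (ℕₚ.*-identityʳ (a 1)))))))
  Q⁺∸Q-¬convergent (suc k) p 2≤a _ = Q⁺∸Q-¬convergent-if (suc k) p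
    (ℕₚ.<-≤-trans (ℕₚ.m<m+n (2 * Q (suc (suc k))) (Q≥1 (suc k) (s≤s z≤n))) (ℕₚ.+-monoˡ-≤ (Q (suc k)) (ℕₚ.*-monoˡ-≤ (Q (suc (suc k))) 2≤a)))

  consecutive-across-big-big : ∀ m A′ → 2 ≤ a (suc m) → a (suc (suc m)) ≡ 2 + A′ →
    Consecutive a (Q (suc (suc m)) ∸ Q (suc m)) (Q (suc m) + Q (suc (suc m)))
  consecutive-across-big-big m A′ 2≤a a′≡ = consecutive-from-coordinates (suc m) -1ℤ (+ 1) (+ 1) (+ 1)
    (Q⁺∸Q-coordinates m) (mediant-coordinates (suc m)) (1≤Q⁺∸Q m 2≤a)
    (Q⁺∸Q-¬convergent m _ 2≤a refl) (mediant-¬convergent (suc m) (subst (2 ≤_) (sym a′≡) (s≤s (s≤s z≤n))))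
    beats minimal
    where
    module _ (K : ℕ) (m+5≤K : 4 + suc m ≤ K) where
      open AtLevel (suc m) K m+5≤K
      gap-w : gap (suc m) K (+ 1) (+ 1) ≡ suc A′ * e₁ + e₂
      gap-w = trans (cong (λ t → ∣ + 1 *ᶻ + t -ᶻ + 1 *ᶻ + e₁ ∣) (trans (e₀≡ a′≡) (split A′ e₁ e₂))) (gap-unit 1 e₁ _)
        where
        split : ∀ A′ e₁ e₂ → (2 + A′) * e₁ + e₂ ≡ 1 * e₁ + (suc A′ * e₁ + e₂)
        split = ℕ-solve-∀
      gap-u : gap (suc m) K -1ℤ (+ 1) ≡ ((2 + A′) * e₁ + e₂) + e₁
      gap-u = trans (gap-opposite⁻ 1 1 e₀ e₁) (cong₂ _+_ (trans (ℕₚ.*-identityˡ e₀) (e₀≡ a′≡)) (ℕₚ.*-identityˡ e₁))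
      beats : gap (suc m) K (+ 1) (+ 1) < gap (suc m) K -1ℤ (+ 1)
      beats = subst₂ _<_ (sym gap-w) (sym gap-u) (ℕₚ.<-≤-trans (ℕₚ.m<n+m (suc A′ * e₁ + e₂) e₁≥1)
        (ℕₚ.≤-trans (ℕₚ.≤-reflexive (regroup A′ e₁ e₂)) (ℕₚ.m≤m+n _ e₁)))
        where
        regroup : ∀ A′ e₁ e₂ → e₁ + (suc A′ * e₁ + e₂) ≡ (2 + A′) * e₁ + e₂
        regroup = ℕ-solve-∀
      minimal : ∀ x y {q} → + q ≡ qOf (suc m) x y → 1 ≤ q → q < Q (suc m) + Q (suc (suc m)) → Avoids (suc m) x y →
        gap (suc m) K -1ℤ (+ 1) ≤ gap (suc m) K x y
      minimal x y q≡ 1≤q q<w avoids = subst (_≤ gap (suc m) K x y) (sym gap-u)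
        (gap≥e₀+e₁ (avoids (convergent-coordinates₀ (suc m))) (avoids (convergent-coordinates₁ (suc m))) A′ e₁ e₂
          (shape a′≡ q≡ 1≤q (ℕₚ.<-≤-trans q<w (ℕₚ.≤-trans (ℕₚ.≤-reflexive (ℕₚ.+-comm (Q (suc m)) _)) (Q-sum≤ (suc m)))))
          (Q-step (suc m)) q<w)

  consecutive-across-one-big : ∀ m A′ → a (suc m) ≡ 1 → a (suc (suc m)) ≡ 2 + A′ →
    Consecutive a (2 * Q m + Q (suc m)) (Q (suc m) + Q (suc (suc m)))
  consecutive-across-one-big m A′ a≡1 a′≡ = consecutive-from-coordinates (suc m) -1ℤ (+ 2) (+ 1) (+ 1)
    (ones-coordinates m a≡1) (mediant-coordinates (suc m)) (ℕₚ.≤-trans (Q≥1 (suc m) (s≤s z≤n)) (ℕₚ.m≤n+m _ _))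
    (ones-¬convergent m a≡1 (Q₀+Q₂<Q₃-when-2≤a m 2≤a′)) (mediant-¬convergent (suc m) 2≤a′)
    beats minimal
    where
    2≤a′ : 2 ≤ a (suc (suc m))
    2≤a′ = subst (2 ≤_) (sym a′≡) (s≤s (s≤s z≤n))
    module _ (K : ℕ) (m+5≤K : 4 + suc m ≤ K) where
      open AtLevel (suc m) K m+5≤K
      gap-w : gap (suc m) K (+ 1) (+ 1) ≡ suc A′ * e₁ + e₂
      gap-w = trans (cong (λ t → ∣ + 1 *ᶻ + t -ᶻ + 1 *ᶻ + e₁ ∣) (trans (e₀≡ a′≡) (split A′ e₁ e₂))) (gap-unit 1 e₁ _)
        where
        split : ∀ A′ e₁ e₂ → (2 + A′) * e₁ + e₂ ≡ 1 * e₁ + (suc A′ * e₁ + e₂)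
        split = ℕ-solve-∀
      gap-u : gap (suc m) K -1ℤ (+ 2) ≡ ((2 + A′) * e₁ + e₂) + 2 * e₁
      gap-u = trans (gap-opposite⁻ 1 2 e₀ e₁) (cong (_+ 2 * e₁) (trans (ℕₚ.*-identityˡ e₀) (e₀≡ a′≡)))
      beats : gap (suc m) K (+ 1) (+ 1) < gap (suc m) K -1ℤ (+ 2)
      beats = subst₂ _<_ (sym gap-w) (sym gap-u) (ℕₚ.<-≤-trans (ℕₚ.m<n+m (suc A′ * e₁ + e₂) e₁≥1)
        (ℕₚ.≤-trans (ℕₚ.≤-reflexive (regroup A′ e₁ e₂)) (ℕₚ.m≤m+n _ (2 * e₁))))
        where
        regroup : ∀ A′ e₁ e₂ → e₁ + (suc A′ * e₁ + e₂) ≡ (2 + A′) * e₁ + e₂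
        regroup = ℕ-solve-∀
      minimal : ∀ x y {q} → + q ≡ qOf (suc m) x y → 1 ≤ q → q < Q (suc m) + Q (suc (suc m)) → Avoids (suc m) x y →
        gap (suc m) K -1ℤ (+ 2) ≤ gap (suc m) K x y
      minimal x y q≡ 1≤q q<w avoids = subst (_≤ gap (suc m) K x y) (sym gap-u)
        (gap≥e₀+2e₁-below-Q₀+Q₁ (avoids (convergent-coordinates₀ (suc m))) (avoids (convergent-coordinates₁ (suc m)))
          1≤q (Q-step (suc m)) (avoids (convergent-coordinates₋₁ m a≡1)) A′ e₁ e₂
          (shape a′≡ q≡ 1≤q (ℕₚ.<-≤-trans q<w (ℕₚ.≤-trans (ℕₚ.≤-reflexive (ℕₚ.+-comm (Q (suc m)) _)) (Q-sum≤ (suc m))))) q<w)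

  consecutive-across-big-one : ∀ m A′ → 2 ≤ a (suc m) → a (suc (suc m)) ≡ 1 → a (suc (suc (suc m))) ≡ suc A′ →
    Consecutive a (Q (suc (suc m)) ∸ Q (suc m)) (2 * Q (suc m) + Q (suc (suc m)))
  consecutive-across-big-one m A′ 2≤a a′≡1 a″≡ = consecutive-from-coordinates (suc (suc m)) (+ 2) -1ℤ -1ℤ (+ 2)
    (trans (Q⁺∸Q-coordinates m) (sym (proj₁ back))) (ones-coordinates (suc m) a′≡1) (1≤Q⁺∸Q m 2≤a)
    (Q⁺∸Q-¬convergent m _ 2≤a (proj₂ back))
    (ones-¬convergent (suc m) a′≡1 (Q₀+Q₂<Q₃ (suc m) (ℕₚ.<-≤-trans (ℕₚ.m<n+m (Q (suc m)) (Q≥1 (suc m) (s≤s z≤n)))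
      (ℕₚ.≤-trans (ℕₚ.≤-reflexive (cong (λ t → Q (suc m) + t) (sym (ℕₚ.+-identityʳ (Q (suc m)))))) (2*Q≤Q⁺ m 2≤a)))))
    beats minimal
    where
    -- a_{m+2} = 1 makes (2 , -1) at level m + 2 the point (-1 , 1) at level m + 1.
    back : qOf (suc (suc m)) (+ 2) -1ℤ ≡ qOf (suc m) -1ℤ (+ 1) × pOf (suc (suc m)) (+ 2) -1ℤ ≡ pOf (suc m) -1ℤ (+ 1)
    back = shift Qᶻ Qᶻ-rec , shift Pᶻ Pᶻ-rec
      where
      shift : ∀ (s : ℕ → ℤ) → (∀ k → s (suc (suc k)) ≡ + a (suc k) *ᶻ s (suc k) +ᶻ s k) →
        + 2 *ᶻ s (suc (suc m)) +ᶻ -1ℤ *ᶻ s (suc (suc (suc m))) ≡ -1ℤ *ᶻ s (suc m) +ᶻ + 1 *ᶻ s (suc (suc m))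
      shift s s-rec = trans (cong (λ t → + 2 *ᶻ s (suc (suc m)) +ᶻ -1ℤ *ᶻ t)
        (trans (s-rec (suc m)) (cong (λ A → + A *ᶻ s (suc (suc m)) +ᶻ s (suc m)) a′≡1))) (identity (s (suc m)) (s (suc (suc m))))
        where
        identity : ∀ (x y : ℤ) → + 2 *ᶻ y +ᶻ -1ℤ *ᶻ (+ 1 *ᶻ y +ᶻ x) ≡ -1ℤ *ᶻ x +ᶻ + 1 *ᶻ y
        identity = solve-∀
    w+Q≡ : (2 * Q (suc m) + Q (suc (suc m))) + Q (suc (suc m)) ≡ 2 * Q (suc (suc (suc m)))
    w+Q≡ = trans (regroup (Q (suc (suc m))) (Q (suc m))) (cong (2 *_) (sym (cong (λ A → A * Q (suc (suc m)) + Q (suc m)) a′≡1)))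
      where
      regroup : ∀ x y → 2 * y + x + x ≡ 2 * (1 * x + y)
      regroup = ℕ-solve-∀
    2Q₃≤3Q₂ : 2 * Q (suc (suc (suc m))) ≤ 3 * Q (suc (suc m))
    2Q₃≤3Q₂ = begin
      2 * Q (suc (suc (suc m)))                   ≡⟨ cong (λ A → 2 * (A * Q (suc (suc m)) + Q (suc m))) a′≡1 ⟩
      2 * (1 * Q (suc (suc m)) + Q (suc m))       ≡⟨ regroup (Q (suc (suc m))) (Q (suc m)) ⟩
      2 * Q (suc (suc m)) + 2 * Q (suc m)         ≤⟨ ℕₚ.+-monoʳ-≤ (2 * Q (suc (suc m))) (2*Q≤Q⁺ m 2≤a) ⟩
      2 * Q (suc (suc m)) + Q (suc (suc m))       ≡⟨ regroup′ (Q (suc (suc m))) ⟩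
      3 * Q (suc (suc m))                         ∎
      where
      open ℕₚ.≤-Reasoning
      regroup : ∀ x y → 2 * (1 * x + y) ≡ 2 * x + 2 * y
      regroup = ℕ-solve-∀
      regroup′ : ∀ x → 2 * x + x ≡ 3 * x
      regroup′ = ℕ-solve-∀
    module _ (K : ℕ) (m+6≤K : 4 + suc (suc m) ≤ K) where
      open AtLevel (suc (suc m)) K m+6≤K
      gap-u : gap (suc (suc m)) K (+ 2) -1ℤ ≡ 2 * ((1 + A′) * e₁ + e₂) + e₁
      gap-u = trans (gap-opposite⁺ 2 1 e₀ e₁) (cong₂ _+_ (cong (2 *_) (e₀≡ a″≡)) (ℕₚ.*-identityˡ e₁))
      beats : gap (suc (suc m)) K -1ℤ (+ 2) < gap (suc (suc m)) K (+ 2) -1ℤ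
      beats = subst₂ _<_ (sym (gap-opposite⁻ 1 2 e₀ e₁)) (sym (gap-opposite⁺ 2 1 e₀ e₁))
        (subst₂ _<_ (regroup e₀ e₁) (regroup′ e₀ e₁) (ℕₚ.+-monoˡ-< (e₀ + e₁) e₁<e₀))
        where
        e₁<e₀ : e₁ < e₀
        e₁<e₀ =
          subst (e₁ <_) (sym (trans (e₀≡ a″≡) (split A′ e₁ e₂))) (ℕₚ.m<m+n e₁ (ℕₚ.≤-trans e₂≥1 (ℕₚ.m≤n+m e₂ (A′ * e₁))))
          where
          split : ∀ A′ e₁ e₂ → (1 + A′) * e₁ + e₂ ≡ e₁ + (A′ * e₁ + e₂)
          split = ℕ-solve-∀
        regroup : ∀ e₀ e₁ → e₁ + (e₀ + e₁) ≡ 1 * e₀ + 2 * e₁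
        regroup = ℕ-solve-∀
        regroup′ : ∀ e₀ e₁ → e₀ + (e₀ + e₁) ≡ 2 * e₀ + 1 * e₁
        regroup′ = ℕ-solve-∀
      minimal : ∀ x y {q} → + q ≡ qOf (suc (suc m)) x y → 1 ≤ q → q < 2 * Q (suc m) + Q (suc (suc m)) →
        Avoids (suc (suc m)) x y → gap (suc (suc m)) K (+ 2) -1ℤ ≤ gap (suc (suc m)) K x y
      minimal x y q≡ 1≤q q<w avoids = subst (_≤ gap (suc (suc m)) K x y) (sym gap-u)
        (gap≥2e₀+e₁ (avoids (convergent-coordinates₀ (suc (suc m)))) (avoids (convergent-coordinates₁ (suc (suc m))))
          1≤q (Q-step (suc (suc m))) (avoids (convergent-coordinates₋₁ (suc m) a′≡1)) A′ e₁ e₂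
          (shape a″≡ q≡ 1≤q (ℕₚ.<-≤-trans q<w w≤Q₄)) q<w w+Q≡ (Q⁺≤2*Q (suc m) a′≡1) 2Q₃≤3Q₂)
        where
        w≤Q₄ : 2 * Q (suc m) + Q (suc (suc m)) ≤ Q (suc (suc (suc (suc m))))
        w≤Q₄ = ℕₚ.≤-trans (w≤Q₀+Q₁ _ _ _ w+Q≡ (Q⁺≤2*Q (suc m) a′≡1))
          (ℕₚ.≤-trans (ℕₚ.≤-reflexive (ℕₚ.+-comm (Q (suc (suc m))) _)) (Q-sum≤ (suc (suc m))))

  consecutive-across-one-one : ∀ m A′ → a (suc m) ≡ 1 → a (suc (suc m)) ≡ 1 → a (suc (suc (suc m))) ≡ suc A′ →
    Consecutive a (2 * Q (suc m)) (2 * Q (suc (suc m)))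
  consecutive-across-one-one m A′ a≡1 a′≡1 a″≡ = consecutive-from-coordinates (suc (suc m)) -[1+ 1 ] (+ 2) (+ 2) (+ 0)
    (doubled-coordinates (suc (suc m)) -1ℤ (+ 1) (Q (suc m)) (sym (proj₁ (proj₂ (convergent-coordinates₋₁ (suc m) a′≡1)))))
    (doubled-coordinates (suc (suc m)) (+ 1) (+ 0) (Q (suc (suc m))) (basis₀-coordinates (suc (suc m))))
    (ℕₚ.≤-trans (Q≥1 (suc m) (s≤s z≤n)) (ℕₚ.m≤m+n _ _))
    (doubled-¬convergent (suc (suc m)) -1ℤ (+ 1) (Q (suc m))) (doubled-¬convergent (suc (suc m)) (+ 1) (+ 0) (Q (suc (suc m))))
    beats minimal
    where
    3Q₂≤2Q₃ : 3 * Q (suc (suc m)) ≤ 2 * Q (suc (suc (suc m)))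
    3Q₂≤2Q₃ = begin
      3 * Q (suc (suc m))                       ≡⟨ regroup (Q (suc (suc m))) ⟩
      2 * Q (suc (suc m)) + Q (suc (suc m))     ≤⟨ ℕₚ.+-monoʳ-≤ (2 * Q (suc (suc m))) (Q⁺≤2*Q m a≡1) ⟩
      2 * Q (suc (suc m)) + 2 * Q (suc m)       ≡⟨ regroup′ (Q (suc (suc m))) (Q (suc m)) ⟩
      2 * (1 * Q (suc (suc m)) + Q (suc m))     ≡⟨ cong (λ A → 2 * (A * Q (suc (suc m)) + Q (suc m))) a′≡1 ⟨
      2 * Q (suc (suc (suc m)))                 ∎
      where
      open ℕₚ.≤-Reasoning
      regroup : ∀ x → 3 * x ≡ 2 * x + x
      regroup = ℕ-solve-∀
      regroup′ : ∀ x y → 2 * x + 2 * y ≡ 2 * (1 * x + y)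
      regroup′ = ℕ-solve-∀
    module _ (K : ℕ) (m+6≤K : 4 + suc (suc m) ≤ K) where
      open AtLevel (suc (suc m)) K m+6≤K
      gap-u : gap (suc (suc m)) K -[1+ 1 ] (+ 2) ≡ 2 * ((1 + A′) * e₁ + e₂) + 2 * e₁
      gap-u = trans (gap-opposite⁻ 2 2 e₀ e₁) (cong (λ t → 2 * t + 2 * e₁) (e₀≡ a″≡))
      beats : gap (suc (suc m)) K (+ 2) (+ 0) < gap (suc (suc m)) K -[1+ 1 ] (+ 2)
      beats = subst₂ _<_ (sym (trans (gap-opposite⁺ 2 0 e₀ e₁) (ℕₚ.+-identityʳ (2 * e₀)))) (sym (gap-opposite⁻ 2 2 e₀ e₁))
        (ℕₚ.m<m+n (2 * e₀) (ℕₚ.≤-trans e₁≥1 (ℕₚ.m≤m+n e₁ _)))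
      minimal : ∀ x y {q} → + q ≡ qOf (suc (suc m)) x y → 1 ≤ q → q < 2 * Q (suc (suc m)) → Avoids (suc (suc m)) x y →
        gap (suc (suc m)) K -[1+ 1 ] (+ 2) ≤ gap (suc (suc m)) K x y
      minimal x y q≡ 1≤q q<w avoids = subst (_≤ gap (suc (suc m)) K x y) (sym gap-u)
        (gap≥2e₀+2e₁ (avoids (convergent-coordinates₀ (suc (suc m)))) (avoids (convergent-coordinates₁ (suc (suc m))))
          1≤q (Q-step (suc (suc m))) (avoids (convergent-coordinates₋₁ (suc m) a′≡1)) A′ e₁ e₂
          (avoids (convergent-coordinates₋₂ m a≡1 a′≡1))
          (shape a″≡ q≡ 1≤q (ℕₚ.<-≤-trans q<w (2*Q≤Q⁺⁺ (suc m)))) q<w (Q⁺≤2*Q (suc m) a′≡1) 3Q₂≤2Q₃)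

-- Words

-- Imported only here: its constructors [] and _∷_, overloading those of List, would
-- make the variable lists passed to the ring solver above ambiguous.
open import Data.List.Relation.Unary.Linked using (Linked; []; [-]; _∷_)

-- at xs i is the i-th entry of xs (junk value 0 past the end).
at : List ℕ → ℕ → ℕ
at [] _ = 0
at (x ∷ _) zero = x
at (_ ∷ xs) (suc i) = at xs i

at-++ : ∀ xs ys i → i < length xs → at (xs ++ ys) i ≡ at xs i
at-++ (x ∷ xs) ys zero _ = refl
at-++ (x ∷ xs) ys (suc i) (s≤s i<n) = at-++ xs ys i i<n

at-applyUpTo : ∀ f n i → i < n → at (applyUpTo f n) i ≡ f i
at-applyUpTo f (suc n) zero _ = refl
at-applyUpTo f (suc n) (suc i) (s≤s i<n) = at-applyUpTo (λ j → f (suc j)) n i i<n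

at-map-upTo : ∀ S n i → i < n → at (map S (upTo n)) i ≡ S i
at-map-upTo S n i i<n = trans (cong (λ xs → at xs i) (Listₚ.map-upTo S n)) (at-applyUpTo S n i i<n)

applyUpTo-at : ∀ xs → applyUpTo (at xs) (length xs) ≡ xs
applyUpTo-at [] = refl
applyUpTo-at (x ∷ xs) = cong (x ∷_) (applyUpTo-at xs)

applyUpTo-cong : ∀ n (f g : ℕ → ℕ) → (∀ i → i < n → f i ≡ g i) → applyUpTo f n ≡ applyUpTo g n
applyUpTo-cong zero f g _ = refl
applyUpTo-cong (suc n) f g f≡g =
  cong₂ _∷_ (f≡g 0 (s≤s z≤n)) (applyUpTo-cong n (λ i → f (suc i)) (λ i → g (suc i)) (λ i i<n → f≡g (suc i) (s≤s i<n)))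

prefix-chain-limit : (W : ℕ → List ℕ) → (∀ N → ∃ λ r → W (suc N) ≡ W N ++ r) → (∀ k → k < length (W (suc (2 * k)))) →
  Σ (ℕ → ℕ) λ S → ∀ N → W N ≡ map S (upTo (length (W N)))
prefix-chain-limit W extends long = S , λ N → sym (begin
    map S (upTo (length (W N)))                  ≡⟨ Listₚ.map-upTo S (length (W N)) ⟩
    applyUpTo S (length (W N))                   ≡⟨ applyUpTo-cong (length (W N)) S (at (W N)) (λ i i<n → sym (agrees N i i<n)) ⟩
    applyUpTo (at (W N)) (length (W N))          ≡⟨ applyUpTo-at (W N) ⟩
    W N                                          ∎)
  where
  open ≡-Reasoning
  S : ℕ → ℕ
  S i = at (W (suc (2 * i))) i
  extends-by : ∀ N d → ∃ λ r → W (d + N) ≡ W N ++ r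
  extends-by N zero = [] , sym (Listₚ.++-identityʳ (W N))
  extends-by N (suc d) with extends-by N d | extends (d + N)
  ... | r , W≡ | r′ , W′≡ = r ++ r′ , trans W′≡ (trans (cong (_++ r′) W≡) (Listₚ.++-assoc (W N) r r′))
  agrees : ∀ N i → i < length (W N) → at (W N) i ≡ S i
  agrees N i i<n with ℕₚ.≤-total N (suc (2 * i))
  ... | inj₁ N≤M with extends-by N (suc (2 * i) ∸ N)
  ... | r , W≡ = sym (trans (cong (λ t → at t i) (trans (cong W (sym (ℕₚ.m∸n+n≡m N≤M))) W≡)) (at-++ (W N) r i i<n))
  agrees N i i<n | inj₂ M≤N with extends-by (suc (2 * i)) (N ∸ suc (2 * i))
  ... | r , W≡ =
    trans (cong (λ t → at t i) (trans (cong W (sym (ℕₚ.m∸n+n≡m M≤N))) W≡)) (at-++ (W (suc (2 * i))) r i (long i))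

last : ∀ {A : Set} → A → List A → A
last x [] = x
last _ (y ∷ ys) = last y ys

last-++ : ∀ {A : Set} (x : A) xs y ys → last x (xs ++ y ∷ ys) ≡ last y ys
last-++ x [] y ys = refl
last-++ x (z ∷ xs) y ys = last-++ z xs y ys

last-just : ∀ {A : Set} (x : A) xs → Data.List.last (x ∷ xs) ≡ just (last x xs)
last-just x [] = refl
last-just x (y ∷ ys) = last-just y ys

module _ {A : Set} {R : A → A → Set} where

  Linked-++ : ∀ x xs y ys → Linked R (x ∷ xs) → Linked R (y ∷ ys) → R (last x xs) y → Linked R ((x ∷ xs) ++ (y ∷ ys))
  Linked-++ x [] y ys _ linked r = r ∷ linked
  Linked-++ x (z ∷ xs) y ys (r₀ ∷ linked) linked′ r = r₀ ∷ Linked-++ z xs y ys linked linked′ r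

module _ {R : ℕ → ℕ → Set} where

  Linked-at : ∀ {xs} → Linked R xs → ∀ i → suc i < length xs → R (at xs i) (at xs (suc i))
  Linked-at [-] i (s≤s ())
  Linked-at (r ∷ _) zero _ = r
  Linked-at (_ ∷ linked) (suc i) (s≤s i<n) = Linked-at linked i i<n

  head≤last : (∀ {u w} → R u w → u ≤ w) → ∀ x xs → Linked R (x ∷ xs) → x ≤ last x xs
  head≤last R⇒≤ x [] _ = ℕₚ.≤-refl
  head≤last R⇒≤ x (y ∷ ys) (r ∷ linked) = ℕₚ.≤-trans (R⇒≤ r) (head≤last R⇒≤ y ys linked)

module Derun {A : Set} (_≟_ : DecidableEquality A) where

  dr : List A → List A
  dr = derun _≟_

  derun-∷ : ∀ x xs → ∃ λ r → dr (x ∷ xs) ≡ x ∷ r × last x r ≡ last x xs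
  derun-∷ x [] = [] , refl , refl
  derun-∷ x (y ∷ ys) with x ≟ y
  ... | yes refl = derun-∷ x ys
  ... | no _ = let (r , dr≡ , last≡) = derun-∷ y ys in y ∷ r , cong (x ∷_) dr≡ , last≡

  derun-++ : ∀ xs ys → ∃ λ r → dr (xs ++ ys) ≡ dr xs ++ r
  derun-++ [] ys = dr ys , refl
  derun-++ (x ∷ []) [] = [] , refl
  derun-++ (x ∷ []) (y ∷ ys) with x ≟ y
  ... | yes refl = let (r , dr≡ , _) = derun-∷ x ys in r , dr≡
  ... | no _ = dr (y ∷ ys) , refl
  derun-++ (x ∷ x′ ∷ xs) ys with x ≟ x′ | derun-++ (x′ ∷ xs) ys
  ... | yes _ | ih = ih
  ... | no _ | r , dr≡ = r , cong (x ∷_) dr≡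

  derun-Linked : ∀ {R : A → A → Set} {xs} → Linked R xs → Linked (λ u w → u ≢ w × R u w) (dr xs)
  derun-Linked [] = []
  derun-Linked [-] = [-]
  derun-Linked {R} {x ∷ y ∷ ys} (r ∷ linked) with x ≟ y | derun-Linked {R} {y ∷ ys} linked
  ... | yes _ | linked′ = linked′
  ... | no x≢y | linked′ with derun-∷ y ys
  ... | r′ , dr≡ , _ = subst (λ t → Linked _ (x ∷ t)) (sym dr≡) ((x≢y , r) ∷ subst (Linked _) dr≡ linked′)

consecutive-chain-enumerates : ∀ a (S : ℕ → ℕ) → S 0 ≡ 1 → (∀ i → S i < S (suc i)) → (∀ i → Consecutive a (S i) (S (suc i))) →
  IsIncreasingEnumeration (InQ a) S
consecutive-chain-enumerates a S S₀≡1 S-increasing consecutive = S-increasing , λ x → complete x , sound x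
  where
  open Consecutive
  i<S : ∀ i → i < S i
  i<S zero = subst (0 <_) (sym S₀≡1) (s≤s z≤n)
  i<S (suc i) = ℕₚ.<-≤-trans (s≤s (i<S i)) (S-increasing i)
  -- S grows past x within x + 1 steps.
  bracket : ∀ x → 1 ≤ x → ∃ λ i → S i ≤ x × x < S (suc i)
  bracket x 1≤x = search (suc x) 0 (subst (_≤ x) (sym S₀≡1) 1≤x) (subst (x <_) (sym (ℕₚ.+-identityʳ (suc x))) (ℕₚ.n<1+n x))
    where
    search : ∀ n i → S i ≤ x → x < n + i → ∃ λ j → S j ≤ x × x < S (suc j)
    search zero i Sᵢ≤x x<i = ⊥-elim (ℕₚ.<-irrefl refl (ℕₚ.<-≤-trans x<i (ℕₚ.≤-trans (ℕₚ.<⇒≤ (i<S i)) Sᵢ≤x)))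
    search (suc n) i Sᵢ≤x x<n+i with x ℕ.<? S (suc i)
    ... | yes x<Sᵢ₊₁ = i , Sᵢ≤x , x<Sᵢ₊₁
    ... | no x≮Sᵢ₊₁ = search n (suc i) (ℕₚ.≮⇒≥ x≮Sᵢ₊₁) (subst (x <_) (sym (ℕₚ.+-suc n i)) x<n+i)
  -- A discontinuity strictly between S i and S (i + 1) would beat the best approximation at S i.
  complete : ∀ x → InQ a x → ∃ λ i → S i ≡ x
  complete x (inj₁ refl) = 0 , S₀≡1
  complete x (inj₂ (2≤x , p , ¬conv , x-beats)) with bracket x (ℕₚ.≤-trans (s≤s z≤n) 2≤x)
  ... | i , Sᵢ≤x , x<Sᵢ₊₁ with S i ℕ.≟ x
  ... | yes Sᵢ≡x = i , Sᵢ≡x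
  ... | no Sᵢ≢x = ⊥-elim (u-best c x p (ℕₚ.≤-trans (s≤s z≤n) 2≤x) x<Sᵢ₊₁ ¬conv
          (x-beats (S i) (pu c) (1≤u c) (ℕₚ.≤∧≢⇒< Sᵢ≤x Sᵢ≢x) (u-non-convergent c)))
    where c = consecutive i
  sound : ∀ x → (∃ λ i → S i ≡ x) → InQ a x
  sound x (zero , Sᵢ≡x) = inj₁ (trans (sym Sᵢ≡x) S₀≡1)
  sound x (suc j , refl) = inj₂ (ℕₚ.≤-trans (s≤s (1≤u c)) (S-increasing j) , pw c , w-non-convergent c , w-record c)
    where c = consecutive j

isOne-≢1 : ∀ {n} → n ≢ 1 → isOne n ≡ false
isOne-≢1 {zero} _ = refl
isOne-≢1 {suc zero} n≢1 = ⊥-elim (n≢1 refl)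
isOne-≢1 {suc (suc n)} _ = refl

-- First and last entries of the block of a_{m+1}, as functions of isOne a_{m+1}
-- and of isOne a_m (resp. isOne a_{m+2}); cf. onesBlock.
head-value : Bool → Bool → ℕ → ℕ → ℕ
head-value false _ q₀ q₁ = q₀ + q₁
head-value true true q₀ q₁ = 2 * q₁
head-value true false q₀ q₁ = 2 * q₀ + q₁

last-value : Bool → Bool → ℕ → ℕ → ℕ → ℕ
last-value false _ q₀ q₁ q₂ = q₂ ∸ q₁
last-value true true q₀ q₁ q₂ = 2 * q₁
last-value true false q₀ q₁ q₂ = 2 * q₀ + q₁

module Blocks (a : ℕ → ℕ) (a₀≡0 : a 0 ≡ 0) (ha : ∀ n → 1 ≤ a (suc n)) where

  open ContinuedFraction a ha
  open ConsecutivePairs a ha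

  Step : ℕ → ℕ → Set
  Step u w = u ≤ w × Consecutive a u w

  blockHead blockLast : ℕ → ℕ
  blockHead m = head-value (isOne (a (suc m))) (isOne (a m)) (Q m) (Q (suc m))
  blockLast m = last-value (isOne (a (suc m))) (isOne (a (suc (suc m)))) (Q m) (Q (suc m)) (Q (suc (suc m)))

  head-≢1 : ∀ m → a (suc m) ≢ 1 → blockHead m ≡ Q m + Q (suc m)
  head-≢1 m a≢1 = cong (λ b → head-value b (isOne (a m)) (Q m) (Q (suc m))) (isOne-≢1 a≢1)

  head-1-1 : ∀ m → a (suc m) ≡ 1 → a m ≡ 1 → blockHead m ≡ 2 * Q (suc m)
  head-1-1 m a≡1 a₋≡1 = cong₂ (λ b c → head-value b c (Q m) (Q (suc m))) (cong isOne a≡1) (cong isOne a₋≡1)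

  head-1-≢1 : ∀ m → a (suc m) ≡ 1 → a m ≢ 1 → blockHead m ≡ 2 * Q m + Q (suc m)
  head-1-≢1 m a≡1 a₋≢1 = cong₂ (λ b c → head-value b c (Q m) (Q (suc m))) (cong isOne a≡1) (isOne-≢1 a₋≢1)

  last-≢1 : ∀ m → a (suc m) ≢ 1 → blockLast m ≡ Q (suc (suc m)) ∸ Q (suc m)
  last-≢1 m a≢1 = cong (λ b → last-value b (isOne (a (suc (suc m)))) (Q m) (Q (suc m)) (Q (suc (suc m)))) (isOne-≢1 a≢1)

  last-1-1 : ∀ m → a (suc m) ≡ 1 → a (suc (suc m)) ≡ 1 → blockLast m ≡ 2 * Q (suc m)
  last-1-1 m a≡1 a₊≡1 = cong₂ (λ b c → last-value b c (Q m) (Q (suc m)) (Q (suc (suc m)))) (cong isOne a≡1) (cong isOne a₊≡1)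

  last-1-≢1 : ∀ m → a (suc m) ≡ 1 → a (suc (suc m)) ≢ 1 → blockLast m ≡ 2 * Q m + Q (suc m)
  last-1-≢1 m a≡1 a₊≢1 = cong₂ (λ b c → last-value b c (Q m) (Q (suc m)) (Q (suc (suc m)))) (cong isOne a≡1) (isOne-≢1 a₊≢1)

  a≡suc : ∀ n → ∃ λ A′ → a (suc n) ≡ suc A′
  a≡suc n with a (suc n) | ha n
  ... | suc A′ | _ = A′ , refl

  a≡2+ : ∀ n → a (suc n) ≢ 1 → ∃ λ A′ → a (suc n) ≡ 2 + A′
  a≡2+ n a≢1 with a (suc n) | ha n
  ... | suc zero | _ = ⊥-elim (a≢1 refl)
  ... | suc (suc A′) | _ = A′ , refl

  2≤a : ∀ n → a (suc n) ≢ 1 → 2 ≤ a (suc n)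
  2≤a n a≢1 = let (A′ , a≡) = a≡2+ n a≢1 in subst (2 ≤_) (sym a≡) (s≤s (s≤s z≤n))

  Q<Q⁺ : ∀ m → a m ≢ 1 → Q m < Q (suc m)
  Q<Q⁺ zero _ = s≤s z≤n
  Q<Q⁺ (suc k) a≢1 = ℕₚ.<-≤-trans (ℕₚ.m<m+n (Q (suc k)) (Q≥1 (suc k) (s≤s z≤n)))
    (ℕₚ.≤-trans (ℕₚ.≤-reflexive (cong (λ t → Q (suc k) + t) (sym (ℕₚ.+-identityʳ (Q (suc k)))))) (2*Q≤Q⁺ k (2≤a k a≢1)))

  2*Q≤Q⁺-if : ∀ m → a m ≢ 1 → 2 * Q m ≤ Q (suc m)
  2*Q≤Q⁺-if zero _ = z≤n
  2*Q≤Q⁺-if (suc k) a≢1 = 2*Q≤Q⁺ k (2≤a k a≢1)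

  record BlockShape (m : ℕ) : Set where
    field
      rest : List ℕ
      block≡ : block a m ≡ blockHead m ∷ rest
      linked : Linked Step (blockHead m ∷ rest)
      last≡ : last (blockHead m) rest ≡ blockLast m

  shaped : ∀ {m h} t → blockHead m ≡ h → block a m ≡ h ∷ t → Linked Step (h ∷ t) → last h t ≡ blockLast m → BlockShape m
  shaped t refl block≡ linked last≡ = record { rest = t ; block≡ = block≡ ; linked = linked ; last≡ = last≡ }

  block-of-one : ∀ m {b c} → a (suc m) ≡ 1 → isOne (a m) ≡ b → isOne (a (suc (suc m))) ≡ c →
    block a m ≡ onesBlock b c (Q m) (Q (suc m))
  block-of-one m a≡1 b≡ c≡ = trans (cong (blockAux a m) a≡1) (cong₂ (λ b c → onesBlock b c (Q m) (Q (suc m))) b≡ c≡)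

  block-shape : ∀ m → BlockShape m
  block-shape m with a (suc m) ℕ.≟ 1
  block-shape m | no a≢1 with a≡2+ m a≢1
  ... | zero , a≡2 = shaped [] (head-≢1 m a≢1) (trans (cong (blockAux a m) a≡2) (cong (_∷ []) Q⁺∸Q≡mediant)) [-]
          (sym (trans (last-≢1 m a≢1) Q⁺∸Q≡mediant))
    where
    Q⁺∸Q≡mediant : Q (suc (suc m)) ∸ Q (suc m) ≡ Q m + Q (suc m)
    Q⁺∸Q≡mediant = trans (Q⁺∸Q≡ m 1 a≡2) (cong (λ t → Q m + t) (ℕₚ.*-identityˡ (Q (suc m))))
  ... | suc A′ , a≡ = shaped (2 * Q (suc m) ∷ (Q (suc (suc m)) ∸ Q (suc m)) ∷ []) (head-≢1 m a≢1) (cong (blockAux a m) a≡)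
          ((mediant≤2Q , consecutive-large-first m A′ a≡) ∷ (2Q≤Q⁺∸Q , consecutive-large-second m A′ a≡) ∷ [-])
          (sym (last-≢1 m a≢1))
    where
    mediant≤2Q : Q m + Q (suc m) ≤ 2 * Q (suc m)
    mediant≤2Q =
      ℕₚ.≤-trans (ℕₚ.+-monoˡ-≤ (Q (suc m)) (Q-step m)) (ℕₚ.≤-reflexive (cong (λ t → Q (suc m) + t) (sym (ℕₚ.+-identityʳ (Q (suc m))))))
    2Q≤Q⁺∸Q : 2 * Q (suc m) ≤ Q (suc (suc m)) ∸ Q (suc m)
    2Q≤Q⁺∸Q = ℕₚ.≤-trans (ℕₚ.*-monoˡ-≤ (Q (suc m)) {2} {2 + A′} (s≤s (s≤s z≤n)))
      (ℕₚ.≤-trans (ℕₚ.m≤n+m _ (Q m)) (ℕₚ.≤-reflexive (sym (Q⁺∸Q≡ m (2 + A′) a≡))))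
  block-shape m | yes a≡1 with a m ℕ.≟ 1 | a (suc (suc m)) ℕ.≟ 1
  ... | no a₋≢1 | no a₊≢1 = shaped [] (head-1-≢1 m a≡1 a₋≢1) (block-of-one m a≡1 (isOne-≢1 a₋≢1) (isOne-≢1 a₊≢1)) [-]
          (sym (last-1-≢1 m a≡1 a₊≢1))
  ... | no a₋≢1 | yes a₊≡1 =
    shaped (2 * Q (suc m) ∷ []) (head-1-≢1 m a≡1 a₋≢1) (block-of-one m a≡1 (isOne-≢1 a₋≢1) (cong isOne a₊≡1))
          ((start≤2Q , consecutive-ones-start m a≡1 a₊≡1 (Q<Q⁺ m a₋≢1)) ∷ [-]) (sym (last-1-1 m a≡1 a₊≡1))
    where
    start≤2Q : 2 * Q m + Q (suc m) ≤ 2 * Q (suc m)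
    start≤2Q = ℕₚ.≤-trans (ℕₚ.+-monoˡ-≤ (Q (suc m)) (2*Q≤Q⁺-if m a₋≢1))
      (ℕₚ.≤-reflexive (cong (λ t → Q (suc m) + t) (sym (ℕₚ.+-identityʳ (Q (suc m))))))
  ... | yes a₋≡1 | yes a₊≡1 = shaped [] (head-1-1 m a≡1 a₋≡1) (block-of-one m a≡1 (cong isOne a₋≡1) (cong isOne a₊≡1)) [-]
          (sym (last-1-1 m a≡1 a₊≡1))
  ... | yes a₋≡1 | no a₊≢1 =
    shaped (2 * Q m + Q (suc m) ∷ []) (head-1-1 m a≡1 a₋≡1) (block-of-one m a≡1 (cong isOne a₋≡1) (isOne-≢1 a₊≢1))
          ((2Q≤end m a₋≡1 , consecutive-ones-end m (proj₁ (a≡2+ (suc m) a₊≢1)) a≡1 (proj₂ (a≡2+ (suc m) a₊≢1))) ∷ [-])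
          (sym (last-1-≢1 m a≡1 a₊≢1))
    where
    2Q≤end : ∀ m → a m ≡ 1 → 2 * Q (suc m) ≤ 2 * Q m + Q (suc m)
    2Q≤end zero a₀≡1 with () ← trans (sym a₀≡0) a₀≡1
    2Q≤end (suc k) aₖ₊₁≡1 = ℕₚ.≤-trans (ℕₚ.≤-reflexive (cong (λ t → Q (suc (suc k)) + t) (ℕₚ.+-identityʳ (Q (suc (suc k))))))
      (ℕₚ.+-monoˡ-≤ (Q (suc (suc k))) (Q⁺≤2*Q k aₖ₊₁≡1))

  junction : ∀ m → Step (blockLast m) (blockHead (suc m))
  junction m with a (suc m) ℕ.≟ 1 | a (suc (suc m)) ℕ.≟ 1
  ... | yes a≡1 | yes a₊≡1 = subst₂ Step (sym (last-1-1 m a≡1 a₊≡1)) (sym (head-1-1 (suc m) a₊≡1 a≡1))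
        (ℕₚ.*-monoʳ-≤ 2 (Q-step (suc m)) , consecutive-across-one-one m (proj₁ (a≡suc (suc (suc m)))) a≡1 a₊≡1 (proj₂ (a≡suc (suc (suc m)))))
  ... | yes a≡1 | no a₊≢1 = subst₂ Step (sym (last-1-≢1 m a≡1 a₊≢1)) (sym (head-≢1 (suc m) a₊≢1))
        (end≤mediant , consecutive-across-one-big m (proj₁ (a≡2+ (suc m) a₊≢1)) a≡1 (proj₂ (a≡2+ (suc m) a₊≢1)))
    where
    end≤mediant : 2 * Q m + Q (suc m) ≤ Q (suc m) + Q (suc (suc m))
    end≤mediant = begin
      2 * Q m + Q (suc m)             ≡⟨ ℕₚ.+-comm (2 * Q m) (Q (suc m)) ⟩
      Q (suc m) + 2 * Q m             ≤⟨ ℕₚ.+-monoʳ-≤ (Q (suc m)) (ℕₚ.+-monoʳ-≤ (Q m) (ℕₚ.≤-trans (ℕₚ.≤-reflexive (ℕₚ.+-identityʳ (Q m))) (Q-step m))) ⟩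
      Q (suc m) + (Q m + Q (suc m))   ≡⟨ cong (λ t → Q (suc m) + t) (ℕₚ.+-comm (Q m) (Q (suc m))) ⟩
      Q (suc m) + (Q (suc m) + Q m)   ≡⟨ cong (λ t → Q (suc m) + (t + Q m)) (sym (trans (cong (_* Q (suc m)) a≡1) (ℕₚ.*-identityˡ (Q (suc m))))) ⟩
      Q (suc m) + Q (suc (suc m))     ∎
      where open ℕₚ.≤-Reasoning
  ... | no a≢1 | yes a₊≡1 = subst₂ Step (sym (last-≢1 m a≢1)) (sym (head-1-≢1 (suc m) a₊≡1 a≢1))
        (ℕₚ.≤-trans (ℕₚ.m∸n≤m (Q (suc (suc m))) (Q (suc m))) (ℕₚ.m≤n+m _ (2 * Q (suc m)))
        , consecutive-across-big-one m (proj₁ (a≡suc (suc (suc m)))) (2≤a m a≢1) a₊≡1 (proj₂ (a≡suc (suc (suc m)))))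
  ... | no a≢1 | no a₊≢1 = subst₂ Step (sym (last-≢1 m a≢1)) (sym (head-≢1 (suc m) a₊≢1))
        (ℕₚ.≤-trans (ℕₚ.m∸n≤m (Q (suc (suc m))) (Q (suc m))) (ℕₚ.m≤n+m _ (Q (suc m)))
        , consecutive-across-big-big m (proj₁ (a≡2+ (suc m) a₊≢1)) (2≤a m a≢1) (proj₂ (a≡2+ (suc m) a₊≢1)))

  blockLast≤ : ∀ m → blockLast m ≤ 2 * Q (suc (suc m))
  blockLast≤ m with a (suc m) ℕ.≟ 1 | a (suc (suc m)) ℕ.≟ 1
  ... | no a≢1 | _ = subst (_≤ 2 * Q (suc (suc m))) (sym (last-≢1 m a≢1))
        (ℕₚ.≤-trans (ℕₚ.m∸n≤m (Q (suc (suc m))) (Q (suc m))) (ℕₚ.m≤m+n (Q (suc (suc m))) _))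
  ... | yes a≡1 | yes a₊≡1 = subst (_≤ 2 * Q (suc (suc m))) (sym (last-1-1 m a≡1 a₊≡1)) (ℕₚ.*-monoʳ-≤ 2 (Q-step (suc m)))
  ... | yes a≡1 | no a₊≢1 = subst (_≤ 2 * Q (suc (suc m))) (sym (last-1-≢1 m a≡1 a₊≢1)) (begin
      2 * Q m + Q (suc m)          ≤⟨ ℕₚ.+-monoʳ-≤ (2 * Q m) (ℕₚ.m≤m+n (Q (suc m)) _) ⟩
      2 * Q m + 2 * Q (suc m)      ≡⟨ regroup (Q m) (Q (suc m)) ⟩
      2 * (1 * Q (suc m) + Q m)    ≡⟨ cong (λ A → 2 * (A * Q (suc m) + Q m)) a≡1 ⟨
      2 * Q (suc (suc m))          ∎)
    where
    open ℕₚ.≤-Reasoning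
    regroup : ∀ x y → 2 * x + 2 * y ≡ 2 * (1 * y + x)
    regroup = ℕ-solve-∀

  mediant≤blockHead : ∀ m → Q m + Q (suc m) ≤ blockHead m
  mediant≤blockHead m with a (suc m) ℕ.≟ 1 | a m ℕ.≟ 1
  ... | no a≢1 | _ = ℕₚ.≤-reflexive (sym (head-≢1 m a≢1))
  ... | yes a≡1 | yes a₋≡1 = subst (Q m + Q (suc m) ≤_) (sym (head-1-1 m a≡1 a₋≡1))
        (ℕₚ.≤-trans (ℕₚ.+-monoˡ-≤ (Q (suc m)) (Q-step m)) (ℕₚ.≤-reflexive (cong (λ t → Q (suc m) + t) (sym (ℕₚ.+-identityʳ (Q (suc m)))))))
  ... | yes a≡1 | no a₋≢1 =
    subst (Q m + Q (suc m) ≤_) (sym (head-1-≢1 m a≡1 a₋≢1)) (ℕₚ.+-monoˡ-≤ (Q (suc m)) (ℕₚ.m≤m+n (Q m) _))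

  blockLast-increasing : ∀ n → blockLast n < blockLast (suc (suc n))
  blockLast-increasing n = begin-strict
    blockLast n                                          ≤⟨ blockLast≤ n ⟩
    2 * Q (suc (suc n))                                  ≡⟨ cong (λ t → Q (suc (suc n)) + t) (ℕₚ.+-identityʳ _) ⟩
    Q (suc (suc n)) + Q (suc (suc n))                    <⟨ ℕₚ.+-monoʳ-< (Q (suc (suc n))) (Q-strict n) ⟩
    Q (suc (suc n)) + Q (suc (suc (suc n)))              ≤⟨ mediant≤blockHead (suc (suc n)) ⟩
    blockHead (suc (suc n))                              ≤⟨ head≤last proj₁ _ rest linked ⟩
    last (blockHead (suc (suc n))) rest                  ≡⟨ last≡ ⟩
    blockLast (suc (suc n))                              ∎
    where
    open ℕₚ.≤-Reasoning
    open BlockShape (block-shape (suc (suc n)))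

  blocks : ℕ → List ℕ
  blocks N = concat (map (block a) (upTo N))

  blocks-suc : ∀ N → blocks (suc N) ≡ blocks N ++ block a N
  blocks-suc N = begin
      concat (map (block a) (upTo (suc N)))               ≡⟨ cong (λ t → concat (map (block a) t)) (Listₚ.upTo-∷ʳ N) ⟨
      concat (map (block a) (upTo N ∷ʳ N))                ≡⟨ cong concat (Listₚ.map-++ (block a) (upTo N) (N ∷ [])) ⟩
      concat (map (block a) (upTo N) ++ block a N ∷ [])   ≡⟨ Listₚ.concat-++ (map (block a) (upTo N)) (block a N ∷ []) ⟨
      blocks N ++ concat (block a N ∷ [])                 ≡⟨ cong (blocks N ++_) (Listₚ.++-identityʳ (block a N)) ⟩
      blocks N ++ block a N                               ∎
    where open ≡-Reasoning

  blocks-shape : ∀ n → ∃ λ t → blocks (suc n) ≡ blockHead 0 ∷ t × Linked Step (blockHead 0 ∷ t) × last (blockHead 0) t ≡ blockLast n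
  blocks-shape zero = rest , trans (Listₚ.++-identityʳ (block a 0)) block≡ , linked , last≡
    where open BlockShape (block-shape 0)
  blocks-shape (suc n) with blocks-shape n | block-shape (suc n)
  ... | t , blocks≡ , linked-t , last-t | shape = t ++ blockHead (suc n) ∷ rest
      , trans (blocks-suc (suc n)) (cong₂ _++_ blocks≡ block≡)
      , Linked-++ _ t _ rest linked-t linked (subst (λ x → Step x (blockHead (suc n))) (sym last-t) (junction n))
      , trans (last-++ _ t _ rest) last≡
    where open BlockShape shape

  open Derun ℕ._≟_

  word-shape : ∀ n → ∃ λ r → word a (suc n) ≡ blockHead 0 ∷ r ×
    Linked (λ u w → u ≢ w × Step u w) (blockHead 0 ∷ r) × last (blockHead 0) r ≡ blockLast n
  word-shape n with blocks-shape n
  ... | t , blocks≡ , linked , last-t with derun-∷ (blockHead 0) t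
  ... | r , dr≡ , last-r = r , trans (cong dr blocks≡) dr≡ , subst (Linked _) dr≡ (derun-Linked linked) , trans last-r last-t

  word-extends : ∀ N → ∃ λ r → word a (suc N) ≡ word a N ++ r
  word-extends N = let (r , dr≡) = derun-++ (blocks N) (block a N) in r , trans (cong dr (blocks-suc N)) dr≡

  word-last : ∀ n → Data.List.last (word a (suc n)) ≡ just (blockLast n)
  word-last n = let (r , W≡ , _ , last≡) = word-shape n in
    trans (cong Data.List.last W≡) (trans (last-just (blockHead 0) r) (cong just last≡))

  word-grows : ∀ n → length (word a (suc n)) < length (word a (suc (suc (suc n))))
  word-grows n with word-extends (suc n) | word-extends (suc (suc n))
  ... | r , W₂≡ | r′ , W₃≡ with r ++ r′ | Listₚ.++-assoc (word a (suc n)) r r′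
  ... | [] | assoc = ⊥-elim (ℕₚ.<⇒≢ (blockLast-increasing n) (just-injective (begin
      just (blockLast n)                              ≡⟨ word-last n ⟨
      Data.List.last (word a (suc n))                 ≡⟨ cong Data.List.last W₁≡W₃ ⟩
      Data.List.last (word a (suc (suc (suc n))))     ≡⟨ word-last (suc (suc n)) ⟩
      just (blockLast (suc (suc n)))                  ∎)))
    where
    open ≡-Reasoning
    W₁≡W₃ : word a (suc n) ≡ word a (suc (suc (suc n)))
    W₁≡W₃ = sym (trans W₃≡ (trans (cong (_++ r′) W₂≡) (trans assoc (Listₚ.++-identityʳ _))))
  ... | _ ∷ _ | assoc = subst (length (word a (suc n)) <_)
      (sym (trans (cong length (trans W₃≡ (trans (cong (_++ r′) W₂≡) assoc))) (Listₚ.length-++ (word a (suc n)))))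
      (ℕₚ.m<m+n _ (s≤s z≤n))

  word-long : ∀ k → k < length (word a (suc (2 * k)))
  word-long zero = let (_ , W≡ , _) = word-shape 0 in subst (λ w → 0 < length w) (sym W≡) (s≤s z≤n)
  word-long (suc k) rewrite ℕₚ.+-suc k (k + 0) = ℕₚ.≤-trans (s≤s (word-long k)) (word-grows (2 * k))

  blockHead₀≡1 : blockHead 0 ≡ 1
  blockHead₀≡1 rewrite a₀≡0 with isOne (a 1)
  ... | true = refl
  ... | false = refl

  -- The paper's sequence 𝔮₁ = 1 < 𝔮₂ < ⋯, indexed from 0.
  𝔮 : ℕ → ℕ
  𝔮 = proj₁ (prefix-chain-limit (word a) word-extends word-long)

  word≡𝔮-prefix : ∀ N → word a N ≡ map 𝔮 (upTo (length (word a N)))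
  word≡𝔮-prefix = proj₂ (prefix-chain-limit (word a) word-extends word-long)

  at-word : ∀ N i → i < length (word a N) → at (word a N) i ≡ 𝔮 i
  at-word N i i<n = trans (cong (λ w → at w i) (word≡𝔮-prefix N)) (at-map-upTo 𝔮 _ i i<n)

  𝔮₀≡1 : 𝔮 0 ≡ 1
  𝔮₀≡1 = let (_ , W₁≡ , _) = word-shape 0 in
    trans (sym (at-word 1 0 (word-long 0))) (trans (cong (λ w → at w 0) W₁≡) blockHead₀≡1)

  𝔮-step : ∀ i → 𝔮 i ≢ 𝔮 (suc i) × Step (𝔮 i) (𝔮 (suc i))
  𝔮-step i = let (_ , W≡ , linked , _) = word-shape (2 * suc i) in
    subst₂ (λ u w → u ≢ w × Step u w) (at-word N i (ℕₚ.<⇒≤ (word-long (suc i)))) (at-word N (suc i) (word-long (suc i)))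
      (Linked-at (subst (Linked _) (sym W≡) linked) i (word-long (suc i)))
    where
    N = suc (2 * suc i)

  𝔮-increasing : ∀ i → 𝔮 i < 𝔮 (suc i)
  𝔮-increasing i = let (𝔮ᵢ≢𝔮ᵢ₊₁ , 𝔮ᵢ≤𝔮ᵢ₊₁ , _) = 𝔮-step i in ℕₚ.≤∧≢⇒< 𝔮ᵢ≤𝔮ᵢ₊₁ 𝔮ᵢ≢𝔮ᵢ₊₁

  𝔮-consecutive : ∀ i → Consecutive a (𝔮 i) (𝔮 (suc i))
  𝔮-consecutive i = proj₂ (proj₂ (𝔮-step i))

mainTheorem1 : (a : ℕ → ℕ) → a 0 ≡ 0 → ((n : ℕ) → 1 ≤ a (suc n)) →
    Σ (ℕ → ℕ) λ Q → IsIncreasingEnumeration (InQ a) Q ×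
    ((N : ℕ) → word a N ≡ map Q (upTo (length (word a N)))) ×
    ((k : ℕ) → ∃ λ N → k < length (word a N))
mainTheorem1 a a₀≡0 ha =
  𝔮 , consecutive-chain-enumerates a 𝔮 𝔮₀≡1 𝔮-increasing 𝔮-consecutive , word≡𝔮-prefix , λ k → suc (2 * k) , word-long k
  where open Blocks a a₀≡0 ha
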